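{- Let $w\in S_n$ and let $R$ be an rc-graph for $w$. Run the following procedure. Set $R':=R_{\rm bot}(w)$. For $i=1,\ldots,n-1$, and for $j$ from $n-i$ down to $1$: if $(i,j)\in R\setminus R'$, let $(k,l)$ be the position at which the two lines of the line diagram of $R'$ that meet without crossing at $(i,j)$ cross each other, and replace $R'$ by $R'\cup\{(i,j)\}\setminus\{(k,l)\}$. Then at every such replacement step, the new set $R'\cup\{(i,j)\}\setminus\{(k,l)\}$ is obtained from the current $R'$ by a sequence of L-moves which moves the cross in position $(k,l)$ into position $(i,j)$.
   Context: For $w=w_1\ldots w_n\in S_n$, an rc-graph for $w$ is a subset $R\subseteq\{(i,j)\in\mathbb{Z}_{>0}^2: i+j\le n\}$ such that, listing its elements $(i_1,j_1),(i_2,j_2),\ldots$ in the linear order $(i,j)\le(i',j')\iff i<i'$ or ($i=i'$ and $j\ge j'$), the word $a_1a_2\ldots a_\ell$ with $a_k=i_k+j_k-1$ is a reduced word for $w$. Elements of $R$ are called crosses; $(i,j)$ is in row $i$ and column $j$ (matrix coordinates, row 1 on top). The line diagram of $R$ consists of $n$ lines going up and to the right: the $i$th line starts at the left of position $(i,1)$ and ends at the top of position $(1,w_i)$; two lines meeting at a position $(i,j)$ cross there if $(i,j)\in R$, and otherwise avoid each other (touch and turn) there. The code of $w$ is $(c_1,\ldots,c_{n-1})$ with $c_i=|\{j>i: w_j<w_i\}|$, and $R_{\rm bot}(w):=\{(i,j): 1\le j\le c_i\}$ (an rc-graph for $w$). A ladder move applies to a cross $(i,j)\in R$ when there is $m\ge1$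 with $(i,j+1)\notin R$, $(i-k,j),(i-k,j+1)\in R$ for $1\le k<m$, and $(i-m,j),(i-m,j+1)\notin R$; it replaces $R$ by $R\setminus\{(i,j)\}\cup\{(i-m,j+1)\}$. An L-move is a ladder move applied to the rightmost cross in its row (i.e. $(i,l)\notin R$ for all $l>j$). -}

module Defs where

open import Data.Nat using (ℕ; zero; suc; _+_; _*_; _∸_; _≤_; _<_; _<ᵇ_; _≤ᵇ_; _≡ᵇ_)
open import Data.Bool using (Bool; true; false; if_then_else_; _∧_)
open import Data.List using (List; []; _∷_; map; concatMap; upTo; drop; length)
open import Data.List.Relation.Unary.All using (All)
open import Data.List.Relation.Binary.Permutation.Propositional using (_↭_)
open import Data.List.Membership.Propositional using (_∈_)
open import Data.Product using (_×_; _,_; Σ; ∃)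
open import Data.Sum using (_⊎_)
open import Relation.Binary.PropositionalEquality using (_≡_)

-- Permutations of {1,…,n} in one-line notation w = w₁ … wₙ (a list).

oneToN : ℕ → List ℕ
oneToN n = map suc (upTo n)

IsPerm : ℕ → List ℕ → Set
IsPerm n w = w ↭ oneToN n

-- 1-indexed entry w_i (default 0 out of range)
at : List ℕ → ℕ → ℕ
at []       _             = 0
at (x ∷ xs) zero          = 0
at (x ∷ xs) (suc zero)    = x
at (x ∷ xs) (suc (suc i)) = at xs (suc i)

countLt : ℕ → List ℕ → ℕ
countLt x []       = 0
countLt x (y ∷ ys) = if y <ᵇ x then suc (countLt x ys) else countLt x ys

-- code: c_i = #{ j > i : w_j < w_i }   (1-indexed; 0 for i = 0)
codeAt : List ℕ → ℕ → ℕ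
codeAt w zero    = 0
codeAt w (suc i) = countLt (at w (suc i)) (drop (suc i) w)

-- Reduced words.  Letter a stands for s_a; the word a₁…a_ℓ represents
-- s_{a₁} s_{a₂} ⋯ s_{a_ℓ}; right multiplication by s_a swaps the entries
-- in positions a, a+1 of the one-line notation.

swapAt : ℕ → List ℕ → List ℕ
swapAt (suc zero)    (x ∷ y ∷ xs) = y ∷ x ∷ xs
swapAt (suc (suc k)) (x ∷ xs)     = x ∷ swapAt (suc k) xs
swapAt _             xs           = xs

applyWord : List ℕ → List ℕ → List ℕ
applyWord u []       = u
applyWord u (a ∷ as) = applyWord (swapAt a u) as

IsWordFor : ℕ → List ℕ → List ℕ → Set
IsWordFor n w as = All (λ a → 1 ≤ a × a < n) as × applyWord (oneToN n) as ≡ w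

IsReducedWord : ℕ → List ℕ → List ℕ → Set
IsReducedWord n w as = IsWordFor n w as × (∀ bs → IsWordFor n w bs → length as ≤ length bs)

-- Subsets of ℤ_{>0}² as characteristic functions (row i, column j).

Grid : Set
Grid = ℕ → ℕ → Bool

_≐_ : Grid → Grid → Set
S ≐ T = ∀ i j → S i j ≡ T i j

insert : ℕ → ℕ → Grid → Grid
insert i j S x y = if (x ≡ᵇ i) ∧ (y ≡ᵇ j) then true else S x y

remove : ℕ → ℕ → Grid → Grid
remove i j S x y = if (x ≡ᵇ i) ∧ (y ≡ᵇ j) then false else S x y

Pos : Set
Pos = ℕ × ℕ

desc : ℕ → List ℕ
desc zero    = []
desc (suc k) = suc k ∷ desc k

-- the positions {(i,j) : i,j ≥ 1, i + j ≤ n} in the linear order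
-- (i,j) ≤ (i',j') iff i < i' or (i = i' and j ≥ j')
positions : ℕ → List Pos
positions n = concatMap (λ i → map (λ j → (i , j)) (desc (n ∸ i))) (oneToN (n ∸ 1))

rcWord : ℕ → Grid → List ℕ
rcWord n R = concatMap (λ p → f p) (positions n)
  where
  f : Pos → List ℕ
  f (i , j) = if R i j then (i + j ∸ 1) ∷ [] else []

IsRCGraph : ℕ → List ℕ → Grid → Set
IsRCGraph n w R =
  (∀ i j → R i j ≡ true → 1 ≤ i × 1 ≤ j × i + j ≤ n) × IsReducedWord n w (rcWord n R)

Rbot : List ℕ → Grid
Rbot w i j = (1 ≤ᵇ j) ∧ (j ≤ᵇ codeAt w i)

-- A line enters a tile from the left or from the bottom.
-- Cross: left → right, bottom → top.  Non-cross: left → top, bottom → right.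
-- Line t starts at the left of (t,1); a line leaving the top of row 1 ends.

data Dir : Set where
  fromLeft fromBottom : Dir

trace : Grid → ℕ → ℕ → ℕ → Dir → List (Pos × Dir)
trace S zero     i j d = []
trace S (suc f) i j d = ((i , j) , d) ∷ next (S i j) d
  where
  goRight goUp : List (Pos × Dir)
  goRight = trace S f i (suc j) fromLeft
  up : ℕ → List (Pos × Dir)
  up (suc (suc i')) = trace S f (suc i') j fromBottom
  up _              = []
  goUp = up i
  next : Bool → Dir → List (Pos × Dir)
  next true  fromLeft   = goRight
  next true  fromBottom = goUp
  next false fromLeft   = goUp
  next false fromBottom = goRight

-- the tiles visited by line t (1 ≤ t ≤ n), with entry sides;
-- 2n steps suffice for a line to reach the top of the diagram
lineOf : ℕ → Grid → ℕ → List (Pos × Dir)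
lineOf n S t = trace S (2 * n) t 1 fromLeft

Enters : ℕ → Grid → ℕ → Pos → Dir → Set
Enters n S t p d = 1 ≤ t × t ≤ n × (p , d) ∈ lineOf n S t

MeetNoCross : ℕ → Grid → ℕ → ℕ → ℕ → ℕ → Set
MeetNoCross n S i j a b =
  S i j ≡ false × Enters n S a (i , j) fromLeft × Enters n S b (i , j) fromBottom

CrossAt : ℕ → Grid → ℕ → ℕ → ℕ → ℕ → Set
CrossAt n S a b k l =
  S k l ≡ true ×
  ((Enters n S a (k , l) fromLeft × Enters n S b (k , l) fromBottom) ⊎
   (Enters n S a (k , l) fromBottom × Enters n S b (k , l) fromLeft))

SwapData : ℕ → Grid → ℕ → ℕ → ℕ → ℕ → Set
SwapData n S i j k l = Σ ℕ λ a → Σ ℕ λ b → MeetNoCross n S i j a b × CrossAt n S a b k l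

IsLadderMove : Grid → ℕ → ℕ → ℕ → Set
IsLadderMove S i j m =
  S i j ≡ true × 1 ≤ m × m < i × S i (suc j) ≡ false ×
  (∀ k → 1 ≤ k → k < m → S (i ∸ k) j ≡ true × S (i ∸ k) (suc j) ≡ true) ×
  S (i ∸ m) j ≡ false × S (i ∸ m) (suc j) ≡ false

ladder : Grid → ℕ → ℕ → ℕ → Grid
ladder S i j m = insert (i ∸ m) (suc j) (remove i j S)

IsLMove : Grid → ℕ → ℕ → ℕ → Set
IsLMove S i j m = IsLadderMove S i j m × (∀ l → j < l → S i l ≡ false)

-- LChain S i j i' j' T : a sequence of L-moves, each applied to the current
-- position of one tracked cross, moves that cross from (i,j) to (i',j')
-- and turns S into T
data LChain : Grid → ℕ → ℕ → ℕ → ℕ → Grid → Set where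
  done : ∀ {S T i j} → S ≐ T → LChain S i j i j T
  step : ∀ {S T i j i' j'} (m : ℕ) → IsLMove S i j m →
         LChain (ladder S i j m) (i ∸ m) (suc j) i' j' T →
         LChain S i j i' j' T

-- The procedure.  Proc n w R S ps : the current set R' is S and the
-- positions still to be processed are ps (in the order of `positions n`).

data Proc (n : ℕ) (w : List ℕ) (R : Grid) : Grid → List Pos → Set where
  start : Proc n w R (Rbot w) (positions n)
  skip  : ∀ {S i j ps} → Proc n w R S ((i , j) ∷ ps) →
          (R i j ≡ true → S i j ≡ true) → Proc n w R S ps
  swap  : ∀ {S i j ps} k l → Proc n w R S ((i , j) ∷ ps) →
          R i j ≡ true → S i j ≡ false → SwapData n S i j k l →
          Proc n w R (remove k l (insert i j S)) ps

-- Lines are tracked through labellings of diagonals: `below G n r p` is the line of the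
-- line diagram of G on diagonal p of the cut above row r + 1, and a cross at (r, c + 1)
-- exchanges the lines on diagonals r + c and r + c + 1.  The procedure keeps an invariant:
-- S agrees with R on the processed positions, the unprocessed rows of S are left-justified,
-- and S and R carry the same lines across the cut at the current position.  Since R_bot(w)
-- has inv(w) crosses, the reduced reading word of R lowers the inversion number at every
-- letter, so two lines of R cross at most once.  At a swap step the lines a (from the left)
-- and b (from below) meet without crossing in S.  Traced downwards through the left-justified
-- rows, they stay in the same two columns across rows filled there and move one column to
-- the left across rows empty there, until they cross at the last cross (b, l) of row b.
-- Read upwards, each stretch of filled rows is the ladder of an L-move (rows are
-- left-justified, so the moving cross is rightmost in its row), and these moves carry the
-- cross from (b, l) to (i, j).

module Submission where

open import Defs
open import Data.Nat
open import Data.Nat.Properties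
open import Data.Bool using (Bool; true; false; if_then_else_; _∧_; T)
open import Data.List using (List; []; _∷_; _++_; length; reverse; map; drop; concatMap; applyUpTo; upTo)
open import Data.List.Properties using (++-assoc; ++-identityʳ; reverse-++; unfold-reverse; concatMap-++; map-applyUpTo; map-id; length-++; length-reverse; length-map; length-applyUpTo; length-drop)
open import Data.List.Relation.Unary.All using (All; []; _∷_)
open import Data.List.Relation.Unary.All.Properties using (++⁺)
open import Data.List.Relation.Unary.Any using (here; there)
open import Data.List.Membership.Propositional using (_∈_)
open import Data.List.Relation.Binary.Permutation.Propositional using (_↭_)
import Data.List.Relation.Binary.Permutation.Propositional as ↭
open import Data.List.Relation.Binary.Permutation.Propositional.Properties using (∈-resp-↭; ↭-length)
open import Data.Product using (_×_; _,_; Σ; proj₁; proj₂)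
open import Data.Sum using (_⊎_; inj₁; inj₂)
open import Data.Unit using (⊤; tt)
open import Data.Empty using (⊥; ⊥-elim)
open import Function using (id; _∘_)
open import Relation.Nullary using (¬_; yes; no)
open import Relation.Binary.PropositionalEquality
open import Relation.Binary.Definitions using (Tri; tri<; tri≈; tri>)

true≢false : true ≢ false
true≢false ()

≡ᵇ-refl : ∀ x → (x ≡ᵇ x) ≡ true
≡ᵇ-refl zero = refl
≡ᵇ-refl (suc x) = ≡ᵇ-refl x

≡ᵇ-≢ : ∀ {x y} → x ≢ y → (x ≡ᵇ y) ≡ false
≡ᵇ-≢ {x} {y} ne with x ≡ᵇ y in e
... | false = refl
... | true = ⊥-elim (ne (≡ᵇ⇒≡ x y (subst T (sym e) tt)))

≡ᵇ∧≡ᵇ⇒≡ : ∀ x y i j → ((x ≡ᵇ i) ∧ (y ≡ᵇ j)) ≡ true → x ≡ i × y ≡ j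
≡ᵇ∧≡ᵇ⇒≡ x y i j e with x ≡ᵇ i in ei | y ≡ᵇ j in ej
... | true | true = ≡ᵇ⇒≡ x i (subst T (sym ei) tt) , ≡ᵇ⇒≡ y j (subst T (sym ej) tt)
... | true | false = ⊥-elim (true≢false (sym e))
... | false | _ = ⊥-elim (true≢false (sym e))

<ᵇ-true : ∀ {x y} → x < y → (x <ᵇ y) ≡ true
<ᵇ-true {x} {y} lt with x <ᵇ y in e
... | true = refl
... | false = ⊥-elim (subst T e (<⇒<ᵇ lt))

<ᵇ-false : ∀ {x y} → y ≤ x → (x <ᵇ y) ≡ false
<ᵇ-false {x} {y} le with x <ᵇ y in e
... | false = refl
... | true = ⊥-elim (<⇒≱ (<ᵇ⇒< x y (subst T (sym e) tt)) le)

m∸n≡1+[m∸1+n] : ∀ m n → n < m → m ∸ n ≡ suc (m ∸ suc n)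
m∸n≡1+[m∸1+n] (suc m) zero _ = refl
m∸n≡1+[m∸1+n] (suc m) (suc n) (s≤s n<m) = m∸n≡1+[m∸1+n] m n n<m

-- Adjacent transpositions acting on labellings

transpose : ℕ → ℕ → ℕ
transpose d p with p ≟ d
... | yes _ = suc d
... | no _ with p ≟ suc d
...   | yes _ = d
...   | no _ = p

transpose-matchˡ : ∀ d → transpose d d ≡ suc d
transpose-matchˡ d with d ≟ d
... | yes _ = refl
... | no ne = ⊥-elim (ne refl)

transpose-matchʳ : ∀ d → transpose d (suc d) ≡ d
transpose-matchʳ d with suc d ≟ d
... | yes e = ⊥-elim (<-irrefl (sym e) (n<1+n d))
... | no _ with suc d ≟ suc d
...   | yes _ = refl
...   | no ne = ⊥-elim (ne refl)

transpose-noMatch : ∀ d p → p ≢ d → p ≢ suc d → transpose d p ≡ p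
transpose-noMatch d p n1 n2 with p ≟ d
... | yes e = ⊥-elim (n1 e)
... | no _ with p ≟ suc d
...   | yes e = ⊥-elim (n2 e)
...   | no _ = refl

transpose-below : ∀ d p → p < d → transpose d p ≡ p
transpose-below d p lt = transpose-noMatch d p (λ e → <-irrefl e lt) (λ e → <-irrefl e (m<n⇒m<1+n lt))

transpose-above : ∀ d p → suc d < p → transpose d p ≡ p
transpose-above d p lt = transpose-noMatch d p (λ e → <-irrefl (sym e) (<-trans (n<1+n d) lt)) (λ e → <-irrefl (sym e) lt)

transpose-involutive : ∀ d p → transpose d (transpose d p) ≡ p
transpose-involutive d p with p ≟ d
... | yes refl = transpose-matchʳ d
... | no n1 with p ≟ suc d
...   | yes refl = transpose-matchˡ d
...   | no n2 = transpose-noMatch d p n1 n2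

transpose-injective : ∀ d p q → transpose d p ≡ transpose d q → p ≡ q
transpose-injective d p q e = trans (sym (transpose-involutive d p)) (trans (cong (transpose d) e) (transpose-involutive d q))

transpose-suc : ∀ d p → transpose (suc d) (suc p) ≡ suc (transpose d p)
transpose-suc d p with p ≟ d
... | yes refl = transpose-matchˡ (suc p)
... | no n1 with p ≟ suc d
...   | yes refl = transpose-matchʳ (suc d)
...   | no n2 = transpose-noMatch (suc d) (suc p) (λ e → n1 (suc-injective e)) (λ e → n2 (suc-injective e))

transpose-inRange : ∀ lo hi d p → lo ≤ d → suc d ≤ hi → lo ≤ p → p ≤ hi → lo ≤ transpose d p × transpose d p ≤ hi
transpose-inRange lo hi d p l1 l2 l3 l4 with p ≟ d
... | yes refl = ≤-trans l1 (n≤1+n d) , l2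
... | no n1 with p ≟ suc d
...   | yes refl = l1 , ≤-trans (n≤1+n d) l2
...   | no n2 = l3 , l4

Labelling : Set
Labelling = ℕ → ℕ

swapF : ℕ → Labelling → Labelling
swapF d f p = f (transpose d p)

swapF-cong : ∀ d {f g : Labelling} → f ≗ g → swapF d f ≗ swapF d g
swapF-cong d e p = e (transpose d p)

swapF-involutive : ∀ d (f : Labelling) → swapF d (swapF d f) ≗ f
swapF-involutive d f p = cong f (transpose-involutive d p)

applyWordF : Labelling → List ℕ → Labelling
applyWordF f [] = f
applyWordF f (a ∷ as) = applyWordF (swapF a f) as

applyWordF-++ : ∀ f xs ys → applyWordF f (xs ++ ys) ≡ applyWordF (applyWordF f xs) ys
applyWordF-++ f [] ys = refl
applyWordF-++ f (x ∷ xs) ys = applyWordF-++ (swapF x f) xs ys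

applyWordF-cong : ∀ {f g : Labelling} as → f ≗ g → applyWordF f as ≗ applyWordF g as
applyWordF-cong [] e = e
applyWordF-cong (a ∷ as) e = applyWordF-cong as (swapF-cong a e)

applyWordF-∘ : ∀ (f : Labelling) as p → applyWordF f as p ≡ f (applyWordF id as p)
applyWordF-∘ f [] p = refl
applyWordF-∘ f (a ∷ as) p = trans (applyWordF-∘ (swapF a f) as p) (cong (λ z → f z) (sym (applyWordF-∘ (swapF a id) as p)))

applyWordF-reverseʳ : ∀ (f : Labelling) as → applyWordF (applyWordF f as) (reverse as) ≗ f
applyWordF-reverseʳ f [] p = refl
applyWordF-reverseʳ f (a ∷ as) p = begin
    applyWordF (applyWordF (swapF a f) as) (reverse (a ∷ as)) p
  ≡⟨ cong (λ z → applyWordF (applyWordF (swapF a f) as) z p) (Data.List.Properties.unfold-reverse a as) ⟩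
    applyWordF (applyWordF (swapF a f) as) (reverse as ++ a ∷ []) p
  ≡⟨ cong (λ h → h p) (applyWordF-++ (applyWordF (swapF a f) as) (reverse as) (a ∷ [])) ⟩
    swapF a (applyWordF (applyWordF (swapF a f) as) (reverse as)) p
  ≡⟨ applyWordF-reverseʳ (swapF a f) as (transpose a p) ⟩
    swapF a (swapF a f) p
  ≡⟨ swapF-involutive a f p ⟩
    f p ∎
  where open ≡-Reasoning

applyWordF-reverseˡ : ∀ (f : Labelling) as → applyWordF (applyWordF f (reverse as)) as ≗ f
applyWordF-reverseˡ f as p = trans (cong (λ z → applyWordF (applyWordF f (reverse as)) z p) (sym (Data.List.Properties.reverse-involutive as))) (applyWordF-reverseʳ f (reverse as) p)

MapsInto : Labelling → ℕ → ℕ → Set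
MapsInto f lo hi = ∀ p → lo ≤ p → p ≤ hi → lo ≤ f p × f p ≤ hi

swapF-mapsInto : ∀ d f lo hi → lo ≤ d → suc d ≤ hi → MapsInto f lo hi → MapsInto (swapF d f) lo hi
swapF-mapsInto d f lo hi l1 l2 mf p a b = let (x , y) = transpose-inRange lo hi d p l1 l2 a b in mf _ x y

Letters : ℕ → List ℕ → Set
Letters n as = All (λ a → 1 ≤ a × a < n) as

applyWordF-mapsInto : ∀ f as n → Letters n as → MapsInto f 1 n → MapsInto (applyWordF f as) 1 n
applyWordF-mapsInto f [] n _ mf = mf
applyWordF-mapsInto f (a ∷ as) n ((l1 , l2) ∷ ls) mf = applyWordF-mapsInto (swapF a f) as n ls (swapF-mapsInto a f 1 n l1 l2 mf)

id-mapsInto : ∀ lo hi → MapsInto id lo hi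
id-mapsInto lo hi p a b = a , b


swapAt-length : ∀ a u → length (swapAt a u) ≡ length u
swapAt-length zero u = refl
swapAt-length (suc zero) [] = refl
swapAt-length (suc zero) (x ∷ []) = refl
swapAt-length (suc zero) (x ∷ y ∷ u) = refl
swapAt-length (suc (suc a)) [] = refl
swapAt-length (suc (suc a)) (x ∷ u) = cong suc (swapAt-length (suc a) u)

at-swapAt : ∀ a u → 1 ≤ a → a < length u → ∀ p → at (swapAt a u) p ≡ at u (transpose a p)
at-swapAt (suc zero) (x ∷ y ∷ u) _ _ zero = refl
at-swapAt (suc zero) (x ∷ y ∷ u) _ _ (suc zero) rewrite transpose-matchˡ 1 = refl
at-swapAt (suc zero) (x ∷ y ∷ u) _ _ (suc (suc zero)) rewrite transpose-matchʳ 1 = refl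
at-swapAt (suc zero) (x ∷ y ∷ u) _ _ (suc (suc (suc p))) rewrite transpose-above 1 (3 + p) (s≤s (s≤s (s≤s z≤n))) = refl
at-swapAt (suc zero) (x ∷ []) _ (s≤s ()) p
at-swapAt (suc (suc a)) (x ∷ u) _ _ zero = refl
at-swapAt (suc (suc a)) (x ∷ u) _ _ (suc zero) rewrite transpose-below (2 + a) 1 (s≤s (s≤s z≤n)) = refl
at-swapAt (suc (suc a)) (x ∷ u) _ (s≤s lt) (suc (suc p))
  rewrite transpose-suc (suc a) (suc p) = trans (at-swapAt (suc a) u (s≤s z≤n) lt (suc p)) (trans (cong (at u) (transpose-suc a p)) (sym (cong (λ k → at (x ∷ u) (suc k)) (transpose-suc a p))))

at-applyWord : ∀ n u as → length u ≡ n → Letters n as → ∀ p → at (applyWord u as) p ≡ applyWordF (at u) as p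
at-applyWord n u [] _ _ p = refl
at-applyWord n u (a ∷ as) lu ((l1 , l2) ∷ ls) p =
  trans (at-applyWord n (swapAt a u) as (trans (swapAt-length a u) lu) ls p)
        (applyWordF-cong as (λ q → at-swapAt a u l1 (subst (a <_) (sym lu) l2) q) p)

applyWord-length : ∀ u as → length (applyWord u as) ≡ length u
applyWord-length u [] = refl
applyWord-length u (a ∷ as) = trans (applyWord-length (swapAt a u) as) (swapAt-length a u)

at-ext : ∀ u v → length u ≡ length v → (∀ p → 1 ≤ p → p ≤ length u → at u p ≡ at v p) → u ≡ v
at-ext [] [] _ _ = refl
at-ext [] (x ∷ v) () _
at-ext (x ∷ u) [] () _
at-ext (x ∷ u) (y ∷ v) lu h = cong₂ _∷_ (h 1 (s≤s z≤n) (s≤s z≤n)) (at-ext u v (suc-injective lu) h')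
  where
  h' : ∀ p → 1 ≤ p → p ≤ length u → at u p ≡ at v p
  h' (suc p) _ le = h (suc (suc p)) (s≤s z≤n) (s≤s le)

throughTile : Grid → ℕ → ℕ → Labelling → Labelling
throughTile G r zero f = f
throughTile G r (suc c) f = if G r (suc c) then swapF (r + c) f else f

throughRow : Grid → ℕ → ℕ → Labelling → Labelling
throughRow G r zero f = f
throughRow G r (suc c) f = throughTile G r (suc c) (throughRow G r c f)

belowRows : Grid → ℕ → ℕ → ℕ → Labelling
belowRows G n r zero = id
belowRows G n r (suc k) = throughRow G (suc r) (n ∸ suc r) (belowRows G n (suc r) k)

-- below G n r p is the start of line p when p ≤ r, and otherwise the line leaving the top of
-- tile (r + 1, p − r).
below : Grid → ℕ → ℕ → Labelling
below G n r = belowRows G n r (n ∸ suc r)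


below-step : ∀ G n r → r < n → below G n r ≡ throughRow G (suc r) (n ∸ suc r) (below G n (suc r))
below-step G n r lt with m≤n⇒m<n∨m≡n lt
... | inj₁ lt' = cong (belowRows G n r) (m∸n≡1+[m∸1+n] n (suc r) lt')
... | inj₂ refl rewrite n∸n≡0 r | m≤n⇒m∸n≡0 (n≤1+n r) = refl

throughTile-cross : ∀ G r c f → G r (suc c) ≡ true → throughTile G r (suc c) f ≡ swapF (r + c) f
throughTile-cross G r c f e rewrite e = refl

throughTile-empty : ∀ G r c f → G r (suc c) ≡ false → throughTile G r (suc c) f ≡ f
throughTile-empty G r c f e rewrite e = refl

throughTile-cases : ∀ G r c f p → (throughTile G r (suc c) f p ≡ f (transpose (r + c) p)) ⊎ (throughTile G r (suc c) f p ≡ f p)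
throughTile-cases G r c f p with G r (suc c)
... | true = inj₁ refl
... | false = inj₂ refl

throughTile-fix : ∀ G r c f p → p ≢ r + c → p ≢ suc (r + c) → throughTile G r (suc c) f p ≡ f p
throughTile-fix G r c f p n1 n2 with throughTile-cases G r c f p
... | inj₁ e = trans e (cong f (transpose-noMatch (r + c) p n1 n2))
... | inj₂ e = e

throughRow-fixˡ : ∀ G r c f p → p < r → throughRow G r c f p ≡ f p
throughRow-fixˡ G r zero f p lt = refl
throughRow-fixˡ G r (suc c) f p lt =
  trans (throughTile-fix G r c (throughRow G r c f) p (λ e → <-irrefl e (<-≤-trans lt (m≤m+n r c)))
                                         (λ e → <-irrefl e (<-≤-trans lt (≤-trans (m≤m+n r c) (n≤1+n _)))))
        (throughRow-fixˡ G r c f p lt)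

throughRow-fixʳ : ∀ G r c f p → r + c < p → throughRow G r c f p ≡ f p
throughRow-fixʳ G r zero f p lt = refl
throughRow-fixʳ G r (suc c) f p lt =
  trans (throughTile-fix G r c (throughRow G r c f) p (λ e → <-irrefl (sym e) (≤-trans (s≤s (≤-trans (n≤1+n _) (≤-reflexive (sym (+-suc r c))))) lt))
                                         (λ e → <-irrefl (sym e) (subst (_< p) (+-suc r c) lt)))
        (throughRow-fixʳ G r c f p (≤-trans (s≤s (≤-trans (m≤m+n _ 1) (≤-reflexive (trans (+-comm (r + c) 1) (sym (+-suc r c)))))) lt))

throughRow-extend : ∀ G r c k f p → p < r + c → throughRow G r (k + c) f p ≡ throughRow G r c f p
throughRow-extend G r c zero f p lt = refl
throughRow-extend G r c (suc k) f p lt =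
  trans (throughTile-fix G r (k + c) (throughRow G r (k + c) f) p
          (λ e → <-irrefl e (<-≤-trans lt (+-monoʳ-≤ r (m≤n+m c k))))
          (λ e → <-irrefl e (<-≤-trans lt (≤-trans (+-monoʳ-≤ r (m≤n+m c k)) (n≤1+n _)))))
        (throughRow-extend G r c k f p lt)

throughRow-cong : ∀ G r c {f g : Labelling} → f ≗ g → throughRow G r c f ≗ throughRow G r c g
throughRow-cong G r zero e p = e p
throughRow-cong G r (suc c) {f} {g} e p with G r (suc c)
... | true = throughRow-cong G r c e (transpose (r + c) p)
... | false = throughRow-cong G r c e p

throughRow-cong-grid : ∀ G G' r c f → (∀ c' → 1 ≤ c' → c' ≤ c → G r c' ≡ G' r c') → throughRow G r c f ≗ throughRow G' r c f
throughRow-cong-grid G G' r zero f h p = refl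
throughRow-cong-grid G G' r (suc c) f h p
  rewrite h (suc c) (s≤s z≤n) ≤-refl with G' r (suc c)
... | true = throughRow-cong-grid G G' r c f (λ c' a b → h c' a (m≤n⇒m≤1+n b)) (transpose (r + c) p)
... | false = throughRow-cong-grid G G' r c f (λ c' a b → h c' a (m≤n⇒m≤1+n b)) p

throughRow-mapsInto : ∀ G r c f lo hi → MapsInto f lo hi → lo ≤ r → r + c ≤ hi → MapsInto (throughRow G r c f) lo hi
throughRow-mapsInto G r zero f lo hi mf l1 l2 = mf
throughRow-mapsInto G r (suc c) f lo hi mf l1 l2 with G r (suc c)
... | true = swapF-mapsInto (r + c) (throughRow G r c f) lo hi (≤-trans l1 (m≤m+n r c)) (subst (_≤ hi) (+-suc r c) l2)
               (throughRow-mapsInto G r c f lo hi mf l1 (≤-trans (+-monoʳ-≤ r (n≤1+n c)) l2))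
... | false = throughRow-mapsInto G r c f lo hi mf l1 (≤-trans (+-monoʳ-≤ r (n≤1+n c)) l2)

IsInjective : Labelling → Set
IsInjective f = ∀ p q → f p ≡ f q → p ≡ q

throughRow-injective : ∀ G r c f → IsInjective f → IsInjective (throughRow G r c f)
throughRow-injective G r zero f inj = inj
throughRow-injective G r (suc c) f inj with G r (suc c)
... | true = λ p q e → transpose-injective (r + c) p q (throughRow-injective G r c f inj _ _ e)
... | false = throughRow-injective G r c f inj

module RowInduction (n : ℕ) (P : ℕ → Set) (base : ∀ r → n ≤ suc r → P r) (step : ∀ r → suc r < n → P (suc r) → P r) where
  aux : ∀ k r → n ∸ r ≤ k → P r
  aux zero r le = base r (≤-trans (m∸n≡0⇒m≤n (n≤0⇒n≡0 le)) (n≤1+n r))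
  aux (suc k) r le with n ≤? suc r
  ... | yes b = base r b
  ... | no nb = step r (≰⇒> nb) (aux k (suc r) (≤-trans (≤-reflexive (sym (pred[m∸n]≡m∸[1+n] n r))) (pred-mono-≤ le)))
  ind : ∀ r → P r
  ind r = aux (n ∸ r) r ≤-refl

below-base : ∀ G n r → n ≤ suc r → below G n r ≡ id
below-base G n r le = cong (belowRows G n r) (m≤n⇒m∸n≡0 le)

below-fixˡ : ∀ G n r p → p ≤ r → below G n r p ≡ p
below-fixˡ G n = RowInduction.ind n (λ r → ∀ p → p ≤ r → below G n r p ≡ p)
  (λ r b p le → cong (λ h → h p) (below-base G n r b))
  (λ r lt ih p le → trans (cong (λ h → h p) (below-step G n r (<-trans (n<1+n r) lt)))
                     (trans (throughRow-fixˡ G (suc r) (n ∸ suc r) _ p (s≤s le)) (ih p (m≤n⇒m≤1+n le))))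

below-mapsInto : ∀ G n r → MapsInto (below G n r) (suc r) n
below-mapsInto G n = RowInduction.ind n (λ r → MapsInto (below G n r) (suc r) n)
  (λ r b p l1 l2 → subst (λ h → suc r ≤ h p × h p ≤ n) (sym (below-base G n r b)) (l1 , l2))
  (λ r lt ih → subst (λ h → MapsInto h (suc r) n) (sym (below-step G n r (<-trans (n<1+n r) lt)))
     (throughRow-mapsInto G (suc r) (n ∸ suc r) _ (suc r) n (ext r lt ih) ≤-refl (≤-reflexive (m+[n∸m]≡n (<⇒≤ lt)))))
  where
  ext : ∀ r → suc r < n → MapsInto (below G n (suc r)) (suc (suc r)) n → MapsInto (below G n (suc r)) (suc r) n
  ext r lt ih p l1 l2 with m≤n⇒m<n∨m≡n l1
  ... | inj₁ lt' = let (a , b) = ih p lt' l2 in (≤-trans (n≤1+n _) a) , b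
  ... | inj₂ refl rewrite below-fixˡ G n (suc r) (suc r) ≤-refl = ≤-refl , l2

below-mapsInto₁ : ∀ G n r → MapsInto (below G n r) 1 n
below-mapsInto₁ G n r p l1 l2 with r <? p
... | yes lt = let (a , b) = below-mapsInto G n r p lt l2 in ≤-trans (s≤s z≤n) a , b
... | no nlt rewrite below-fixˡ G n r p (≮⇒≥ nlt) = l1 , l2

below-injective : ∀ G n r → IsInjective (below G n r)
below-injective G n = RowInduction.ind n (λ r → IsInjective (below G n r))
  (λ r b → subst IsInjective (sym (below-base G n r b)) (λ p q e → e))
  (λ r lt ih → subst IsInjective (sym (below-step G n r (<-trans (n<1+n r) lt))) (throughRow-injective G (suc r) (n ∸ suc r) _ ih))

below-cong-grid : ∀ G G' n r → (∀ r' c → r < r' → G r' c ≡ G' r' c) → below G n r ≗ below G' n r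
below-cong-grid G G' n = RowInduction.ind n (λ r → (∀ r' c → r < r' → G r' c ≡ G' r' c) → below G n r ≗ below G' n r)
  (λ r b h p → trans (cong (λ z → z p) (below-base G n r b)) (sym (cong (λ z → z p) (below-base G' n r b))))
  (λ r lt ih h p → trans (cong (λ z → z p) (below-step G n r (<-trans (n<1+n r) lt)))
     (trans (throughRow-cong G (suc r) (n ∸ suc r) (ih (λ r' c lt' → h r' c (<-trans (n<1+n r) lt'))) p)
     (trans (throughRow-cong-grid G G' (suc r) (n ∸ suc r) _ (λ c' _ _ → h (suc r) c' (n<1+n r)) p)
            (sym (cong (λ z → z p) (below-step G' n r (<-trans (n<1+n r) lt)))))))

below-fixʳ : ∀ G n r p → n < p → below G n r p ≡ p
below-fixʳ G n = RowInduction.ind n (λ r → ∀ p → n < p → below G n r p ≡ p)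
  (λ r b p lt → cong (λ h → h p) (below-base G n r b))
  (λ r lt ih p np → trans (cong (λ h → h p) (below-step G n r (<-trans (n<1+n r) lt)))
     (trans (throughRow-fixʳ G (suc r) (n ∸ suc r) _ p (subst (_< p) (sym (m+[n∸m]≡n (<⇒≤ lt))) np)) (ih p np)))

-- Left-justified rows act as rotations

IsRotation : ℕ → ℕ → Labelling → Labelling → Set
IsRotation r L f g = (∀ p → r ≤ p → p < r + L → g p ≡ f (suc p)) × (g (r + L) ≡ f r) ×
                (∀ p → p < r → g p ≡ f p) × (∀ p → r + L < p → g p ≡ f p)

rotation-zero : ∀ r f → IsRotation r 0 f f
rotation-zero r f = (λ p a b → ⊥-elim (<-irrefl refl (≤-<-trans a (subst (p <_) (+-identityʳ r) b))))
             , cong f (+-identityʳ r) , (λ _ _ → refl) , (λ _ _ → refl)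

rotation-suc : ∀ r L f g → IsRotation r L f g → IsRotation r (suc L) f (swapF (r + L) g)
rotation-suc r L f g (c1 , c2 , c3 , c4) = d1 , d2 , d3 , d4
  where
  d1 : ∀ p → r ≤ p → p < r + suc L → swapF (r + L) g p ≡ f (suc p)
  d1 p a b with <-cmp p (r + L)
  ... | tri< lt _ _ = trans (cong g (transpose-below (r + L) p lt)) (c1 p a lt)
  ... | tri≈ _ refl _ = trans (cong g (transpose-matchˡ (r + L))) (c4 (suc (r + L)) ≤-refl)
  ... | tri> _ _ gt = ⊥-elim (<-irrefl refl (<-≤-trans gt (≤-pred (subst (p <_) (+-suc r L) b))))
  d2 : swapF (r + L) g (r + suc L) ≡ f r
  d2 rewrite +-suc r L = trans (cong g (transpose-matchʳ (r + L))) c2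
  d3 : ∀ p → p < r → swapF (r + L) g p ≡ f p
  d3 p lt = trans (cong g (transpose-below (r + L) p (<-≤-trans lt (m≤m+n r L)))) (c3 p lt)
  d4 : ∀ p → r + suc L < p → swapF (r + L) g p ≡ f p
  d4 p lt = trans (cong g (transpose-above (r + L) p (subst (_< p) (+-suc r L) lt)))
                  (c4 p (<-trans (n<1+n (r + L)) (subst (_< p) (+-suc r L) lt)))

IsRotation-cong : ∀ r L f g g' → IsRotation r L f g → g ≗ g' → IsRotation r L f g'
IsRotation-cong r L f g g' (c1 , c2 , c3 , c4) e =
  (λ p a b → trans (sym (e p)) (c1 p a b)) , trans (sym (e _)) c2 , (λ p a → trans (sym (e p)) (c3 p a)) , (λ p a → trans (sym (e p)) (c4 p a))

rotation-unique : ∀ r L f g g' → IsRotation r L f g → IsRotation r L f g' → g ≗ g'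
rotation-unique r L f g g' (c1 , c2 , c3 , c4) (d1 , d2 , d3 , d4) p with <-cmp p r
... | tri< lt _ _ = trans (c3 p lt) (sym (d3 p lt))
... | tri≈ _ refl _ with <-cmp p (p + L)
...   | tri< lt _ _ = trans (c1 p ≤-refl lt) (sym (d1 p ≤-refl lt))
...   | tri≈ _ e _ = trans (cong g e) (trans c2 (trans (sym d2) (cong g' (sym e))))
...   | tri> _ _ gt = ⊥-elim (<-irrefl refl (<-≤-trans gt (m≤m+n p L)))
rotation-unique r L f g g' (c1 , c2 , c3 , c4) (d1 , d2 , d3 , d4) p | tri> _ _ gt with <-cmp p (r + L)
... | tri< lt _ _ = trans (c1 p (<⇒≤ gt) lt) (sym (d1 p (<⇒≤ gt) lt))
... | tri≈ _ refl _ = trans c2 (sym d2)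
... | tri> _ _ gt' = trans (c4 p gt') (sym (d4 p gt'))

throughFullRow-rotation : ∀ G r L f → (∀ c' → 1 ≤ c' → c' ≤ L → G r c' ≡ true) → IsRotation r L f (throughRow G r L f)
throughFullRow-rotation G r zero f h = rotation-zero r f
throughFullRow-rotation G r (suc L) f h with G r (suc L) in eq
... | true = rotation-suc r L f (throughRow G r L f) (throughFullRow-rotation G r L f (λ c' a b → h c' a (m≤n⇒m≤1+n b)))
... | false = ⊥-elim (case (trans (sym eq) (h (suc L) (s≤s z≤n) ≤-refl)))
  where case : false ≡ true → ⊥
        case ()

throughRow-emptyTail : ∀ G r L k f → (∀ c' → L < c' → c' ≤ k + L → G r c' ≡ false) → throughRow G r (k + L) f ≗ throughRow G r L f
throughRow-emptyTail G r L zero f h p = refl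
throughRow-emptyTail G r L (suc k) f h p with G r (suc (k + L)) in eq
... | true = ⊥-elim (case (trans (sym eq) (h (suc (k + L)) (s≤s (m≤n+m L k)) ≤-refl)))
  where case : true ≡ false → ⊥
        case ()
... | false = throughRow-emptyTail G r L k f (λ c' a b → h c' a (m≤n⇒m≤1+n b)) p

LeftJustified : Grid → ℕ → ℕ → ℕ → Set
LeftJustified G r c L = ∀ c' → 1 ≤ c' → c' ≤ c → (G r c' ≡ true → c' ≤ L) × (c' ≤ L → G r c' ≡ true)

leftJustified-rotation : ∀ G r c L f → LeftJustified G r c L → L ≤ c → IsRotation r L f (throughRow G r c f)
leftJustified-rotation G r c L f h le =
  IsRotation-cong r L f _ _ (throughFullRow-rotation G r L f (λ c' a b → proj₂ (h c' a (≤-trans b le)) b))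
    (λ p → trans (sym (throughRow-emptyTail G r L (c ∸ L) f nc p)) (cong (λ z → throughRow G r z f p) (m∸n+n≡m le)))
  where
  nc : ∀ c' → L < c' → c' ≤ (c ∸ L) + L → G r c' ≡ false
  nc c' a b with G r c' in eq
  ... | false = refl
  ... | true = ⊥-elim (<-irrefl refl (<-≤-trans a (proj₁ (h c' (≤-trans (s≤s z≤n) a) (subst (c' ≤_) (m∸n+n≡m le) b)) eq)))

rotation-swapF-far : ∀ r L f g e → IsRotation r L f g → r + L < e → IsRotation r L (swapF e f) (swapF e g)
rotation-swapF-far r L f g e (c1 , c2 , c3 , c4) lt = d1 , d2 , d3 , d4
  where
  d1 : ∀ p → r ≤ p → p < r + L → swapF e g p ≡ swapF e f (suc p)
  d1 p a b = trans (cong g (transpose-below e p (<-trans b lt))) (trans (c1 p a b) (cong f (sym (transpose-below e (suc p) (≤-<-trans b lt)))))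
  d2 : swapF e g (r + L) ≡ swapF e f r
  d2 = trans (cong g (transpose-below e (r + L) lt)) (trans c2 (cong f (sym (transpose-below e r (≤-<-trans (m≤m+n r L) lt)))))
  d3 : ∀ p → p < r → swapF e g p ≡ swapF e f p
  d3 p a = trans (cong g (transpose-below e p (<-trans (<-≤-trans a (m≤m+n r L)) lt))) (trans (c3 p a) (cong f (sym (transpose-below e p (<-trans (<-≤-trans a (m≤m+n r L)) lt)))))
  d4 : ∀ p → r + L < p → swapF e g p ≡ swapF e f p
  d4 p a = c4 (transpose e p) (big p a)
    where
    big : ∀ p → r + L < p → r + L < transpose e p
    big p a with p ≟ e
    ... | yes refl = <-trans a (n<1+n p)
    ... | no _ with p ≟ suc e
    ...   | yes refl = lt
    ...   | no _ = a

rotation-shift : ∀ r L f g g' e → IsRotation r L f g → IsRotation r L (swapF e f) g' → r + L < e → g' ≗ swapF e g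
rotation-shift r L f g g' e c c' lt = rotation-unique r L (swapF e f) g' (swapF e g) c' (rotation-swapF-far r L f g e c lt)

data Region (r L p : ℕ) : Set where
  rlo : p < r → Region r L p
  rin : r ≤ p → p < r + L → Region r L p
  rend : p ≡ r + L → Region r L p
  rhi : r + L < p → Region r L p

region : ∀ r L p → Region r L p
region r L p with <-cmp p r
... | tri< lt _ _ = rlo lt
... | tri≈ _ e _ with <-cmp p (r + L)
...   | tri< lt _ _ = rin (≤-reflexive (sym e)) lt
...   | tri≈ _ e' _ = rend e'
...   | tri> _ _ gt = rhi gt
region r L p | tri> _ _ gt with <-cmp p (r + L)
... | tri< lt _ _ = rin (<⇒≤ gt) lt
... | tri≈ _ e' _ = rend e'
... | tri> _ _ gt' = rhi gt'

transpose-inside : ∀ r L e p → r ≤ e → suc (suc e) ≤ r + L → r ≤ p → p < r + L → r ≤ transpose e p × transpose e p < r + L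
transpose-inside r L e p le1 le2 a b with p ≟ e
... | yes refl = ≤-trans le1 (n≤1+n e) , le2
... | no _ with p ≟ suc e
...   | yes refl = le1 , ≤-trans (n≤1+n _) le2
...   | no _ = a , b

rotation-conj : ∀ r L f g g' e → IsRotation r L f g → IsRotation r L (swapF (suc e) f) g' → r ≤ e → suc (suc e) ≤ r + L → g' ≗ swapF e g
rotation-conj r L f g g' e (c1 , c2 , c3 , c4) (d1 , d2 , d3 , d4) le1 le2 p with region r L p
... | rlo lt = trans (d3 p lt) (trans (cong f (transpose-below (suc e) p (<-≤-trans lt (≤-trans le1 (n≤1+n e)))))
                      (trans (sym (c3 p lt)) (cong g (sym (transpose-below e p (<-≤-trans lt le1))))))
... | rin a b = let (x , y) = transpose-inside r L e p le1 le2 a b in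
                trans (d1 p a b) (trans (cong f (transpose-suc e p)) (sym (c1 (transpose e p) x y)))
... | rend refl = trans d2 (trans (cong f (transpose-below (suc e) r (s≤s le1))) (trans (sym c2) (cong g (sym (transpose-above e (r + L) le2)))))
... | rhi lt = trans (d4 p lt) (trans (cong f (transpose-above (suc e) p (<-≤-trans (s≤s le2) lt)))
                      (trans (sym (c4 p lt)) (cong g (sym (transpose-above e p (<-trans le2 lt))))))

Bounded : ℕ → Grid → Set
Bounded n G = ∀ i j → G i j ≡ true → 1 ≤ i × 1 ≤ j × i + j ≤ n

label : Grid → ℕ → ℕ → ℕ → Dir → ℕ
label G n r zero d = 0
label G n r (suc c) fromLeft = throughRow G r c (below G n r) (r + c)
label G n r (suc c) fromBottom = throughRow G r c (below G n r) (suc (r + c))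

InDiagram : ℕ → ℕ → ℕ → Dir → Set
InDiagram n r c fromLeft = 1 ≤ r × 1 ≤ c × r + c ≤ suc n
InDiagram n r c fromBottom = 1 ≤ r × 1 ≤ c × r + c ≤ n

throughRow-emptyTile-extend : ∀ G r c m g → G r (suc c) ≡ false → c ≤ m → throughRow G r m g (r + c) ≡ throughRow G r c g (r + c)
throughRow-emptyTile-extend G r c m g nc le with m≤n⇒m<n∨m≡n le
... | inj₂ refl = refl
... | inj₁ lt = trans (cong (λ z → throughRow G r z g (r + c)) (sym (m∸n+n≡m lt)))
                 (trans (throughRow-extend G r (suc c) (m ∸ suc c) g (r + c) (+-monoʳ-< r (n<1+n c)))
                        (cong (λ h → h (r + c)) (throughTile-empty G r c (throughRow G r c g) nc)))

+≤⇒≤∸ : ∀ {a b n} → a + b ≤ n → b ≤ n ∸ a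
+≤⇒≤∸ {a} {b} {n} h = subst (_≤ n ∸ a) (m+n∸m≡n a b) (∸-monoˡ-≤ a h)

bool-cases : ∀ {A : Set} (b : Bool) → (b ≡ true → A) → (b ≡ false → A) → A
bool-cases true t f = t refl
bool-cases false t f = f refl

module LineDiagram (G : Grid) (n : ℕ) (bd : Bounded n G) where

  label-crossˡ : ∀ r c → G r (suc c) ≡ true → label G n r (suc (suc c)) fromLeft ≡ label G n r (suc c) fromLeft
  label-crossˡ r c e rewrite throughTile-cross G r c (throughRow G r c (below G n r)) e | +-suc r c = cong (throughRow G r c (below G n r)) (transpose-matchʳ (r + c))

  label-turnʳ : ∀ r c → G r (suc c) ≡ false → label G n r (suc (suc c)) fromLeft ≡ label G n r (suc c) fromBottom
  label-turnʳ r c e rewrite throughTile-empty G r c (throughRow G r c (below G n r)) e | +-suc r c = refl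

  label-turnᵘ : ∀ r c → G (suc r) (suc c) ≡ false → suc r + suc c ≤ suc n →
         label G n r (suc c) fromBottom ≡ label G n (suc r) (suc c) fromLeft
  label-turnᵘ r c e le = trans (throughRow-fixʳ G r c _ (suc (r + c)) ≤-refl)
                  (trans (cong (λ h → h (suc (r + c))) (below-step G n r rn))
                         (throughRow-emptyTile-extend G (suc r) c (n ∸ suc r) (below G n (suc r)) e cle))
    where
    le' : suc r + c ≤ n
    le' = ≤-pred (subst (_≤ suc n) (+-suc (suc r) c) le)
    rn : r < n
    rn = ≤-trans (s≤s (m≤m+n r c)) le'
    cle : c ≤ n ∸ suc r
    cle = +≤⇒≤∸ {suc r} le'

  label-crossᵘ : ∀ r c → G (suc r) (suc c) ≡ true →
         label G n r (suc c) fromBottom ≡ label G n (suc r) (suc c) fromBottom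
  label-crossᵘ r c e = trans (throughRow-fixʳ G r c _ (suc (r + c)) ≤-refl)
               (trans (cong (λ h → h (suc (r + c))) (below-step G n r rn))
               (trans (trans (cong (λ z → throughRow G (suc r) z (below G n (suc r)) (suc r + c)) (sym (m∸n+n≡m cle)))
                             (throughRow-extend G (suc r) (suc c) (n ∸ suc r ∸ suc c) (below G n (suc r)) (suc r + c) (+-monoʳ-< (suc r) (n<1+n c))))
                      (trans (cong (λ h → h (suc r + c)) (throughTile-cross G (suc r) c _ e)) (cong (throughRow G (suc r) c (below G n (suc r))) (transpose-matchˡ (suc r + c))))))
    where
    b : suc r + suc c ≤ n
    b = proj₂ (proj₂ (bd (suc r) (suc c) e))
    rn : r < n
    rn = ≤-trans (s≤s (m≤m+n r (suc c))) b
    cle : suc c ≤ n ∸ suc r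
    cle = +≤⇒≤∸ {suc r} b

  label-start : ∀ t → label G n t 1 fromLeft ≡ t
  label-start t = trans (below-fixˡ G n t (t + 0) (≤-reflexive (+-identityʳ t))) (+-identityʳ t)

  InDiagramP : Pos × Dir → Set
  InDiagramP ((r , c) , d) = InDiagram n r c d

  labelP : Pos × Dir → ℕ
  labelP ((r , c) , d) = label G n r c d

  LabelledBy : ℕ → Pos × Dir → Set
  LabelledBy t x = InDiagramP x × labelP x ≡ t

  private
    labelledBy-cong : ∀ {t t'} {xs : List (Pos × Dir)} → t ≡ t' → All (LabelledBy t) xs → All (LabelledBy t') xs
    labelledBy-cong e = Data.List.Relation.Unary.All.map (λ (a , b) → a , trans b e)

    +suc≤ : ∀ r c → r + suc c ≤ n → r + suc (suc c) ≤ suc n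
    +suc≤ r c le = subst (_≤ suc n) (sym (+-suc r (suc c))) (s≤s le)

  trace-labelled : ∀ f r c d → InDiagram n r c d → All (LabelledBy (label G n r c d)) (trace G f r c d)
  trace-labelled zero r c d reg = []
  trace-labelled (suc f) r zero fromLeft (_ , () , _)
  trace-labelled (suc f) r zero fromBottom (_ , () , _)
  trace-labelled (suc f) r (suc c) fromLeft reg with G r (suc c) in eq
  ... | true = (reg , refl) ∷ labelledBy-cong (label-crossˡ r c eq)
        (trace-labelled f r (suc (suc c)) fromLeft (proj₁ reg , s≤s z≤n , +suc≤ r c (proj₂ (proj₂ (bd r (suc c) eq)))))
  trace-labelled (suc f) zero (suc c) fromLeft (() , _) | false
  trace-labelled (suc f) (suc zero) (suc c) fromLeft reg | false = (reg , refl) ∷ []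
  trace-labelled (suc f) (suc (suc r)) (suc c) fromLeft reg | false = (reg , refl) ∷ labelledBy-cong (label-turnᵘ (suc r) c eq (proj₂ (proj₂ reg)))
        (trace-labelled f (suc r) (suc c) fromBottom (s≤s z≤n , s≤s z≤n , ≤-pred (proj₂ (proj₂ reg))))
  trace-labelled (suc f) r (suc c) fromBottom reg with G r (suc c) in eq
  ... | false = (reg , refl) ∷ labelledBy-cong (label-turnʳ r c eq)
        (trace-labelled f r (suc (suc c)) fromLeft (proj₁ reg , s≤s z≤n , +suc≤ r c (proj₂ (proj₂ reg))))
  trace-labelled (suc f) zero (suc c) fromBottom (() , _) | true
  trace-labelled (suc f) (suc zero) (suc c) fromBottom reg | true = (reg , refl) ∷ []
  trace-labelled (suc f) (suc (suc r)) (suc c) fromBottom reg | true = (reg , refl) ∷ labelledBy-cong (label-crossᵘ (suc r) c eq)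
        (trace-labelled f (suc r) (suc c) fromBottom (s≤s z≤n , s≤s z≤n , ≤-trans (n≤1+n _) (proj₂ (proj₂ reg))))

  OnLine : ℕ → ℕ → ℕ → ℕ → Dir → Set
  OnLine t f r c d = ∀ x → x ∈ trace G f r c d → x ∈ trace G (2 * n) t 1 fromLeft

  -- Traces are cut off by fuel; Reaches r c d says that a tail of the trace of the line
  -- labelling (r, c) starts at (r, c) with fuel left to reach the top.  It is proved by
  -- walking that line back to its start.
  Reaches : ℕ → ℕ → Dir → Set
  Reaches r c d = Σ ℕ λ f → (r + suc n ≤ f + c) × OnLine (label G n r c d) f r c d

  private

    reaches-bound-absurd : ∀ r c → r + suc n ≤ c → c ≤ n → ⊥
    reaches-bound-absurd r c le cn = <-irrefl refl (≤-trans (s≤s cn) (≤-trans (m≤n+m (suc n) r) le))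

    col≤n : ∀ r c → 1 ≤ r → r + c ≤ suc n → c ≤ n
    col≤n r c lr le = ≤-pred (≤-trans (+-monoˡ-≤ c lr) le)

  trace-crossˡ : ∀ f r c → G r c ≡ true → trace G (suc f) r c fromLeft ≡ ((r , c) , fromLeft) ∷ trace G f r (suc c) fromLeft
  trace-crossˡ f r c e rewrite e = refl
  trace-turnᵘ : ∀ f r c → G (suc (suc r)) c ≡ false → trace G (suc f) (suc (suc r)) c fromLeft ≡ ((suc (suc r) , c) , fromLeft) ∷ trace G f (suc r) c fromBottom
  trace-turnᵘ f r c e rewrite e = refl
  trace-crossᵘ : ∀ f r c → G (suc (suc r)) c ≡ true → trace G (suc f) (suc (suc r)) c fromBottom ≡ ((suc (suc r) , c) , fromBottom) ∷ trace G f (suc r) c fromBottom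
  trace-crossᵘ f r c e rewrite e = refl
  trace-turnʳ : ∀ f r c → G r c ≡ false → trace G (suc f) r c fromBottom ≡ ((r , c) , fromBottom) ∷ trace G f r (suc c) fromLeft
  trace-turnʳ f r c e rewrite e = refl

  reaches-back : ∀ r c d r' c' d' → label G n r' c' d' ≡ label G n r c d →
         (∀ f → Σ _ λ y → trace G (suc f) r' c' d' ≡ y ∷ trace G f r c d) →
         (r' + suc n ≤ c' → ⊥) → (∀ f → r' + suc n ≤ suc f + c' → r + suc n ≤ f + c) →
         Reaches r' c' d' → Reaches r c d
  reaches-back r c d r' c' d' le st z b (zero , bnd , inc) = ⊥-elim (z bnd)
  reaches-back r c d r' c' d' le st z b (suc f , bnd , inc) = f , b f bnd ,
    λ x m → subst (λ t → x ∈ trace G (2 * n) t 1 fromLeft) le (inc x (subst (x ∈_) (sym (proj₂ (st f))) (there m)))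

  reaches : ∀ k r c d → c + (n ∸ r) ≤ k → InDiagram n r c d → Reaches r c d
  reaches k r zero fromLeft _ (_ , () , _)
  reaches k r zero fromBottom _ (_ , () , _)
  reaches zero r (suc c) d () reg
  reaches (suc k) r (suc zero) fromLeft le reg =
    2 * n , bnd , λ x m → subst (λ t → x ∈ trace G (2 * n) t 1 fromLeft) (sym (label-start r)) m
    where
    rn : r ≤ n
    rn = ≤-pred (subst (_≤ suc n) (+-comm r 1) (proj₂ (proj₂ reg)))
    bnd : r + suc n ≤ 2 * n + 1
    bnd = subst (r + suc n ≤_) (sym (trans (+-comm (2 * n) 1) (cong suc (cong (n +_) (+-identityʳ n)))))
           (subst (_≤ suc (n + n)) (sym (+-suc r n)) (s≤s (+-monoˡ-≤ n rn)))
  reaches (suc k) r (suc (suc c)) fromLeft le reg = bool-cases (G r (suc c))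
    (λ eq → reaches-back r (suc (suc c)) fromLeft r (suc c) fromLeft (sym (label-crossˡ r c eq)) (λ f → _ , trace-crossˡ f r (suc c) eq)
              (λ bnd → reaches-bound-absurd r (suc c) bnd cn) (λ f bnd → subst (r + suc n ≤_) (sym (+-suc f (suc c))) bnd)
              (reaches k r (suc c) fromLeft (≤-pred le) (proj₁ reg , s≤s z≤n , ≤-trans (n≤1+n _) rc)))
    (λ eq → reaches-back r (suc (suc c)) fromLeft r (suc c) fromBottom (sym (label-turnʳ r c eq)) (λ f → _ , trace-turnʳ f r (suc c) eq)
              (λ bnd → reaches-bound-absurd r (suc c) bnd cn) (λ f bnd → subst (r + suc n ≤_) (sym (+-suc f (suc c))) bnd)
              (reaches k r (suc c) fromBottom (≤-pred le) (proj₁ reg , s≤s z≤n , ≤-pred rc)))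
    where
    rc : suc (r + suc c) ≤ suc n
    rc = subst (_≤ suc n) (+-suc r (suc c)) (proj₂ (proj₂ reg))
    cn : suc c ≤ n
    cn = col≤n r (suc c) (proj₁ reg) (≤-trans (n≤1+n _) rc)
  reaches (suc k) zero (suc c) fromBottom le (() , _)
  reaches (suc k) (suc r) (suc c) fromBottom le reg = bool-cases (G (suc (suc r)) (suc c))
    (λ eq → reaches-back (suc r) (suc c) fromBottom (suc (suc r)) (suc c) fromBottom (sym (label-crossᵘ (suc r) c eq)) (λ f → _ , trace-crossᵘ f r (suc c) eq)
              (λ bnd → reaches-bound-absurd (suc (suc r)) (suc c) bnd cn) (λ f bnd → ≤-pred bnd)
              (reaches k (suc (suc r)) (suc c) fromBottom le' (s≤s z≤n , s≤s z≤n , proj₂ (proj₂ (bd _ _ eq)))))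
    (λ eq → reaches-back (suc r) (suc c) fromBottom (suc (suc r)) (suc c) fromLeft (sym (label-turnᵘ (suc r) c eq (s≤s (proj₂ (proj₂ reg))))) (λ f → _ , trace-turnᵘ f r (suc c) eq)
              (λ bnd → reaches-bound-absurd (suc (suc r)) (suc c) bnd cn) (λ f bnd → ≤-pred bnd)
              (reaches k (suc (suc r)) (suc c) fromLeft le' (s≤s z≤n , s≤s z≤n , s≤s (proj₂ (proj₂ reg)))))
    where
    cn : suc c ≤ n
    cn = col≤n (suc r) (suc c) (s≤s z≤n) (≤-trans (proj₂ (proj₂ reg)) (n≤1+n n))
    rn : suc r < n
    rn = ≤-trans (s≤s (m≤m+n (suc r) c)) (subst (_≤ n) (+-suc (suc r) c) (proj₂ (proj₂ reg)))
    le' : suc c + (n ∸ suc (suc r)) ≤ k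
    le' = ≤-pred (subst (_≤ suc k) (trans (cong (suc c +_) (m∸n≡1+[m∸1+n] n (suc r) rn)) (+-suc (suc c) _)) le)

  label-range : ∀ r c d → InDiagram n r c d → 1 ≤ label G n r c d × label G n r c d ≤ n
  label-range r zero fromLeft (_ , () , _)
  label-range r zero fromBottom (_ , () , _)
  label-range r (suc c) fromLeft (lr , _ , le) =
    throughRow-mapsInto G r c (below G n r) 1 n (below-mapsInto₁ G n r) lr rc (r + c) (≤-trans lr (m≤m+n r c)) rc
    where rc : r + c ≤ n
          rc = ≤-pred (subst (_≤ suc n) (+-suc r c) le)
  label-range r (suc c) fromBottom (lr , _ , le) =
    throughRow-mapsInto G r c (below G n r) 1 n (below-mapsInto₁ G n r) lr (≤-trans (n≤1+n _) rc) (suc (r + c)) (s≤s z≤n) rc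
    where rc : suc (r + c) ≤ n
          rc = subst (_≤ n) (+-suc r c) le

  enters-lab : ∀ r c d → InDiagram n r c d → Enters n G (label G n r c d) (r , c) d
  enters-lab r c d reg with reaches (c + (n ∸ r)) r c d ≤-refl reg | label-range r c d reg
  ... | f , bnd , inc | (l1 , l2) = l1 , l2 , inc _ (mem f bnd)
    where
    cn' : ∀ d → InDiagram n r c d → c ≤ n
    cn' fromLeft reg = col≤n r c (proj₁ reg) (proj₂ (proj₂ reg))
    cn' fromBottom reg = col≤n r c (proj₁ reg) (≤-trans (proj₂ (proj₂ reg)) (n≤1+n n))
    cn : c ≤ n
    cn = cn' d reg
    mem : ∀ f → r + suc n ≤ f + c → ((r , c) , d) ∈ trace G f r c d
    mem zero b = ⊥-elim (reaches-bound-absurd r c b cn)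
    mem (suc f) b = here refl

  lab-enters : ∀ t r c d → Enters n G t (r , c) d → InDiagram n r c d × label G n r c d ≡ t
  lab-enters t r c d (l1 , l2 , m) =
    let (a , b) = Data.List.Relation.Unary.All.lookup (trace-labelled (2 * n) t 1 fromLeft (l1 , s≤s z≤n , subst (_≤ suc n) (+-comm 1 t) (s≤s l2))) m
    in a , trans b (label-start t)

tileWord : Grid → ℕ → ℕ → List ℕ
tileWord G r zero = []
tileWord G r (suc c) = if G r (suc c) then (r + c) ∷ [] else []

rowWord : Grid → ℕ → ℕ → List ℕ
rowWord G r zero = []
rowWord G r (suc c) = rowWord G r c ++ tileWord G r (suc c)

rowWordRev : Grid → ℕ → ℕ → List ℕ
rowWordRev G r zero = []
rowWordRev G r (suc c) = tileWord G r (suc c) ++ rowWordRev G r c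

rowWordFrom : Grid → ℕ → ℕ → ℕ → List ℕ
rowWordFrom G r c zero = []
rowWordFrom G r c (suc m) = rowWordFrom G r c m ++ tileWord G r (suc (m + c))

belowWordRows : Grid → ℕ → ℕ → ℕ → List ℕ
belowWordRows G n r zero = []
belowWordRows G n r (suc k) = belowWordRows G n (suc r) k ++ rowWord G (suc r) (n ∸ suc r)

belowWord : Grid → ℕ → ℕ → List ℕ
belowWord G n r = belowWordRows G n r (n ∸ suc r)

prefixWord : Grid → ℕ → ℕ → ℕ → List ℕ
prefixWord G n r c = belowWord G n r ++ rowWord G r c

applyWordF-tileWord : ∀ G r c f → applyWordF f (tileWord G r (suc c)) ≗ throughTile G r (suc c) f
applyWordF-tileWord G r c f p with G r (suc c)
... | true = refl
... | false = refl

throughTile-cong : ∀ G r c {g h : Labelling} → g ≗ h → throughTile G r c g ≗ throughTile G r c h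
throughTile-cong G r zero e p = e p
throughTile-cong G r (suc c) e p with G r (suc c)
... | true = e _
... | false = e p

throughRow-word : ∀ G r c f → throughRow G r c f ≗ applyWordF f (rowWord G r c)
throughRow-word G r zero f p = refl
throughRow-word G r (suc c) f p =
  trans (throughTile-cong G r (suc c) (throughRow-word G r c f) p)
        (trans (sym (applyWordF-tileWord G r c (applyWordF f (rowWord G r c)) p)) (cong (λ h → h p) (sym (applyWordF-++ f (rowWord G r c) (tileWord G r (suc c))))))

belowRows-word : ∀ G n r k → belowRows G n r k ≗ applyWordF id (belowWordRows G n r k)
belowRows-word G n r zero p = refl
belowRows-word G n r (suc k) p =
  trans (throughRow-cong G (suc r) (n ∸ suc r) (belowRows-word G n (suc r) k) p)
  (trans (throughRow-word G (suc r) (n ∸ suc r) _ p)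
         (cong (λ h → h p) (sym (applyWordF-++ id (belowWordRows G n (suc r) k) (rowWord G (suc r) (n ∸ suc r))))))

below-word : ∀ G n r → below G n r ≗ applyWordF id (belowWord G n r)
below-word G n r = belowRows-word G n r (n ∸ suc r)

throughRow-below-word : ∀ G n r c → throughRow G r c (below G n r) ≗ applyWordF id (prefixWord G n r c)
throughRow-below-word G n r c p = trans (throughRow-cong G r c (below-word G n r) p)
  (trans (throughRow-word G r c _ p) (cong (λ h → h p) (sym (applyWordF-++ id (belowWord G n r) (rowWord G r c)))))

belowWord-step : ∀ G n r → r < n → belowWord G n r ≡ belowWord G n (suc r) ++ rowWord G (suc r) (n ∸ suc r)
belowWord-step G n r lt1 with m≤n⇒m<n∨m≡n lt1
... | inj₁ lt2 = cong (belowWordRows G n r) (m∸n≡1+[m∸1+n] n (suc r) lt2)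
... | inj₂ refl rewrite n∸n≡0 r | m≤n⇒m∸n≡0 (n≤1+n r) = refl

belowWord-base : ∀ G n r → n ≤ suc r → belowWord G n r ≡ []
belowWord-base G n r le = cong (belowWordRows G n r) (m≤n⇒m∸n≡0 le)

rowWord-extend : ∀ G r c m → rowWord G r (m + c) ≡ rowWord G r c ++ rowWordFrom G r c m
rowWord-extend G r c zero = sym (++-identityʳ _)
rowWord-extend G r c (suc m) = trans (cong (_++ tileWord G r (suc (m + c))) (rowWord-extend G r c m)) (++-assoc (rowWord G r c) _ _)

tileWord-cong-grid : ∀ G G2 r c → G r c ≡ G2 r c → tileWord G r c ≡ tileWord G2 r c
tileWord-cong-grid G G2 r zero e = refl
tileWord-cong-grid G G2 r (suc c) e rewrite e = refl

rowWord-cong-grid : ∀ G G2 r c → (∀ c1 → 1 ≤ c1 → c1 ≤ c → G r c1 ≡ G2 r c1) → rowWord G r c ≡ rowWord G2 r c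
rowWord-cong-grid G G2 r zero h = refl
rowWord-cong-grid G G2 r (suc c) h = cong₂ _++_ (rowWord-cong-grid G G2 r c (λ c1 a b → h c1 a (m≤n⇒m≤1+n b))) (tileWord-cong-grid G G2 r (suc c) (h (suc c) (s≤s z≤n) ≤-refl))

rowWordFrom-cong-grid : ∀ G G2 r c m → (∀ c1 → c < c1 → c1 ≤ m + c → G r c1 ≡ G2 r c1) → rowWordFrom G r c m ≡ rowWordFrom G2 r c m
rowWordFrom-cong-grid G G2 r c zero h = refl
rowWordFrom-cong-grid G G2 r c (suc m) h = cong₂ _++_ (rowWordFrom-cong-grid G G2 r c m (λ c1 a b → h c1 a (m≤n⇒m≤1+n b)))
  (tileWord-cong-grid G G2 r (suc (m + c)) (h (suc (m + c)) (s≤s (m≤n+m c m)) ≤-refl))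

prefixWord-suc : ∀ G n r c → prefixWord G n r (suc c) ≡ prefixWord G n r c ++ tileWord G r (suc c)
prefixWord-suc G n r c = sym (++-assoc (belowWord G n r) (rowWord G r c) (tileWord G r (suc c)))

belowWord-commonSuffix′ : ∀ G G2 n k d → d + k < n →
          (∀ r1 c1 → k < r1 → r1 ≤ d + k → G r1 c1 ≡ G2 r1 c1) →
          Σ (List ℕ) λ M → (belowWord G n k ≡ belowWord G n (d + k) ++ M) × (belowWord G2 n k ≡ belowWord G2 n (d + k) ++ M)
belowWord-commonSuffix′ G G2 n k zero rn h = [] , sym (++-identityʳ _) , sym (++-identityʳ _)
belowWord-commonSuffix′ G G2 n k (suc d) rn h with belowWord-commonSuffix′ G G2 n (suc k) d (subst (_< n) (sym (+-suc d k)) rn)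
                                      (λ r1 c1 a b → h r1 c1 (<-trans (n<1+n k) a) (subst (r1 ≤_) (+-suc d k) b))
... | M , e1 , e2 = M ++ rowWord G (suc k) (n ∸ suc k) , g G e1 , trans (g G2 e2) (cong (λ z → belowWord G2 n (suc d + k) ++ M ++ z) (sym ra))
  where
  kn : k < n
  kn = ≤-<-trans (m≤n+m k (suc d)) rn
  ra : rowWord G (suc k) (n ∸ suc k) ≡ rowWord G2 (suc k) (n ∸ suc k)
  ra = rowWord-cong-grid G G2 (suc k) (n ∸ suc k) (λ c1 _ _ → h (suc k) c1 ≤-refl (s≤s (m≤n+m k d)))
  g : ∀ H → belowWord H n (suc k) ≡ belowWord H n (d + suc k) ++ M → belowWord H n k ≡ belowWord H n (suc d + k) ++ M ++ rowWord H (suc k) (n ∸ suc k)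
  g H e = trans (belowWord-step H n k kn) (trans (cong (_++ _) e) (trans (++-assoc (belowWord H n (d + suc k)) M _)
            (cong (λ z → belowWord H n z ++ M ++ rowWord H (suc k) (n ∸ suc k)) (+-suc d k))))

belowWord-commonSuffix : ∀ G G2 n k r → k ≤ r → r < n →
          (∀ r1 c1 → k < r1 → r1 ≤ r → G r1 c1 ≡ G2 r1 c1) →
          Σ (List ℕ) λ M → (belowWord G n k ≡ belowWord G n r ++ M) × (belowWord G2 n k ≡ belowWord G2 n r ++ M)
belowWord-commonSuffix G G2 n k r le rn h with belowWord-commonSuffix′ G G2 n k (r ∸ k) (subst (_< n) (sym (m∸n+n≡m le)) rn) (λ r1 c1 a b → h r1 c1 a (subst (r1 ≤_) (m∸n+n≡m le) b))
... | M , e1 , e2 = M , subst (λ z → belowWord G n k ≡ belowWord G n z ++ M) (m∸n+n≡m le) e1 , subst (λ z → belowWord G2 n k ≡ belowWord G2 n z ++ M) (m∸n+n≡m le) e2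

Processed : ℕ → ℕ → ℕ → ℕ → Set
Processed i j r c = r < i ⊎ (r ≡ i × j < c)

prefixWord-commonExtension : ∀ G G2 n i j k c → i < n → j ≤ n ∸ i →
        (∀ r1 c1 → Processed i j r1 c1 → G r1 c1 ≡ G2 r1 c1) →
        (k < i × c ≤ n ∸ k) ⊎ (k ≡ i × j ≤ c × c ≤ n ∸ i) →
        Σ (List ℕ) λ M → (prefixWord G n k c ≡ prefixWord G n i j ++ M) × (prefixWord G2 n k c ≡ prefixWord G2 n i j ++ M)
prefixWord-commonExtension G G2 n i j k c ilt jle h (inj₂ (refl , jc , cn)) =
  rowWordFrom G i j (c ∸ j) , e G , trans (e G2) (cong (prefixWord G2 n i j ++_) (sym (rowWordFrom-cong-grid G G2 i j (c ∸ j) (λ c1 a b → h i c1 (inj₂ (refl , a))))))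
  where
  e : ∀ H → prefixWord H n i c ≡ prefixWord H n i j ++ rowWordFrom H i j (c ∸ j)
  e H = trans (cong (λ z → belowWord H n i ++ rowWord H i z) (sym (m∸n+n≡m jc)))
          (trans (cong (belowWord H n i ++_) (rowWord-extend H i j (c ∸ j))) (sym (++-assoc (belowWord H n i) _ _)))
prefixWord-commonExtension G G2 n zero j k c ilt jle h (inj₁ (() , _))
prefixWord-commonExtension G G2 n (suc i) j k c ilt jle h (inj₁ (ki , cn))
  with belowWord-commonSuffix G G2 n k i (≤-pred ki) (<-trans (n<1+n i) ilt) (λ r1 c1 a b → h r1 c1 (inj₁ (s≤s b)))
... | M , e1 , e2 = Mid G , f G M e1 , trans (f G2 M e2) (cong (prefixWord G2 n (suc i) j ++_) (sym midEq))
  where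
  m0 : ℕ
  m0 = n ∸ suc i ∸ j
  Mid : Grid → List ℕ
  Mid H = rowWordFrom H (suc i) j m0 ++ M ++ rowWord H k c
  midEq : Mid G ≡ Mid G2
  midEq = cong₂ (λ z1 z2 → z1 ++ M ++ z2) (rowWordFrom-cong-grid G G2 (suc i) j m0 (λ c1 a b → h (suc i) c1 (inj₂ (refl , a))))
                                           (rowWord-cong-grid G G2 k c (λ c1 _ _ → h k c1 (inj₁ ki)))
  solveAssoc : (a b c d e : List ℕ) → ((a ++ (b ++ c)) ++ d) ++ e ≡ (a ++ b) ++ c ++ d ++ e
  solveAssoc a b c d e = trans (cong (λ z → (z ++ d) ++ e) (sym (++-assoc a b c)))
                         (trans (++-assoc ((a ++ b) ++ c) d e) (++-assoc (a ++ b) c (d ++ e)))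
  f : ∀ H M → belowWord H n k ≡ belowWord H n i ++ M → prefixWord H n k c ≡ prefixWord H n (suc i) j ++ rowWordFrom H (suc i) j m0 ++ M ++ rowWord H k c
  f H M e = begin
      belowWord H n k ++ rowWord H k c
    ≡⟨ cong (_++ rowWord H k c) e ⟩
      (belowWord H n i ++ M) ++ rowWord H k c
    ≡⟨ cong (λ z → (z ++ M) ++ rowWord H k c) (belowWord-step H n i (<-trans (n<1+n i) ilt)) ⟩
      ((belowWord H n (suc i) ++ rowWord H (suc i) (n ∸ suc i)) ++ M) ++ rowWord H k c
    ≡⟨ cong (λ z → ((belowWord H n (suc i) ++ rowWord H (suc i) z) ++ M) ++ rowWord H k c) (sym (m∸n+n≡m jle)) ⟩
      ((belowWord H n (suc i) ++ rowWord H (suc i) (m0 + j)) ++ M) ++ rowWord H k c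
    ≡⟨ cong (λ z → ((belowWord H n (suc i) ++ z) ++ M) ++ rowWord H k c) (rowWord-extend H (suc i) j m0) ⟩
      ((belowWord H n (suc i) ++ (rowWord H (suc i) j ++ rowWordFrom H (suc i) j m0)) ++ M) ++ rowWord H k c
    ≡⟨ solveAssoc (belowWord H n (suc i)) (rowWord H (suc i) j) (rowWordFrom H (suc i) j m0) M (rowWord H k c) ⟩
      (belowWord H n (suc i) ++ rowWord H (suc i) j) ++ rowWordFrom H (suc i) j m0 ++ M ++ rowWord H k c
    ∎
    where open ≡-Reasoning

cellWord : Grid → Pos → List ℕ
cellWord R (i , j) = if R i j then (i + j ∸ 1) ∷ [] else []

concatMap-concatMap : ∀ {A B C : Set} (f : B → List C) (g : A → List B) xs →
  concatMap f (concatMap g xs) ≡ concatMap (λ x → concatMap f (g x)) xs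
concatMap-concatMap f g [] = refl
concatMap-concatMap f g (x ∷ xs) = trans (concatMap-++ f (g x) (concatMap g xs)) (cong (concatMap f (g x) ++_) (concatMap-concatMap f g xs))

cellWord-tileWord : ∀ G i m → cellWord G (i , suc m) ≡ tileWord G i (suc m)
cellWord-tileWord G i m with G i (suc m)
... | true = cong (λ z → (z ∸ 1) ∷ []) (+-suc i m)
... | false = refl

row-cellWords : ∀ G i m → concatMap (cellWord G) (map (λ j → (i , j)) (desc m)) ≡ rowWordRev G i m
row-cellWords G i zero = refl
row-cellWords G i (suc m) = cong₂ _++_ (cellWord-tileWord G i m) (row-cellWords G i m)

tileWord-reverse : ∀ G r c → reverse (tileWord G r c) ≡ tileWord G r c
tileWord-reverse G r zero = refl
tileWord-reverse G r (suc c) with G r (suc c)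
... | true = refl
... | false = refl

rowWordRev-reverse : ∀ G r c → rowWordRev G r c ≡ reverse (rowWord G r c)
rowWordRev-reverse G r zero = refl
rowWordRev-reverse G r (suc c) = trans (cong₂ _++_ (sym (tileWord-reverse G r (suc c))) (rowWordRev-reverse G r c)) (sym (reverse-++ (rowWord G r c) (tileWord G r (suc c))))

applyUpTo-cong : ∀ {A : Set} (f g : ℕ → A) k → (∀ x → f x ≡ g x) → applyUpTo f k ≡ applyUpTo g k
applyUpTo-cong f g zero h = refl
applyUpTo-cong f g (suc k) h = cong₂ _∷_ (h 0) (applyUpTo-cong (f ∘ suc) (g ∘ suc) k (λ x → h (suc x)))

rowsRev-reverse : ∀ G n r k → concatMap (λ i → rowWordRev G i (n ∸ i)) (applyUpTo (λ x → suc (r + x)) k) ≡ reverse (belowWordRows G n r k)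
rowsRev-reverse G n r zero = refl
rowsRev-reverse G n r (suc k) =
  trans (cong₂ _++_ (cong (λ z → rowWordRev G z (n ∸ z)) (cong suc (+-identityʳ r)))
                    (trans (cong (concatMap (λ i → rowWordRev G i (n ∸ i))) (applyUpTo-cong _ (λ x → suc (suc r + x)) k (λ x → cong suc (+-suc r x))))
                           (rowsRev-reverse G n (suc r) k)))
  (trans (cong (_++ reverse (belowWordRows G n (suc r) k)) (rowWordRev-reverse G (suc r) (n ∸ suc r)))
         (sym (reverse-++ (belowWordRows G n (suc r) k) (rowWord G (suc r) (n ∸ suc r)))))

rcWord-reverse : ∀ n G → rcWord n G ≡ reverse (belowWord G n 0)
rcWord-reverse n G =
  trans (concatMap-concatMap (cellWord G) (λ i → map (λ j → (i , j)) (desc (n ∸ i))) (oneToN (n ∸ 1)))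
  (trans (cong (λ z → concatMap (λ i → concatMap (cellWord G) (map (λ j → (i , j)) (desc (n ∸ i)))) z) (map-applyUpTo id suc (n ∸ 1)))
  (trans (Data.List.Properties.concatMap-cong (λ i → row-cellWords G i (n ∸ i)) (applyUpTo suc (n ∸ 1)))
         (rowsRev-reverse G n 0 (n ∸ 1))))

All-reverse : ∀ {P : ℕ → Set} xs → All P xs → All P (reverse xs)
All-reverse [] [] = []
All-reverse {P} (x ∷ xs) (px ∷ pxs) = subst (All P) (sym (unfold-reverse x xs)) (++⁺ (All-reverse xs pxs) (px ∷ []))

letters-rowWord : ∀ G n r c → 1 ≤ r → r + c ≤ n → Letters n (rowWord G r c)
letters-rowWord G n r zero _ _ = []
letters-rowWord G n r (suc c) lr le with G r (suc c)
... | true = ++⁺ (letters-rowWord G n r c lr (≤-trans (+-monoʳ-≤ r (n≤1+n c)) le))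
                 ((≤-trans lr (m≤m+n r c) , subst (_≤ n) (+-suc r c) le) ∷ [])
... | false = ++⁺ (letters-rowWord G n r c lr (≤-trans (+-monoʳ-≤ r (n≤1+n c)) le)) []

letters-belowWordRows : ∀ G n r k → Letters n (belowWordRows G n r k)
letters-belowWordRows G n r zero = []
letters-belowWordRows G n r (suc k) = ++⁺ (letters-belowWordRows G n (suc r) k) rl
  where
  rl : Letters n (rowWord G (suc r) (n ∸ suc r))
  rl with suc r ≤? n
  ... | yes le = letters-rowWord G n (suc r) (n ∸ suc r) (s≤s z≤n) (≤-reflexive (m+[n∸m]≡n le))
  ... | no nle rewrite m≤n⇒m∸n≡0 (<⇒≤ (≰⇒> nle)) = []

letters-rcWord : ∀ n G → Letters n (rcWord n G)
letters-rcWord n G = subst (Letters n) (sym (rcWord-reverse n G)) (All-reverse _ (letters-belowWordRows G n 0 (n ∸ 1)))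

length-rcWord : ∀ n G → length (rcWord n G) ≡ length (belowWord G n 0)
length-rcWord n G = trans (cong length (rcWord-reverse n G)) (length-reverse (belowWord G n 0))

at-applyUpTo : ∀ (f : ℕ → ℕ) k q → q < k → at (applyUpTo f k) (suc q) ≡ f q
at-applyUpTo f (suc k) zero _ = refl
at-applyUpTo f (suc zero) (suc q) (s≤s ())
at-applyUpTo f (suc (suc k)) (suc q) (s≤s lt) = at-applyUpTo (f ∘ suc) (suc k) q lt

oneToN-applyUpTo : ∀ n → oneToN n ≡ applyUpTo suc n
oneToN-applyUpTo n = map-applyUpTo id suc n

at-oneToN : ∀ n q → 1 ≤ q → q ≤ n → at (oneToN n) q ≡ q
at-oneToN n (suc q) _ le = trans (cong (λ z → at z (suc q)) (oneToN-applyUpTo n)) (at-applyUpTo suc n q le)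

length-oneToN : ∀ n → length (oneToN n) ≡ n
length-oneToN n = trans (length-map suc (upTo n)) (length-applyUpTo id n)

module TopLabels (n : ℕ) (w : List ℕ) (G : Grid) (length-w : length w ≡ n) where
  BL : List ℕ
  BL = belowWord G n 0
  ws : List ℕ
  ws = rcWord n G

  lets : Letters n ws
  lets = letters-rcWord n G

  ws-into : MapsInto (applyWordF id ws) 1 n
  ws-into = applyWordF-mapsInto id ws n lets (id-mapsInto 1 n)

  applyWord-at : ∀ q → 1 ≤ q → q ≤ n → at (applyWord (oneToN n) ws) q ≡ applyWordF id ws q
  applyWord-at q a b = trans (at-applyWord n (oneToN n) ws (length-oneToN n) lets q)
    (trans (applyWordF-∘ (at (oneToN n)) ws q)
           (at-oneToN n _ (proj₁ (ws-into q a b)) (proj₂ (ws-into q a b))))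

  ws-BL : ∀ p → applyWordF id ws (applyWordF id BL p) ≡ p
  ws-BL p = trans (sym (applyWordF-∘ (applyWordF id ws) BL p))
                  (trans (cong (λ z → applyWordF (applyWordF id z) BL p) (rcWord-reverse n G)) (applyWordF-reverseˡ id BL p))

  BL-ws : ∀ q → applyWordF id BL (applyWordF id ws q) ≡ q
  BL-ws q = trans (sym (applyWordF-∘ (applyWordF id BL) ws q))
                  (trans (cong (λ z → applyWordF (applyWordF id BL) z q) (rcWord-reverse n G)) (applyWordF-reverseʳ id BL q))

  word→top : applyWord (oneToN n) ws ≡ w → ∀ p → 1 ≤ p → p ≤ n → at w (below G n 0 p) ≡ p
  word→top e p a b =
    let q = below G n 0 p
        (qa , qb) = below-mapsInto₁ G n 0 p a b
    in trans (cong (λ z → at z q) (sym e))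
       (trans (applyWord-at q qa qb)
       (trans (cong (applyWordF id ws) (below-word G n 0 p)) (ws-BL p)))

  top→word : (∀ p → 1 ≤ p → p ≤ n → at w (below G n 0 p) ≡ p) → applyWord (oneToN n) ws ≡ w
  top→word h = at-ext _ _ (trans (applyWord-length (oneToN n) ws) (trans (length-oneToN n) (sym length-w))) pt
    where
    pt : ∀ q → 1 ≤ q → q ≤ length (applyWord (oneToN n) ws) → at (applyWord (oneToN n) ws) q ≡ at w q
    pt q a b' =
      let b = subst (q ≤_) (trans (applyWord-length (oneToN n) ws) (length-oneToN n)) b'
          p = applyWordF id ws q
          (pa , pb) = ws-into q a b
      in trans (applyWord-at q a b)
         (sym (trans (cong (at w) (sym (trans (below-word G n 0 p) (BL-ws q)))) (h p pa pb)))

inversions : List ℕ → ℕ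
inversions [] = 0
inversions (x ∷ xs) = countLt x xs + inversions xs

countLt-swap : ∀ x a ys → countLt x (swapAt a ys) ≡ countLt x ys
countLt-swap x zero ys = refl
countLt-swap x (suc zero) [] = refl
countLt-swap x (suc zero) (y ∷ []) = refl
countLt-swap x (suc zero) (y ∷ z ∷ zs) with y <ᵇ x | z <ᵇ x
... | true | true = refl
... | true | false = refl
... | false | true = refl
... | false | false = refl
countLt-swap x (suc (suc a)) [] = refl
countLt-swap x (suc (suc a)) (y ∷ ys) with y <ᵇ x
... | true = cong suc (countLt-swap x (suc a) ys)
... | false = countLt-swap x (suc a) ys

countLt-≤-∷ : ∀ x y zs → countLt x zs ≤ countLt x (y ∷ zs)
countLt-≤-∷ x y zs with y <ᵇ x
... | true = n≤1+n _
... | false = ≤-refl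

countLt-∷-< : ∀ x y L → y < x → countLt x (y ∷ L) ≡ suc (countLt x L)
countLt-∷-< x y L y<x rewrite <ᵇ-true y<x = refl

countLt-∷-≮ : ∀ x y L → ¬ y < x → countLt x (y ∷ L) ≡ countLt x L
countLt-∷-≮ x y L y≮x rewrite <ᵇ-false {y} {x} (≮⇒≥ y≮x) = refl

+-exchange : ∀ a b c → a + (b + c) ≡ b + (a + c)
+-exchange a b c = trans (sym (+-assoc a b c)) (trans (cong (_+ c) (+-comm a b)) (+-assoc b a c))

inversions-swap-descent : ∀ x y zs → y < x → inversions (x ∷ y ∷ zs) ≡ suc (inversions (y ∷ x ∷ zs))
inversions-swap-descent x y zs y<x
  rewrite countLt-∷-< x y zs y<x | countLt-∷-≮ y x zs (<⇒≯ y<x) = cong suc (+-exchange (countLt x zs) (countLt y zs) (inversions zs))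

inversions-swap-ascent : ∀ x y zs → ¬ y < x → inversions (x ∷ y ∷ zs) ≤ inversions (y ∷ x ∷ zs)
inversions-swap-ascent x y zs y≮x = begin
    countLt x (y ∷ zs) + (countLt y zs + inversions zs) ≡⟨ cong (_+ _) (countLt-∷-≮ x y zs y≮x) ⟩
    countLt x zs + (countLt y zs + inversions zs)       ≡⟨ +-exchange (countLt x zs) (countLt y zs) (inversions zs) ⟩
    countLt y zs + (countLt x zs + inversions zs)       ≤⟨ +-monoˡ-≤ _ (countLt-≤-∷ y x zs) ⟩
    countLt y (x ∷ zs) + (countLt x zs + inversions zs) ∎
  where open ≤-Reasoning

inversions-swapAt-≤ : ∀ a xs → inversions xs ≤ suc (inversions (swapAt a xs))
inversions-swapAt-≤ zero xs = n≤1+n _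
inversions-swapAt-≤ (suc zero) [] = n≤1+n _
inversions-swapAt-≤ (suc zero) (x ∷ []) = n≤1+n _
inversions-swapAt-≤ (suc zero) (x ∷ y ∷ zs) with y <? x
... | yes y<x = ≤-reflexive (inversions-swap-descent x y zs y<x)
... | no y≮x = ≤-trans (inversions-swap-ascent x y zs y≮x) (n≤1+n _)
inversions-swapAt-≤ (suc (suc a)) [] = n≤1+n _
inversions-swapAt-≤ (suc (suc a)) (x ∷ xs) = begin
    countLt x xs + inversions xs
  ≤⟨ +-monoʳ-≤ (countLt x xs) (inversions-swapAt-≤ (suc a) xs) ⟩
    countLt x xs + suc (inversions (swapAt (suc a) xs))
  ≡⟨ +-suc _ _ ⟩
    suc (countLt x xs + inversions (swapAt (suc a) xs))
  ≡⟨ cong (λ z → suc (z + inversions (swapAt (suc a) xs))) (sym (countLt-swap x (suc a) xs)) ⟩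
    suc (countLt x (swapAt (suc a) xs) + inversions (swapAt (suc a) xs)) ∎
  where open ≤-Reasoning

inversions-swapAt-ascent : ∀ a xs → at xs a ≤ at xs (suc a) → inversions xs ≤ inversions (swapAt a xs)
inversions-swapAt-ascent zero xs _ = ≤-refl
inversions-swapAt-ascent (suc zero) [] _ = ≤-refl
inversions-swapAt-ascent (suc zero) (x ∷ []) _ = ≤-refl
inversions-swapAt-ascent (suc zero) (x ∷ y ∷ zs) x≤y = inversions-swap-ascent x y zs (≤⇒≯ x≤y)
inversions-swapAt-ascent (suc (suc a)) [] _ = ≤-refl
inversions-swapAt-ascent (suc (suc a)) (x ∷ xs) le =
  subst (λ z → countLt x xs + inversions xs ≤ z + inversions (swapAt (suc a) xs)) (sym (countLt-swap x (suc a) xs))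
        (+-monoʳ-≤ (countLt x xs) (inversions-swapAt-ascent (suc a) xs le))

tabulate₁ : ℕ → Labelling → List ℕ
tabulate₁ n f = map f (oneToN n)

at-map : ∀ (f : Labelling) xs p → 1 ≤ p → p ≤ length xs → at (map f xs) p ≡ f (at xs p)
at-map f (x ∷ xs) (suc zero) _ _ = refl
at-map f (x ∷ y ∷ xs) (suc (suc p)) _ (s≤s le) = at-map f (y ∷ xs) (suc p) (s≤s z≤n) le
at-map f (x ∷ []) (suc (suc p)) _ (s≤s ())

length-tabulate₁ : ∀ n f → length (tabulate₁ n f) ≡ n
length-tabulate₁ n f = trans (length-map f (oneToN n)) (length-oneToN n)

at-tabulate₁ : ∀ n f p → 1 ≤ p → p ≤ n → at (tabulate₁ n f) p ≡ f p
at-tabulate₁ n f p a b = trans (at-map f (oneToN n) p a (subst (p ≤_) (sym (length-oneToN n)) b)) (cong f (at-oneToN n p a b))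

tabulate₁-cong : ∀ n f g → (∀ p → 1 ≤ p → p ≤ n → f p ≡ g p) → tabulate₁ n f ≡ tabulate₁ n g
tabulate₁-cong n f g h = at-ext _ _ (trans (length-tabulate₁ n f) (sym (length-tabulate₁ n g)))
  (λ p a b → let b' = subst (p ≤_) (length-tabulate₁ n f) b in trans (at-tabulate₁ n f p a b') (trans (h p a b') (sym (at-tabulate₁ n g p a b'))))

tabulate₁-swapF : ∀ n f e → 1 ≤ e → e < n → tabulate₁ n (swapF e f) ≡ swapAt e (tabulate₁ n f)
tabulate₁-swapF n f e a b = at-ext _ _ (trans (length-tabulate₁ n _) (sym (trans (swapAt-length e _) (length-tabulate₁ n f))))
  (λ p pa pb → let pb' = subst (p ≤_) (length-tabulate₁ n _) pb
                   (sa , sb) = transpose-inRange 1 n e p a b pa pb'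
               in trans (at-tabulate₁ n _ p pa pb')
                  (sym (trans (at-swapAt e (tabulate₁ n f) a (subst (e <_) (sym (length-tabulate₁ n f)) b) p) (at-tabulate₁ n f _ sa sb))))

data TransposeView (e p : ℕ) : Set where
  isE : p ≡ e → TransposeView e p
  isSE : p ≡ suc e → TransposeView e p
  other : p ≢ e → p ≢ suc e → TransposeView e p

transposeView : ∀ e p → TransposeView e p
transposeView e p with p ≟ e
... | yes x = isE x
... | no x with p ≟ suc e
...   | yes y = isSE y
...   | no y = other x y

module InversionCount (n : ℕ) (w : List ℕ) where
  Φ : Labelling → ℕ
  Φ σ = inversions (tabulate₁ n (λ p → at w (σ p)))

  tabulate-w∘swapF : ∀ σ e → 1 ≤ e → e < n → tabulate₁ n (λ p → at w (swapF e σ p)) ≡ swapAt e (tabulate₁ n (λ p → at w (σ p)))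
  tabulate-w∘swapF σ e a b = tabulate₁-swapF n (λ p → at w (σ p)) e a b

  Φ-swapF-≤ : ∀ σ e → 1 ≤ e → e < n → Φ σ ≤ suc (Φ (swapF e σ))
  Φ-swapF-≤ σ e a b rewrite tabulate-w∘swapF σ e a b = inversions-swapAt-≤ e _

  Φ-swapF-ascent : ∀ σ e → 1 ≤ e → e < n → at w (σ e) ≤ at w (σ (suc e)) → Φ σ ≤ Φ (swapF e σ)
  Φ-swapF-ascent σ e a b le rewrite tabulate-w∘swapF σ e a b =
    inversions-swapAt-ascent e _ (subst₂ _≤_ (sym (at-tabulate₁ n _ e a (<⇒≤ b))) (sym (at-tabulate₁ n _ (suc e) (s≤s z≤n) b)) le)

  Descending : Labelling → List ℕ → Set
  Descending σ [] = ⊤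
  Descending σ (e ∷ L) = (at w (σ (suc e)) < at w (σ e)) × Descending (swapF e σ) L

  Φ-applyWordF-≤ : ∀ σ L → Letters n L → Φ σ ≤ Φ (applyWordF σ L) + length L
  Φ-applyWordF-≤ σ [] _ = ≤-reflexive (sym (+-identityʳ _))
  Φ-applyWordF-≤ σ (e ∷ L) ((a , b) ∷ ls) = ≤-trans (Φ-swapF-≤ σ e a b)
    (≤-trans (s≤s (Φ-applyWordF-≤ (swapF e σ) L ls)) (≤-reflexive (sym (+-suc _ _))))

  -- Each letter lowers Φ by at most one, so a word that lowers it by its full length
  -- lowers it at every letter.
  tight⇒descending : ∀ σ L → Letters n L → Φ (applyWordF σ L) + length L ≤ Φ σ → Descending σ L
  tight⇒descending σ [] _ _ = tt
  tight⇒descending σ (e ∷ L) ((a , b) ∷ ls) le = dsc , tight⇒descending (swapF e σ) L ls le2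
    where
    le1 : suc (Φ (applyWordF (swapF e σ) L) + length L) ≤ Φ σ
    le1 = subst (_≤ Φ σ) (+-suc _ _) le
    le3 : suc (Φ (swapF e σ)) ≤ Φ σ
    le3 = ≤-trans (s≤s (Φ-applyWordF-≤ (swapF e σ) L ls)) le1
    le2 : Φ (applyWordF (swapF e σ) L) + length L ≤ Φ (swapF e σ)
    le2 = ≤-pred (≤-trans le1 (Φ-swapF-≤ σ e a b))
    dsc : at w (σ (suc e)) < at w (σ e)
    dsc with at w (σ (suc e)) <? at w (σ e)
    ... | yes d = d
    ... | no nd = ⊥-elim (<-irrefl refl (≤-trans le3 (Φ-swapF-ascent σ e a b (≮⇒≥ nd))))

  descending-++⁻ʳ : ∀ σ L1 L2 → Descending σ (L1 ++ L2) → Descending (applyWordF σ L1) L2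
  descending-++⁻ʳ σ [] L2 d = d
  descending-++⁻ʳ σ (e ∷ L1) L2 (_ , d) = descending-++⁻ʳ (swapF e σ) L1 L2 d

  descending-++⁻ˡ : ∀ σ L1 L2 → Descending σ (L1 ++ L2) → Descending σ L1
  descending-++⁻ˡ σ [] L2 d = tt
  descending-++⁻ˡ σ (e ∷ L1) L2 (d1 , d) = d1 , descending-++⁻ˡ (swapF e σ) L1 L2 d

  LeftOf : ℕ → ℕ → Labelling → Set
  LeftOf a b σ = ∀ p q → σ p ≡ a → σ q ≡ b → p < q

  transpose-order : ∀ e p q → transpose e p < transpose e q → (p ≡ suc e × q ≡ e) ⊎ p < q
  transpose-order e p q lt with transposeView e p | transposeView e q
  ... | isE refl | isE refl = ⊥-elim (<-irrefl refl lt)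
  ... | isE refl | isSE refl = inj₂ (n<1+n p)
  ... | isE refl | other q1 q2 = inj₂ (<-trans (n<1+n p) (subst₂ _<_ (transpose-matchˡ p) (transpose-noMatch p q q1 q2) lt))
  ... | isSE refl | isE refl = inj₁ (refl , refl)
  ... | isSE refl | isSE refl = ⊥-elim (<-irrefl refl lt)
  ... | isSE refl | other q1 q2 = inj₂ (lem2 (subst₂ _<_ (transpose-matchʳ e) (transpose-noMatch e q q1 q2) lt))
    where lem2 : e < q → suc e < q
          lem2 l with m≤n⇒m<n∨m≡n l
          ... | inj₁ x = x
          ... | inj₂ x = ⊥-elim (q2 (sym x))
  ... | other p1 p2 | isE refl = inj₂ (lem (subst₂ _<_ (transpose-noMatch q p p1 p2) (transpose-matchˡ q) lt))
    where lem : p < suc q → p < q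
          lem l with m≤n⇒m<n∨m≡n (≤-pred l)
          ... | inj₁ x = x
          ... | inj₂ x = ⊥-elim (p1 x)
  ... | other p1 p2 | isSE refl = inj₂ (<-trans (subst₂ _<_ (transpose-noMatch e p p1 p2) (transpose-matchʳ e) lt) (n<1+n e))
  ... | other p1 p2 | other q1 q2 = inj₂ (subst₂ _<_ (transpose-noMatch e p p1 p2) (transpose-noMatch e q q1 q2) lt)

  leftOf-swapF : ∀ a b σ e → at w a < at w b → at w (σ (suc e)) < at w (σ e) → LeftOf a b σ → LeftOf a b (swapF e σ)
  leftOf-swapF a b σ e wab d al p q pa qb with transpose-order e p q (al (transpose e p) (transpose e q) pa qb)
  ... | inj₂ x = x
  ... | inj₁ (refl , refl) = ⊥-elim (<-asym wab (subst₂ (λ u v → at w u < at w v) x1 x2 d))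
    where
    x1 : σ (suc e) ≡ b
    x1 = trans (cong σ (sym (transpose-matchˡ e))) qb
    x2 : σ e ≡ a
    x2 = trans (cong σ (sym (transpose-matchʳ e))) pa

  leftOf-descending : ∀ a b σ L → at w a < at w b → LeftOf a b σ → Descending σ L → LeftOf a b (applyWordF σ L)
  leftOf-descending a b σ [] wab al _ = al
  leftOf-descending a b σ (e ∷ L) wab al (d , ds) = leftOf-descending a b (swapF e σ) L wab (leftOf-swapF a b σ e wab d al) ds

  leftOf-cong : ∀ a b σ τ → σ ≗ τ → LeftOf a b σ → LeftOf a b τ
  leftOf-cong a b σ τ e al p q pa qb = al p q (trans (e p) pa) (trans (e q) qb)

countLt-↭ : ∀ x {xs ys} → xs ↭ ys → countLt x xs ≡ countLt x ys
countLt-↭ x ↭.refl = refl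
countLt-↭ x (↭.prep y p) with y <ᵇ x
... | true = cong suc (countLt-↭ x p)
... | false = countLt-↭ x p
countLt-↭ x (↭.swap y z p) with y <ᵇ x | z <ᵇ x
... | true | true = cong (suc ∘ suc) (countLt-↭ x p)
... | true | false = cong suc (countLt-↭ x p)
... | false | true = cong suc (countLt-↭ x p)
... | false | false = countLt-↭ x p
countLt-↭ x (↭.trans p q) = trans (countLt-↭ x p) (countLt-↭ x q)

countLt-mono : ∀ x y xs → x ≤ y → countLt x xs ≤ countLt y xs
countLt-mono x y [] le = z≤n
countLt-mono x y (z ∷ zs) le with z <ᵇ x in e1 | z <ᵇ y in e2
... | true | true = s≤s (countLt-mono x y zs le)
... | false | true = ≤-trans (countLt-mono x y zs le) (n≤1+n _)
... | false | false = countLt-mono x y zs le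
... | true | false = ⊥-elim (<⇒≱ (<-≤-trans (<ᵇ⇒< z x (subst T (sym e1) tt)) le) (≮⇒≥ (λ l → subst T e2 (<⇒<ᵇ l))))

countLt-strict : ∀ x y xs p → 1 ≤ p → p ≤ length xs → at xs p ≡ x → x < y → countLt x xs < countLt y xs
countLt-strict x y (z ∷ zs) (suc zero) _ _ refl lt rewrite <ᵇ-false {z} {z} ≤-refl | <ᵇ-true lt = s≤s (countLt-mono z y zs (<⇒≤ lt))
countLt-strict x y (z ∷ z2 ∷ zs) (suc (suc p)) _ (s≤s le) e lt with z <ᵇ x in e1 | z <ᵇ y in e2
... | true | true = s≤s (countLt-strict x y (z2 ∷ zs) (suc p) (s≤s z≤n) le e lt)
... | false | true = ≤-trans (countLt-strict x y (z2 ∷ zs) (suc p) (s≤s z≤n) le e lt) (n≤1+n _)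
... | false | false = countLt-strict x y (z2 ∷ zs) (suc p) (s≤s z≤n) le e lt
... | true | false = ⊥-elim (<⇒≱ (<-trans (<ᵇ⇒< z x (subst T (sym e1) tt)) lt) (≮⇒≥ (λ l → subst T e2 (<⇒<ᵇ l))))
countLt-strict x y (z ∷ []) (suc (suc p)) _ (s≤s ()) e lt

countLt-len : ∀ x xs → countLt x xs ≤ length xs
countLt-len x [] = z≤n
countLt-len x (y ∷ ys) with y <ᵇ x
... | true = s≤s (countLt-len x ys)
... | false = ≤-trans (countLt-len x ys) (n≤1+n _)

drop-at : ∀ r (w : List ℕ) → r < length w → drop r w ≡ at w (suc r) ∷ drop (suc r) w
drop-at zero (x ∷ w) _ = refl
drop-at (suc r) (x ∷ w) (s≤s lt) = trans (drop-at r w lt) (cong (_∷ drop (suc r) w) (sym (at-suc r x w lt)))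
  where
  at-suc : ∀ r x (w : List ℕ) → r < length w → at (x ∷ w) (suc (suc r)) ≡ at w (suc r)
  at-suc r x w _ = refl

at-drop : ∀ r (w : List ℕ) q → r < q → at (drop r w) (q ∸ r) ≡ at w q
at-drop zero w q _ = refl
at-drop (suc r) [] q _ = refl
at-drop (suc r) (x ∷ []) (suc (suc q)) (s≤s lt) = trans (at-drop r [] (suc q) lt) refl
at-drop (suc r) (x ∷ y ∷ w) (suc (suc q)) (s≤s lt) = at-drop r (y ∷ w) (suc q) lt
at-drop (suc r) (x ∷ w) (suc zero) (s≤s ())

at-∈ : ∀ xs p → 1 ≤ p → p ≤ length xs → at xs p ∈ xs
at-∈ (x ∷ xs) (suc zero) _ _ = here refl
at-∈ (x ∷ y ∷ xs) (suc (suc p)) _ (s≤s le) = there (at-∈ (y ∷ xs) (suc p) (s≤s z≤n) le)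
at-∈ (x ∷ []) (suc (suc p)) _ (s≤s ())

occurrences : ℕ → List ℕ → ℕ
occurrences x [] = 0
occurrences x (y ∷ ys) = if y ≡ᵇ x then suc (occurrences x ys) else occurrences x ys

occurrences-↭ : ∀ x {xs ys} → xs ↭ ys → occurrences x xs ≡ occurrences x ys
occurrences-↭ x ↭.refl = refl
occurrences-↭ x (↭.prep y p) with y ≡ᵇ x
... | true = cong suc (occurrences-↭ x p)
... | false = occurrences-↭ x p
occurrences-↭ x (↭.swap y z p) with y ≡ᵇ x | z ≡ᵇ x
... | true | true = cong (suc ∘ suc) (occurrences-↭ x p)
... | true | false = cong suc (occurrences-↭ x p)
... | false | true = cong suc (occurrences-↭ x p)
... | false | false = occurrences-↭ x p
occurrences-↭ x (↭.trans p q) = trans (occurrences-↭ x p) (occurrences-↭ x q)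

occurrences-above : ∀ x b k → x < b → occurrences x (applyUpTo (λ i → b + i) k) ≡ 0
occurrences-above x b zero lt = refl
occurrences-above x b (suc k) lt rewrite ≡ᵇ-≢ {b + 0} {x} (λ e → <-irrefl refl (<-≤-trans lt (≤-reflexive (trans (sym (+-identityʳ b)) e)))) =
  trans (cong (occurrences x) (applyUpTo-cong _ (λ i → suc b + i) k (λ i → +-suc b i))) (occurrences-above x (suc b) k (<-trans lt (n<1+n b)))

occurrences-upTo≤1 : ∀ x b k → occurrences x (applyUpTo (λ i → b + i) k) ≤ 1
occurrences-upTo≤1 x b zero = z≤n
occurrences-upTo≤1 x b (suc k) with (b + 0) ≡ᵇ x in e
... | true = s≤s (≤-reflexive (trans (cong (occurrences x) (applyUpTo-cong _ (λ i → suc b + i) k (λ i → +-suc b i)))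
                  (occurrences-above x (suc b) k (s≤s (≤-reflexive (trans (sym (≡ᵇ⇒≡ _ _ (subst T (sym e) tt))) (+-identityʳ b)))))))
... | false = subst (_≤ 1) (sym (cong (occurrences x) (applyUpTo-cong _ (λ i → suc b + i) k (λ i → +-suc b i)))) (occurrences-upTo≤1 x (suc b) k)

occurrences-twice : ∀ x xs q q2 → 1 ≤ q → q < q2 → q2 ≤ length xs → at xs q ≡ x → at xs q2 ≡ x → 2 ≤ occurrences x xs
occurrences-twice x (y ∷ ys) (suc zero) (suc (suc q2)) _ (s≤s (s≤s _)) (s≤s le) refl e2
  rewrite ≡ᵇ-refl y = s≤s (occurrences-pos y ys (suc q2) le e2 (s≤s z≤n))
  where
  occurrences-pos : ∀ x xs p → p ≤ length xs → at xs p ≡ x → 1 ≤ p → 1 ≤ occurrences x xs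
  occurrences-pos x xs zero _ _ ()
  occurrences-pos x (z ∷ zs) (suc zero) _ refl _ rewrite ≡ᵇ-refl z = s≤s z≤n
  occurrences-pos x (z ∷ z2 ∷ zs) (suc (suc p)) (s≤s le) e _ with z ≡ᵇ x
  ... | true = s≤s z≤n
  ... | false = occurrences-pos x (z2 ∷ zs) (suc p) le e (s≤s z≤n)
  occurrences-pos x (z ∷ []) (suc (suc p)) (s≤s ()) e _
  occurrences-pos x [] (suc p) () e _
occurrences-twice x (y ∷ y2 ∷ ys) (suc (suc q)) (suc (suc (suc q2))) _ (s≤s lt) (s≤s le) e1 e2 with y ≡ᵇ x
... | true = ≤-trans (occurrences-twice x (y2 ∷ ys) (suc q) (suc (suc q2)) (s≤s z≤n) lt le e1 e2) (n≤1+n _)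
... | false = occurrences-twice x (y2 ∷ ys) (suc q) (suc (suc q2)) (s≤s z≤n) lt le e1 e2
occurrences-twice x (y ∷ []) (suc (suc q)) (suc (suc (suc q2))) _ _ (s≤s ()) _ _
occurrences-twice x (y ∷ []) (suc (suc q)) (suc zero) _ (s≤s ()) _ _ _
occurrences-twice x (y ∷ y2 ∷ ys) (suc (suc q)) (suc (suc zero)) _ (s≤s (s≤s ())) _ _ _

module Permutation (n : ℕ) (w : List ℕ) (pw : w ↭ oneToN n) where
  length-w : length w ≡ n
  length-w = trans (↭-length pw) (length-oneToN n)

  no-repeats : ∀ {x} → 2 ≤ occurrences x w → ⊥
  no-repeats {x} le = <-irrefl refl (≤-trans le (subst (_≤ 1) (sym (trans (occurrences-↭ x pw) (cong (occurrences x) (oneToN-applyUpTo n)))) (occurrences-upTo≤1 x 1 n)))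

  at-injective : ∀ q q2 → 1 ≤ q → q ≤ n → 1 ≤ q2 → q2 ≤ n → at w q ≡ at w q2 → q ≡ q2
  at-injective q q2 a b c d e with <-cmp q q2
  ... | tri≈ _ x _ = x
  ... | tri< lt _ _ = ⊥-elim (no-repeats (occurrences-twice (at w q) w q q2 a lt (subst (q2 ≤_) (sym length-w) d) refl (sym e)))
  ... | tri> _ _ gt = ⊥-elim (no-repeats (occurrences-twice (at w q) w q2 q c gt (subst (q ≤_) (sym length-w) b) (sym e) refl))

  ∈-upto : ∀ x b k → x ∈ applyUpTo (λ i → b + i) k → b ≤ x × x < b + k
  ∈-upto x b (suc k) (here refl) = ≤-reflexive (sym (+-identityʳ b)) , +-monoʳ-< b (s≤s z≤n)
  ∈-upto x b (suc k) (there m) =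
    let (l1 , l2) = ∈-upto x (suc b) k (subst (x ∈_) (applyUpTo-cong _ (λ i → suc b + i) k (λ i → +-suc b i)) m)
    in ≤-trans (n≤1+n b) l1 , subst (x <_) (sym (+-suc b k)) l2

  at-range : ∀ q → 1 ≤ q → q ≤ n → 1 ≤ at w q × at w q ≤ n
  at-range q a b =
    let m = ∈-resp-↭ pw (at-∈ w q a (subst (q ≤_) (sym length-w) b))
        (l1 , l2) = ∈-upto (at w q) 1 n (subst (at w q ∈_) (oneToN-applyUpTo n) m)
    in l1 , ≤-pred l2

  countLt-upTo : ∀ x b k → countLt x (applyUpTo (λ i → b + i) k) ≡ (x ∸ b) ⊓ k
  countLt-upTo x b zero = sym (⊓-zeroʳ (x ∸ b))
  countLt-upTo x b (suc k) with (b + 0) <ᵇ x in e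
  ... | true = trans (cong suc (trans (cong (countLt x) (applyUpTo-cong _ (λ i → suc b + i) k (λ i → +-suc b i))) (countLt-upTo x (suc b) k)))
                     (cong (_⊓ suc k) (sym (m∸n≡1+[m∸1+n] x b (subst (_< x) (+-identityʳ b) (<ᵇ⇒< _ _ (subst T (sym e) tt))))))
  ... | false = trans (trans (cong (countLt x) (applyUpTo-cong _ (λ i → suc b + i) k (λ i → +-suc b i))) (countLt-upTo x (suc b) k))
                  (trans (cong (_⊓ k) (m≤n⇒m∸n≡0 (≤-trans xb (n≤1+n b)))) (cong (_⊓ suc k) (sym (m≤n⇒m∸n≡0 xb))))
    where xb : x ≤ b
          xb = subst (x ≤_) (+-identityʳ b) (≮⇒≥ (λ l → subst T e (<⇒<ᵇ l)))

  countLt-perm : ∀ x → 1 ≤ x → x ≤ n → countLt x w ≡ x ∸ 1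
  countLt-perm x a b = trans (countLt-↭ x pw) (trans (cong (countLt x) (oneToN-applyUpTo n))
                      (trans (countLt-upTo x 1 n) (m≤n⇒m⊓n≡m (≤-trans (m∸n≤m x 1) b))))

  code≤ : ∀ r → codeAt w r ≤ n ∸ r
  code≤ zero = z≤n
  code≤ (suc r) = ≤-trans (countLt-len _ (drop (suc r) w)) (≤-reflexive (trans (length-drop (suc r) w) (cong (_∸ suc r) length-w)))

≤∸⇒+≤ : ∀ a c p → c ≤ p ∸ a → a ≤ p → a + c ≤ p
≤∸⇒+≤ a c p h le = ≤-trans (+-monoʳ-≤ a h) (≤-reflexive (m+[n∸m]≡n le))

∸<⇒<+ : ∀ a c p → p ∸ a < c → p < a + c
∸<⇒<+ a c p h with a ≤? p
... | yes le = subst (_< a + c) (m+[n∸m]≡n le) (+-monoʳ-< a h)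
... | no nle = <-≤-trans (≰⇒> nle) (m≤m+n a c)

Rbot-row-iff : ∀ w r c → 1 ≤ c → (Rbot w r c ≡ true → c ≤ codeAt w r) × (c ≤ codeAt w r → Rbot w r c ≡ true)
Rbot-row-iff w r c a = f , g
  where
  f : Rbot w r c ≡ true → c ≤ codeAt w r
  f e with 1 ≤ᵇ c | c ≤ᵇ codeAt w r in e2
  ... | true | true = ≤ᵇ⇒≤ c (codeAt w r) (subst T (sym e2) tt)
  ... | true | false = ⊥-elim (true≢false (sym e))
  ... | false | _ = ⊥-elim (true≢false (sym e))
  g : c ≤ codeAt w r → Rbot w r c ≡ true
  g le with 1 ≤ᵇ c in e1 | c ≤ᵇ codeAt w r in e2
  ... | true | true = refl
  ... | false | _ = ⊥-elim (subst T e1 (≤⇒≤ᵇ a))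
  ... | true | false = ⊥-elim (subst T e2 (≤⇒≤ᵇ le))

module BottomGraph (n : ℕ) (w : List ℕ) (pw : w ↭ oneToN n) where
  open Permutation n w pw

  B : ℕ → Labelling
  B r = below (Rbot w) n r

  Rbot-justified : ∀ r → LeftJustified (Rbot w) r (n ∸ r) (codeAt w r)
  Rbot-justified r c a _ = Rbot-row-iff w r c a

  -- In R_bot(w) the lines on the cut above row r + 1 are sorted by their values in w:
  -- the line on diagonal p has rank p − r among w_{r+1}, …, w_n.
  SortedBelow : ℕ → Set
  SortedBelow r = ∀ p → r < p → p ≤ n → countLt (at w (B r p)) (drop r w) ≡ p ∸ suc r

  sortedBelow-base : ∀ r → n ≤ suc r → SortedBelow r
  sortedBelow-base r nle p rp pn rewrite below-base (Rbot w) n r nle = goal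
    where
    p≡ : p ≡ suc r
    p≡ = ≤-antisym (≤-trans pn nle) rp
    rl : r < length w
    rl = subst (r <_) (sym length-w) (≤-trans rp pn)
    dnil : drop (suc r) w ≡ []
    dnil with drop (suc r) w | length-drop (suc r) w
    ... | [] | _ = refl
    ... | x ∷ xs | e = ⊥-elim (<-irrefl refl (≤-trans (s≤s z≤n) (≤-trans (≤-reflexive e) (≤-reflexive (trans (cong (_∸ suc r) length-w) (m≤n⇒m∸n≡0 nle))))))
    goal : countLt (at w p) (drop r w) ≡ p ∸ suc r
    goal rewrite drop-at r w rl | dnil | p≡ | <ᵇ-false {at w (suc r)} {at w (suc r)} ≤-refl | n∸n≡0 r = refl

  Rbot-rotation : ∀ r → IsRotation (suc r) (codeAt w (suc r)) (B (suc r)) (throughRow (Rbot w) (suc r) (n ∸ suc r) (B (suc r)))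
  Rbot-rotation r = leftJustified-rotation (Rbot w) (suc r) (n ∸ suc r) (codeAt w (suc r)) (B (suc r)) (Rbot-justified (suc r)) (code≤ (suc r))

  sortedBelow-inside : ∀ r → suc r < n → SortedBelow (suc r) → ∀ p → suc r ≤ p → p < suc r + codeAt w (suc r) →
                       countLt (at w (B (suc r) (suc p))) (at w (suc r) ∷ drop (suc r) w) ≡ p ∸ suc r
  sortedBelow-inside r lt ih p a b = trans (countLt-∷-≮ x (at w (suc r)) (drop (suc r) w) y≮x) rank
    where
    c = codeAt w (suc r)
    x = at w (B (suc r) (suc p))
    rank : countLt x (drop (suc r) w) ≡ p ∸ suc r
    rank = ih (suc p) (s≤s a) (≤-trans b (≤-trans (+-monoʳ-≤ (suc r) (code≤ (suc r))) (≤-reflexive (m+[n∸m]≡n (<⇒≤ lt)))))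
    y≮x : ¬ at w (suc r) < x
    y≮x yx = <-irrefl refl (<-≤-trans b (≤∸⇒+≤ (suc r) c p (subst (c ≤_) rank (countLt-mono _ x (drop (suc r) w) (<⇒≤ yx))) a))

  sortedBelow-beyond : ∀ r → suc r < n → SortedBelow (suc r) → ∀ p → suc r + codeAt w (suc r) < p → p ≤ n →
                       countLt (at w (B (suc r) p)) (at w (suc r) ∷ drop (suc r) w) ≡ p ∸ suc r
  sortedBelow-beyond r lt ih p h pn =
    trans (countLt-∷-< x y L y<x) (trans (cong suc rank) (sym (m∸n≡1+[m∸1+n] p R1 (≤-trans (s≤s (m≤m+n R1 c)) h))))
    where
    R1 = suc r
    c = codeAt w R1
    y = at w R1
    L = drop R1 w
    q = B R1 p
    x = at w q
    qr : R1 < q × q ≤ n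
    qr = below-mapsInto (Rbot w) n R1 p (≤-trans (s≤s (m≤m+n R1 c)) h) pn
    rank : countLt x L ≡ p ∸ suc R1
    rank = ih p (≤-trans (s≤s (m≤m+n R1 c)) h) pn
    y<x : y < x
    y<x with <-cmp y x
    ... | tri< l _ _ = l
    ... | tri≈ _ e _ = ⊥-elim (<-irrefl (at-injective R1 q (s≤s z≤n) (<⇒≤ (<-≤-trans (proj₁ qr) (proj₂ qr))) (≤-trans (s≤s z≤n) (proj₁ qr)) (proj₂ qr) e) (proj₁ qr))
    ... | tri> _ _ g = ⊥-elim (<-irrefl refl (<-≤-trans (∸<⇒<+ (suc R1) c p (subst (_< c) rank sl)) h))
      where
      sl : countLt x L < countLt y L
      sl = countLt-strict x y L (q ∸ R1) (m<n⇒0<n∸m (proj₁ qr))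
             (subst (q ∸ R1 ≤_) (sym (trans (length-drop R1 w) (cong (_∸ R1) length-w))) (∸-monoˡ-≤ R1 (proj₂ qr)))
             (at-drop R1 w q (proj₁ qr)) g

  sortedBelow-step : ∀ r → suc r < n → SortedBelow (suc r) → SortedBelow r
  sortedBelow-step r lt ih p rp pn
    rewrite below-step (Rbot w) n r (<-trans (n<1+n r) lt) | drop-at r w (subst (r <_) (sym length-w) (<-trans (n<1+n r) lt))
    with region (suc r) (codeAt w (suc r)) p
  ... | rlo x = ⊥-elim (<-irrefl refl (≤-<-trans rp x))
  ... | rin a b rewrite proj₁ (Rbot-rotation r) p a b = sortedBelow-inside r lt ih p a b
  ... | rend refl rewrite proj₁ (proj₂ (Rbot-rotation r)) | below-fixˡ (Rbot w) n (suc r) (suc r) ≤-refl | <ᵇ-false {at w (suc r)} {at w (suc r)} ≤-refl =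
        sym (m+n∸m≡n (suc r) (codeAt w (suc r)))
  ... | rhi h rewrite proj₂ (proj₂ (proj₂ (Rbot-rotation r))) p h = sortedBelow-beyond r lt ih p h pn

  sortedBelow : ∀ r → SortedBelow r
  sortedBelow = RowInduction.ind n SortedBelow sortedBelow-base sortedBelow-step

  Rbot-top : ∀ p → 1 ≤ p → p ≤ n → at w (B 0 p) ≡ p
  Rbot-top p a b = ∸-cancelʳ-≡ xr a (trans (sym (countLt-perm x xr (proj₂ vr))) (sortedBelow 0 p a b))
    where
    q = B 0 p
    qr = below-mapsInto₁ (Rbot w) n 0 p a b
    x = at w q
    vr = at-range q (proj₁ qr) (proj₂ qr)
    xr : 1 ≤ x
    xr = proj₁ vr

leftJustified-shrink : ∀ G r c L → LeftJustified G r (suc c) L → LeftJustified G r c L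
leftJustified-shrink G r c L h c1 a b = h c1 a (m≤n⇒m≤1+n b)

length-rowWord : ∀ G r c L → LeftJustified G r c L → length (rowWord G r c) ≡ L ⊓ c
length-rowWord G r zero L h = sym (⊓-zeroʳ L)
length-rowWord G r (suc c) L h with suc c ≤? L
... | yes le rewrite proj₂ (h (suc c) (s≤s z≤n) ≤-refl) le =
      trans (length-++ (rowWord G r c)) (trans (cong (_+ 1) (length-rowWord G r c L (leftJustified-shrink G r c L h)))
        (trans (cong (_+ 1) (m≥n⇒m⊓n≡n (≤-trans (n≤1+n c) le))) (trans (+-comm c 1) (sym (m≥n⇒m⊓n≡n le)))))
... | no nle with G r (suc c) in e
...   | true = ⊥-elim (nle (proj₁ (h (suc c) (s≤s z≤n) ≤-refl) e))
...   | false = trans (length-++ (rowWord G r c)) (trans (+-identityʳ _) (trans (length-rowWord G r c L (leftJustified-shrink G r c L h))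
                  (trans (m≤n⇒m⊓n≡m (≤-pred (≰⇒> nle))) (sym (m≤n⇒m⊓n≡m (≤-trans (≤-pred (≰⇒> nle)) (n≤1+n c)))))))

cl0 : ∀ x b k → x ≤ b → countLt x (applyUpTo (λ i → b + i) k) ≡ 0
cl0 x b zero _ = refl
cl0 x b (suc k) le rewrite <ᵇ-false {b + 0} {x} (≤-trans le (≤-reflexive (sym (+-identityʳ b)))) =
  trans (cong (countLt x) (applyUpTo-cong _ (λ i → suc b + i) k (λ i → +-suc b i))) (cl0 x (suc b) k (≤-trans le (n≤1+n b)))

inversions-upTo : ∀ b k → inversions (applyUpTo (λ i → b + i) k) ≡ 0
inversions-upTo b zero = refl
inversions-upTo b (suc k) = trans (cong inversions (cong ((b + 0) ∷_) (applyUpTo-cong _ (λ i → suc b + i) k (λ i → +-suc b i))))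
  (trans (cong₂ _+_ (cl0 (b + 0) (suc b) k (≤-trans (≤-reflexive (+-identityʳ b)) (n≤1+n b))) (inversions-upTo (suc b) k)) refl)

inversions-short : ∀ xs → length xs ≤ 1 → inversions xs ≡ 0
inversions-short [] _ = refl
inversions-short (x ∷ []) _ = refl
inversions-short (x ∷ y ∷ xs) (s≤s ())

module BottomLength (n : ℕ) (w : List ℕ) (pw : w ↭ oneToN n) where
  open Permutation n w pw

  length-belowWord-Rbot : ∀ r → length (belowWord (Rbot w) n r) ≡ inversions (drop r w)
  length-belowWord-Rbot = RowInduction.ind n (λ r → length (belowWord (Rbot w) n r) ≡ inversions (drop r w))
    (λ r le → trans (cong length (belowWord-base (Rbot w) n r le))
                (sym (inversions-short (drop r w) (≤-trans (≤-reflexive (trans (length-drop r w) (cong (_∸ r) length-w))) (≤-trans (∸-monoˡ-≤ r le) (≤-reflexive (trans (cong (_∸ r) (+-comm 1 r)) (m+n∸m≡n r 1))))))))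
    (λ r lt ih → trans (cong length (belowWord-step (Rbot w) n r (<-trans (n<1+n r) lt)))
       (trans (length-++ (belowWord (Rbot w) n (suc r)))
       (trans (cong₂ _+_ ih (trans (length-rowWord (Rbot w) (suc r) (n ∸ suc r) (codeAt w (suc r)) (λ c a _ → Rbot-row-iff w (suc r) c a))
                                   (m≤n⇒m⊓n≡m (code≤ (suc r)))))
       (trans (+-comm _ (codeAt w (suc r)))
              (cong inversions (sym (drop-at r w (subst (r <_) (sym length-w) (<-trans (n<1+n r) lt)))))))))

  length-rcWord-Rbot : length (rcWord n (Rbot w)) ≡ inversions w
  length-rcWord-Rbot = trans (length-rcWord n (Rbot w)) (length-belowWord-Rbot 0)

  Rbot-word : IsWordFor n w (rcWord n (Rbot w))
  Rbot-word = letters-rcWord n (Rbot w) , TopLabels.top→word n w (Rbot w) length-w (BottomGraph.Rbot-top n w pw)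

-- Reading words of rc-graphs are descending

module ReducedDescents (n : ℕ) (w : List ℕ) (pw : w ↭ oneToN n) (R : Grid) (rc : IsRCGraph n w R) where
  open Permutation n w pw
  open InversionCount n w

  BL : List ℕ
  BL = belowWord R n 0

  R-top : ∀ p → 1 ≤ p → p ≤ n → at w (below R n 0 p) ≡ p
  R-top = TopLabels.word→top n w R length-w (proj₂ (proj₁ (proj₂ rc)))

  Φ-top : Φ (applyWordF id BL) ≡ 0
  Φ-top = trans (cong inversions (tabulate₁-cong n _ id (λ p a b → trans (cong (at w) (sym (below-word R n 0 p))) (R-top p a b))))
               (trans (cong inversions (trans (map-id (oneToN n)) (oneToN-applyUpTo n))) (inversions-upTo 1 n))

  Φ-id : Φ id ≡ inversions w
  Φ-id = cong inversions (at-ext (tabulate₁ n (at w)) w (trans (length-tabulate₁ n (at w)) (sym length-w))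
             (λ p a b → at-tabulate₁ n (at w) p a (subst (p ≤_) (length-tabulate₁ n (at w)) b)))

  length-R≤inversions : length BL ≤ inversions w
  length-R≤inversions = subst₂ _≤_ (length-rcWord n R) (BottomLength.length-rcWord-Rbot n w pw) (proj₂ (proj₂ rc) (rcWord n (Rbot w)) (BottomLength.Rbot-word n w pw))

  -- R_bot(w) yields a word for w of length inv(w), so the reduced reading word of R is no
  -- longer and hence lowers the inversion number at every letter.
  descending-R : Descending id BL
  descending-R = tight⇒descending id BL (letters-belowWordRows R n 0 (n ∸ 1))
           (subst₂ _≤_ (cong (_+ length BL) (sym Φ-top)) (sym Φ-id) length-R≤inversions)

  belowWord-split : ∀ k c → 1 ≤ k → k < n → c ≤ n ∸ k → Σ (List ℕ) λ M → BL ≡ prefixWord R n k c ++ M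
  belowWord-split k c k1 kn cn with prefixWord-commonExtension R R n k c 0 0 kn cn (λ _ _ _ → refl) (inj₁ (k1 , z≤n))
  ... | M , e1 , _ = M , trans (sym (Data.List.Properties.++-identityʳ BL)) e1

  descending-prefix : ∀ k c → 1 ≤ k → k < n → c ≤ n ∸ k → Descending id (prefixWord R n k c)
  descending-prefix k c k1 kn cn with belowWord-split k c k1 kn cn
  ... | M , e = descending-++⁻ˡ id (prefixWord R n k c) M (subst (Descending id) e descending-R)

  descending-middle : ∀ i j k c M → 1 ≤ k → k < n → c ≤ n ∸ k → prefixWord R n k c ≡ prefixWord R n i j ++ M → Descending (applyWordF id (prefixWord R n i j)) M
  descending-middle i j k c M k1 kn cn e with belowWord-split k c k1 kn cn
  ... | M2 , e2 = descending-++⁻ˡ _ M M2 (descending-++⁻ʳ id (prefixWord R n i j) (M ++ M2)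
                    (subst (Descending id) (trans e2 (trans (cong (_++ M2) e) (Data.List.Properties.++-assoc (prefixWord R n i j) M M2))) descending-R))

  cross-descent : ∀ r c → 1 ≤ r → r + suc c ≤ n → R r (suc c) ≡ true →
            at w (throughRow R r c (below R n r) (suc (r + c))) < at w (throughRow R r c (below R n r) (r + c))
  cross-descent r c r1 le e = subst₂ (λ u v → at w u < at w v) (sym (throughRow-below-word R n r c _)) (sym (throughRow-below-word R n r c _)) (proj₁ d)
    where
    rn : r < n
    rn = ≤-trans (s≤s (m≤m+n r c)) (subst (_≤ n) (+-suc r c) le)
    cn : suc c ≤ n ∸ r
    cn = subst (suc c ≤_) refl (+≤⇒≤∸ {r} le)
    lt1 : tileWord R r (suc c) ≡ (r + c) ∷ []
    lt1 rewrite e = refl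
    d : Descending (applyWordF id (prefixWord R n r c)) ((r + c) ∷ [])
    d = descending-++⁻ʳ id (prefixWord R n r c) ((r + c) ∷ [])
          (subst (Descending id) (trans (prefixWord-suc R n r c) (cong (prefixWord R n r c ++_) lt1)) (descending-prefix r (suc c) r1 rn cn))

insert-here : ∀ i j S → insert i j S i j ≡ true
insert-here i j S rewrite ≡ᵇ-refl i | ≡ᵇ-refl j = refl

remove-here : ∀ i j S → remove i j S i j ≡ false
remove-here i j S rewrite ≡ᵇ-refl i | ≡ᵇ-refl j = refl

insert-otherRow : ∀ i j S x y → x ≢ i → insert i j S x y ≡ S x y
insert-otherRow i j S x y ne rewrite ≡ᵇ-≢ ne = refl

insert-otherCol : ∀ i j S x y → y ≢ j → insert i j S x y ≡ S x y
insert-otherCol i j S x y ne rewrite ≡ᵇ-≢ ne with x ≡ᵇ i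
... | true = refl
... | false = refl

remove-otherRow : ∀ i j S x y → x ≢ i → remove i j S x y ≡ S x y
remove-otherRow i j S x y ne rewrite ≡ᵇ-≢ ne = refl

remove-otherCol : ∀ i j S x y → y ≢ j → remove i j S x y ≡ S x y
remove-otherCol i j S x y ne rewrite ≡ᵇ-≢ ne with x ≡ᵇ i
... | true = refl
... | false = refl

insert-cong : ∀ i j {S T : Grid} → S ≐ T → insert i j S ≐ insert i j T
insert-cong i j e x y with (x ≡ᵇ i) ∧ (y ≡ᵇ j)
... | true = refl
... | false = e x y

insert-remove : ∀ (S : Grid) i j → S i j ≡ true → S ≐ insert i j (remove i j S)
insert-remove S i j Sij x y with (x ≡ᵇ i) ∧ (y ≡ᵇ j) in e
... | false = refl
... | true with ≡ᵇ∧≡ᵇ⇒≡ x y i j e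
...   | refl , refl = Sij

remove-insert : ∀ (S : Grid) i j → S i j ≡ false → remove i j (insert i j S) ≐ S
remove-insert S i j Sij x y with (x ≡ᵇ i) ∧ (y ≡ᵇ j) in e
... | false = refl
... | true with ≡ᵇ∧≡ᵇ⇒≡ x y i j e
...   | refl , refl = sym Sij

insert-remove-comm : ∀ i j i′ j′ (S : Grid) → i ≢ i′ → insert i j (remove i′ j′ S) ≐ remove i′ j′ (insert i j S)
insert-remove-comm i j i′ j′ S ne x y with (x ≡ᵇ i) ∧ (y ≡ᵇ j) in e | (x ≡ᵇ i′) ∧ (y ≡ᵇ j′) in e′
... | true | true = ⊥-elim (ne (trans (sym (proj₁ (≡ᵇ∧≡ᵇ⇒≡ x y i j e))) (proj₁ (≡ᵇ∧≡ᵇ⇒≡ x y i′ j′ e′))))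
... | true | false = refl
... | false | _ = refl

leftJustified-removeLast : ∀ G r c L → LeftJustified G r c (suc L) → LeftJustified (remove r (suc L) G) r c L
leftJustified-removeLast G r c L h c′ 1≤c′ c′≤c with c′ ≟ suc L
... | yes refl = (λ t → ⊥-elim (true≢false (trans (sym t) (remove-here r (suc L) G)))) , (λ le → ⊥-elim (<-irrefl refl le))
... | no ne rewrite remove-otherCol r (suc L) G r c′ ne =
      (λ t → ≤-pred (≤∧≢⇒< (proj₁ (h c′ 1≤c′ c′≤c) t) ne)) , (λ le → proj₂ (h c′ 1≤c′ c′≤c) (m≤n⇒m≤1+n le))

IsLMove-cong : ∀ S T i j m → S ≐ T → IsLMove S i j m → IsLMove T i j m
IsLMove-cong S T i j m e ((a1 , a2 , a3 , a4 , a5 , a6 , a7) , rt) =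
  (trans (sym (e i j)) a1 , a2 , a3 , trans (sym (e i (suc j))) a4 ,
   (λ k x y → let (u , v) = a5 k x y in trans (sym (e _ _)) u , trans (sym (e _ _)) v) ,
   trans (sym (e _ _)) a6 , trans (sym (e _ _)) a7) ,
  (λ l lt → trans (sym (e i l)) (rt l lt))

ladder-cong : ∀ S T i j m → S ≐ T → ladder S i j m ≐ ladder T i j m
ladder-cong S T i j m e x y with (x ≡ᵇ (i ∸ m)) ∧ (y ≡ᵇ suc j)
... | true = refl
... | false with (x ≡ᵇ i) ∧ (y ≡ᵇ j)
...   | true = refl
...   | false = e x y

≐-trans : ∀ {A B C : Grid} → A ≐ B → B ≐ C → A ≐ C
≐-trans e1 e2 x y = trans (e1 x y) (e2 x y)

≐-sym : ∀ {A B : Grid} → A ≐ B → B ≐ A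
≐-sym e x y = sym (e x y)

LChain-cong : ∀ {S T below-S⁻ i j i2 j2} → LChain S i j i2 j2 T → T ≐ below-S⁻ → LChain S i j i2 j2 below-S⁻
LChain-cong (done e) e2 = done (≐-trans e e2)
LChain-cong (step m mv ch) e2 = step m mv (LChain-cong ch e2)

LChain-snoc : ∀ {S T i j i2 j2} m → LChain S i j i2 j2 T → IsLMove T i2 j2 m → LChain S i j (i2 ∸ m) (suc j2) (ladder T i2 j2 m)
LChain-snoc {S} {T} {i} {j} m (done e) mv =
  step m (IsLMove-cong T S i j m (≐-sym e) mv) (done (ladder-cong S T i j m e))
LChain-snoc m (step m2 mv2 ch) mv = step m2 mv2 (LChain-snoc m ch mv)


-- Invariant n R S i c: position (i, c) is the next one to be processed; the processed
-- positions are the rows above i and the columns beyond c in row i.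
record Invariant (n : ℕ) (R S : Grid) (i j : ℕ) : Set where
  field
    1≤i : 1 ≤ i
    i+j≤n : i + j ≤ n
    bounded : Bounded n S
    agrees : ∀ r c → Processed i j r c → S r c ≡ R r c
    rowLength : ℕ → ℕ
    justifiedBelow : ∀ r → i < r → LeftJustified S r (n ∸ r) (rowLength r)
    rowLength≤ : ∀ r → i < r → rowLength r ≤ n ∸ r
    justifiedHere : LeftJustified S i j (rowLength i)
    rowLength≤j : rowLength i ≤ j
    labelsAgree : throughRow S i j (below S n i) ≗ throughRow R i j (below R n i)

module AtTile (n : ℕ) (w : List ℕ) (pw : w ↭ oneToN n) (R : Grid) (rc : IsRCGraph n w R)
              (S : Grid) (i j : ℕ) (inv : Invariant n R S i (suc j)) where
  open Invariant inv public
  open ReducedDescents n w pw R rc public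
  open InversionCount n w public

  bR : Bounded n R
  bR = proj₁ rc

  -- Lines enter tile (i, j + 1) from the left on diagonal e and from below on diagonal e + 1.
  e : ℕ
  e = i + j

  labelsS labelsR : Labelling
  labelsS = throughRow S i j (below S n i)
  labelsR = throughRow R i j (below R n i)

  1+e≤n : suc e ≤ n
  1+e≤n = subst (_≤ n) (+-suc i j) i+j≤n

  justified-cross : ∀ r c → i < r → 1 ≤ c → c ≤ rowLength r → S r c ≡ true
  justified-cross r c ir c1 cl = proj₂ (justifiedBelow r ir c c1 (≤-trans cl (rowLength≤ r ir))) cl

  justified-empty : ∀ r c → i < r → rowLength r < c → S r c ≡ false
  justified-empty r c ir lc with S r c in eq
  ... | false = refl
  ... | true with c ≤? n ∸ r
  ...   | yes cn = ⊥-elim (<-irrefl refl (<-≤-trans lc (proj₁ (justifiedBelow r ir c (proj₁ (proj₂ (bounded r c eq))) cn) eq)))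
  ...   | no ncn = ⊥-elim (ncn (+≤⇒≤∸ {r} (proj₂ (proj₂ (bounded r c eq)))))

  justifiedHere-rotation : LeftJustified S i j (rowLength i) → rowLength i ≤ j → IsRotation i (rowLength i) (below S n i) labelsS
  justifiedHere-rotation h le = leftJustified-rotation S i j (rowLength i) (below S n i) h le

  labelsS-below : ∀ p → i < p → p ≤ n → i < below S n i p
  labelsS-below p a b = proj₁ (below-mapsInto S n i p a b)

  labelsR-bottom : i < labelsR (suc e)
  labelsR-bottom = subst (i <_) (sym (throughRow-fixʳ R i j (below R n i) (suc e) ≤-refl)) (proj₁ (below-mapsInto R n i (suc e) (s≤s (m≤m+n i j)) 1+e≤n))

  justifiedUpTo-j : LeftJustified S i j (rowLength i)
  justifiedUpTo-j c c1 cj = justifiedHere c c1 (m≤n⇒m≤1+n cj)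

  empty⇒rowLength≤j : S i (suc j) ≡ false → rowLength i ≤ j
  empty⇒rowLength≤j Sf with m≤n⇒m<n∨m≡n rowLength≤j
  ... | inj₁ lt = ≤-pred lt
  ... | inj₂ eq = ⊥-elim (true≢false (trans (sym (proj₂ (justifiedHere (suc j) (s≤s z≤n) ≤-refl) (≤-reflexive (sym eq)))) Sf))

  agrees-step : S i (suc j) ≡ R i (suc j) → ∀ r c → Processed i j r c → S r c ≡ R r c
  agrees-step same r c (inj₁ ri) = agrees r c (inj₁ ri)
  agrees-step same r c (inj₂ (refl , jc)) with m≤n⇒m<n∨m≡n jc
  ... | inj₂ refl = same
  ... | inj₁ lt = agrees r c (inj₂ (refl , lt))

module Swap (n : ℕ) (w : List ℕ) (pw : w ↭ oneToN n) (R : Grid) (rc : IsRCGraph n w R)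
             (S : Grid) (i j : ℕ) (inv : Invariant n R S i (suc j))
             (Ri : R i (suc j) ≡ true) (Si : S i (suc j) ≡ false) where
  open AtTile n w pw R rc S i j inv public

  labelsS-swap : labelsS ≗ swapF e labelsR
  labelsS-swap p = trans (sym (cong (λ h → h p) (throughTile-empty S i j labelsS Si)))
             (trans (labelsAgree p) (cong (λ h → h p) (throughTile-cross R i j labelsR Ri)))

  a b : ℕ
  a = labelsS e
  b = labelsS (suc e)

  labelsR-a : labelsR (suc e) ≡ a
  labelsR-a = sym (trans (labelsS-swap e) (cong labelsR (transpose-matchˡ e)))

  labelsR-b : labelsR e ≡ b
  labelsR-b = sym (trans (labelsS-swap (suc e)) (cong labelsR (transpose-matchʳ e)))

  rotationHere : IsRotation i (rowLength i) (below S n i) labelsS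
  rotationHere = justifiedHere-rotation justifiedUpTo-j (empty⇒rowLength≤j Si)

  rowLength<j : rowLength i < j
  rowLength<j with m≤n⇒m<n∨m≡n (empty⇒rowLength≤j Si)
  ... | inj₁ lt = lt
  ... | inj₂ eq = ⊥-elim (<-irrefl (sym ai) (subst (i <_) labelsR-a labelsR-bottom))
    where
    ai : a ≡ i
    ai = trans (cong labelsS (cong (i +_) (sym eq))) (trans (proj₁ (proj₂ rotationHere)) (below-fixˡ S n i i ≤-refl))

  1≤j : 1 ≤ j
  1≤j = ≤-trans (s≤s z≤n) rowLength<j

  i<e : i < e
  i<e = ≤-trans (s≤s (≤-reflexive (sym (+-identityʳ i)))) (+-monoʳ-< i 1≤j)

  below-a : below S n i e ≡ a
  below-a = sym (proj₂ (proj₂ (proj₂ rotationHere)) e (+-monoʳ-< i rowLength<j))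

  below-b : below S n i (suc e) ≡ b
  below-b = sym (proj₂ (proj₂ (proj₂ rotationHere)) (suc e) (<-trans (+-monoʳ-< i rowLength<j) (n<1+n e)))

  i<a : i < a
  i<a = subst (i <_) below-a (labelsS-below e i<e (≤-trans (n≤1+n e) 1+e≤n))

  i<b : i < b
  i<b = subst (i <_) below-b (labelsS-below (suc e) (s≤s (m≤m+n i j)) 1+e≤n)

  w[a]<w[b] : at w a < at w b
  w[a]<w[b] = subst₂ (λ u v → at w u < at w v) labelsR-a labelsR-b (cross-descent i j 1≤i (subst (_≤ n) refl i+j≤n) Ri)

  b<a : b < a
  b<a with <-cmp a b
  ... | tri> _ _ g = g
  ... | tri≈ _ eq _ = ⊥-elim (<-irrefl (below-injective S n i e (suc e) (trans below-a (trans eq (sym below-b)))) (n<1+n e))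
  ... | tri< l _ _ = ⊥-elim (<-irrefl refl (<-trans (al (suc e) e labelsR-a labelsR-b) (n<1+n e)))
    where
    al0 : LeftOf a b id
    al0 p q pa qb = subst₂ _<_ (sym pa) (sym qb) l
    al : LeftOf a b labelsR
    al = leftOf-cong a b _ labelsR (λ p → sym (throughRow-below-word R n i j p))
           (leftOf-descending a b id (prefixWord R n i j) w[a]<w[b] al0 (descending-prefix i j 1≤i (<-trans i<e 1+e≤n) (+≤⇒≤∸ {i} (≤-trans (n≤1+n e) 1+e≤n))))

  -- a and b will turn out to cross at the last cross (b, l) of row b.
  l : ℕ
  l = rowLength b

  S⁻ : Grid
  S⁻ = remove b l S

  S⁻-otherRow : ∀ r c → r ≢ b → S⁻ r c ≡ S r c
  S⁻-otherRow r c ne = remove-otherRow b l S r c ne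

  MeetBelow : ℕ → ℕ → Set
  MeetBelow r x = suc (r + x) ≤ n × below S n r (r + x) ≡ a × below S n r (suc (r + x)) ≡ b

  -- Trail r x: the lines a and b, on diagonals r + x and r + x + 1 of the cut above row
  -- r + 1, cross at (b, l), and L-moves carry that cross from (b, l) to (ρ, x); the rows
  -- strictly between r and ρ are filled in columns x and x + 1.
  record Trail (r x : ℕ) : Set where
    field
      1≤l : 1 ≤ l
      below-b+l : below S n b (b + l) ≡ a
      r<b : r < b
      b+l≤n : b + l ≤ n
      below-S⁻ : below S⁻ n r ≗ swapF (r + x) (below S n r)
      ρ : ℕ
      r<ρ : r < ρ
      ρ≤b : ρ ≤ b
      rungs : ∀ r2 → r < r2 → r2 < ρ → S r2 x ≡ true × S r2 (suc x) ≡ true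
      S⁻[ρ,x] : S⁻ ρ x ≡ false
      S⁻-rightOf : ∀ c → x < c → S⁻ ρ c ≡ false
      chain : LChain S b l ρ x (insert ρ x S⁻)

  rotation-below : ∀ r → i ≤ r → suc r < n → IsRotation (suc r) (rowLength (suc r)) (below S n (suc r)) (below S n r)
  rotation-below r ir rn = subst (IsRotation (suc r) (rowLength (suc r)) (below S n (suc r))) (sym (below-step S n r (<-trans (n<1+n r) rn)))
                    (leftJustified-rotation S (suc r) (n ∸ suc r) (rowLength (suc r)) _ (justifiedBelow (suc r) (s≤s ir)) (rowLength≤ (suc r) (s≤s ir)))

  below-S⁻-step : ∀ r → i ≤ r → suc r < n → suc r ≢ b → below S⁻ n r ≗ throughRow S (suc r) (n ∸ suc r) (below S⁻ n (suc r))
  below-S⁻-step r ir rn ne p = trans (cong (λ h → h p) (below-step S⁻ n r (<-trans (n<1+n r) rn)))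
                         (throughRow-cong-grid S⁻ S (suc r) (n ∸ suc r) _ (λ c _ _ → S⁻-otherRow (suc r) c ne) p)

  below-S⁻-far : ∀ r → b ≤ r → below S⁻ n r ≗ below S n r
  below-S⁻-far r br = below-cong-grid S⁻ S n r (λ r2 c lt → S⁻-otherRow r2 c (λ eq → <-irrefl refl (≤-<-trans br (subst (r <_) eq lt))))

  1+r≤r+x : ∀ r x → 1 ≤ x → suc r ≤ r + x
  1+r≤r+x r x x1 = subst (_≤ r + x) (+-comm r 1) (+-monoʳ-≤ r x1)

  meet⇒1+r<n : ∀ r x → 1 ≤ x → MeetBelow r x → suc r < n
  meet⇒1+r<n r x x1 (qn , _ , _) = ≤-trans (s≤s (1+r≤r+x r x x1)) qn

  1+r+len≤n : ∀ r → i ≤ r → suc r < n → suc r + rowLength (suc r) ≤ n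
  1+r+len≤n r ir rn = ≤-trans (+-monoʳ-≤ (suc r) (rowLength≤ (suc r) (s≤s ir))) (≤-reflexive (m+[n∸m]≡n (<⇒≤ rn)))

  hit-row : ∀ r x → i ≤ r → 1 ≤ x → MeetBelow r x → x ≡ rowLength (suc r) → suc r ≡ b
  hit-row r x ir x1 q@(_ , _ , qb) xL =
    trans (sym (below-fixˡ S n (suc r) (suc r) ≤-refl))
          (trans (sym (proj₁ (proj₂ (rotation-below r ir (meet⇒1+r<n r x x1 q))))) (trans (cong (λ z → below S n r (suc r + z)) (sym xL)) qb))

  below-S⁻-hit : ∀ r x → i ≤ r → MeetBelow r (suc x) → suc x ≡ rowLength (suc r) → below S⁻ n r ≗ swapF (r + suc x) (below S n r)
  below-S⁻-hit r x ir q xL p =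
    trans (cong (λ h → h p) (below-step S⁻ n r (<-trans (n<1+n r) rn)))
          (trans (throughRow-cong S⁻ R1 (n ∸ R1) (below-S⁻-far R1 (≤-reflexive (sym bR1))) p)
          (trans (hXeq p) (cong (λ z → swapF z g p) (sym (+-suc r x)))))
    where
    R1 = suc r
    rn = meet⇒1+r<n r (suc x) (s≤s z≤n) q
    cyc = rotation-below r ir rn
    f = below S n R1
    g = below S n r
    bR1 : suc r ≡ b
    bR1 = hit-row r (suc x) ir (s≤s z≤n) q xL
    xl : suc x ≡ l
    xl = trans xL (cong rowLength bR1)
    rowX : LeftJustified S⁻ R1 (n ∸ R1) x
    rowX = subst₂ (λ u v → LeftJustified (remove u v S) R1 (n ∸ R1) x) bR1 xl
             (leftJustified-removeLast S R1 (n ∸ R1) x (subst (LeftJustified S R1 (n ∸ R1)) (sym xL) (justifiedBelow R1 (s≤s ir))))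
    hX : Labelling
    hX = throughRow S⁻ R1 (n ∸ R1) f
    cycX : IsRotation R1 x f hX
    cycX = leftJustified-rotation S⁻ R1 (n ∸ R1) x f rowX (≤-trans (n≤1+n x) (subst (_≤ n ∸ R1) (sym xL) (rowLength≤ R1 (s≤s ir))))
    cyc' : IsRotation R1 (suc x) f g
    cyc' = subst (λ z → IsRotation R1 z f g) (sym xL) cyc
    hXeq : hX ≗ swapF (R1 + x) g
    hXeq q2 = trans (sym (swapF-involutive (R1 + x) hX q2)) (swapF-cong (R1 + x) (rotation-unique R1 (suc x) f _ g (rotation-suc R1 x f hX cycX) cyc') q2)

  trail-hit : ∀ r x → i ≤ r → 1 ≤ x → MeetBelow r x → x ≡ rowLength (suc r) → Trail r x
  trail-hit r (suc x) ir x1 q@(qn , qa , qb) xL = record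
    { 1≤l = subst (λ z → 1 ≤ rowLength z) bR1 (subst (1 ≤_) xL x1)
    ; below-b+l = subst (λ z → below S n z (z + rowLength z) ≡ a) bR1 blA
    ; r<b = subst (r <_) bR1 (n<1+n r)
    ; b+l≤n = subst (λ z → z + rowLength z ≤ n) bR1 (1+r+len≤n r ir rn)
    ; below-S⁻ = below-S⁻-hit r x ir q xL
    ; ρ = b
    ; r<ρ = subst (r <_) bR1 (n<1+n r)
    ; ρ≤b = ≤-refl
    ; rungs = λ r2 a1 a2 → ⊥-elim (<-irrefl refl (<-≤-trans a1 (≤-pred (subst (r2 <_) (sym bR1) a2))))
    ; S⁻[ρ,x] = subst (λ z → S⁻ b z ≡ false) (sym xl) (remove-here b l S)
    ; S⁻-rightOf = λ c lt → trans (remove-otherCol b l S b c (λ eq → <-irrefl (sym (trans eq (sym xl))) lt)) (justified-empty b c (subst (i <_) bR1 (s≤s ir)) (subst (_< c) xl lt))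
    ; chain = subst (λ z → LChain S b l b z (insert b z S⁻)) (sym xl) (done (insert-remove S b l (justified-cross b l (subst (i <_) bR1 (s≤s ir)) (subst (λ z → 1 ≤ rowLength z) bR1 (subst (1 ≤_) xL x1)) ≤-refl)))
    }
    where
    R1 = suc r
    L = rowLength R1
    rn = meet⇒1+r<n r (suc x) x1 q
    cyc = rotation-below r ir rn
    f = below S n R1
    bR1 : suc r ≡ b
    bR1 = hit-row r (suc x) ir x1 q xL
    xl : suc x ≡ l
    xl = trans xL (cong rowLength bR1)
    blA : below S n R1 (R1 + L) ≡ a
    blA = trans (cong (λ z → f (suc r + z)) (sym xL))
            (trans (sym (proj₁ cyc (r + suc x) (1+r≤r+x r (suc x) x1) (subst (λ z → r + suc x < suc r + z) xL (n<1+n (r + suc x))))) qa)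

  meet-under : ∀ r x → i ≤ r → 1 ≤ x → (q : MeetBelow r x) → x < rowLength (suc r) → MeetBelow (suc r) x
  meet-under r x ir x1 q@(qn , qa , qb) xL =
    ≤-trans (+-monoʳ-< (suc r) xL) (1+r+len≤n r ir rn) ,
    trans (sym (proj₁ cyc (r + x) (1+r≤r+x r x x1) (<-trans (+-monoʳ-< r xL) (n<1+n _)))) qa ,
    trans (sym (proj₁ cyc (suc (r + x)) (s≤s (m≤m+n r x)) (s≤s (+-monoʳ-< r xL)))) qb
    where
    rn = meet⇒1+r<n r x x1 q
    cyc = rotation-below r ir rn

  trail-under : ∀ r x → i ≤ r → 1 ≤ x → MeetBelow r x → x < rowLength (suc r) → Trail (suc r) x → Trail r x
  trail-under r x ir x1 q xL t = record
    { 1≤l = Trail.1≤l t ; below-b+l = Trail.below-b+l t ; r<b = <-trans (n<1+n r) (Trail.r<b t) ; b+l≤n = Trail.b+l≤n t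
    ; below-S⁻ = T2' ; ρ = Trail.ρ t ; r<ρ = <-trans (n<1+n r) (Trail.r<ρ t) ; ρ≤b = Trail.ρ≤b t
    ; rungs = kp ; S⁻[ρ,x] = Trail.S⁻[ρ,x] t ; S⁻-rightOf = Trail.S⁻-rightOf t ; chain = Trail.chain t }
    where
    R1 = suc r
    L = rowLength R1
    rn = meet⇒1+r<n r x x1 q
    cyc = rotation-below r ir rn
    f = below S n R1
    g = below S n r
    ne : R1 ≢ b
    ne eq = <-irrefl eq (Trail.r<b t)
    h' : Labelling
    h' = throughRow S R1 (n ∸ R1) (swapF (suc (r + x)) f)
    cyc2 : IsRotation R1 L (swapF (suc (r + x)) f) h'
    cyc2 = leftJustified-rotation S R1 (n ∸ R1) L _ (justifiedBelow R1 (s≤s ir)) (rowLength≤ R1 (s≤s ir))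
    T2' : below S⁻ n r ≗ swapF (r + x) g
    T2' p = trans (below-S⁻-step r ir rn ne p) (trans (throughRow-cong S R1 (n ∸ R1) (Trail.below-S⁻ t) p)
              (rotation-conj R1 L f g h' (r + x) cyc cyc2 (1+r≤r+x r x x1) (s≤s (+-monoʳ-< r xL)) p))
    kp : ∀ r2 → r < r2 → r2 < Trail.ρ t → S r2 x ≡ true × S r2 (suc x) ≡ true
    kp r2 a1 a2 with m≤n⇒m<n∨m≡n a1
    ... | inj₁ lt = Trail.rungs t r2 lt a2
    ... | inj₂ refl = justified-cross R1 x (s≤s ir) x1 (<⇒≤ xL) , justified-cross R1 (suc x) (s≤s ir) (s≤s z≤n) xL

  meet-pastEnd : ∀ r x → i ≤ r → 1 ≤ x → MeetBelow r x → x ≡ suc (rowLength (suc r)) → ⊥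
  meet-pastEnd r x ir x1 q@(qn , qa , qb) xL = <-asym b<a (subst₂ _<_ aR1 (trans rhi' qb) bigger)
    where
    R1 = suc r
    L = rowLength R1
    rn = meet⇒1+r<n r x x1 q
    cyc = rotation-below r ir rn
    f = below S n R1
    g = below S n r
    aR1 : R1 ≡ a
    aR1 = trans (sym (below-fixˡ S n R1 R1 ≤-refl)) (trans (sym (proj₁ (proj₂ cyc))) (trans (cong g (trans (sym (+-suc r L)) (cong (r +_) (sym xL)))) qa))
    p>  : R1 + L < suc (r + x)
    p> = s≤s (subst (suc (r + L) ≤_) (cong (r +_) (sym xL)) (≤-reflexive (sym (+-suc r L))))
    rhi' : f (suc (r + x)) ≡ g (suc (r + x))
    rhi' = sym (proj₂ (proj₂ (proj₂ cyc)) (suc (r + x)) p>)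
    bigger : R1 < f (suc (r + x))
    bigger = proj₁ (below-mapsInto S n R1 (suc (r + x)) (≤-trans (s≤s (m≤m+n R1 L)) p>) qn)

  meet-shift : ∀ r x → i ≤ r → MeetBelow r (suc x) → rowLength (suc r) < x → MeetBelow (suc r) x
  meet-shift r x ir q@(qn , qa , qb) Lx =
    subst (_≤ n) (cong suc (+-suc r x)) qn ,
    trans (cong f (sym (+-suc r x))) (trans (sym (rhi' (r + suc x) h1)) qa) ,
    trans (cong (λ z → f (suc z)) (sym (+-suc r x))) (trans (sym (rhi' (suc (r + suc x)) (<-trans h1 (n<1+n _)))) qb)
    where
    R1 = suc r
    L = rowLength R1
    rn = meet⇒1+r<n r (suc x) (s≤s z≤n) q
    cyc = rotation-below r ir rn
    f = below S n R1
    g = below S n r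
    rhi' : ∀ p → R1 + L < p → g p ≡ f p
    rhi' = proj₂ (proj₂ (proj₂ cyc))
    h1 : R1 + L < r + suc x
    h1 = subst (R1 + L <_) (sym (+-suc r x)) (+-monoʳ-< R1 Lx)

  0<m∸n⇒n<m : ∀ m r → 0 < m ∸ r → r < m
  0<m∸n⇒n<m zero r h = ⊥-elim (<-irrefl (sym (0∸n≡0 r)) h)
  0<m∸n⇒n<m (suc m) zero h = s≤s z≤n
  0<m∸n⇒n<m (suc m) (suc r) h = s≤s (0<m∸n⇒n<m m r h)

  ∸-flip-< : ∀ m r k → k < m ∸ r → r < m ∸ k
  ∸-flip-< m zero k h = m<n⇒0<n∸m h
  ∸-flip-< zero (suc r) k h = ⊥-elim (<-irrefl (sym (0∸n≡0 (suc r))) (≤-trans (s≤s z≤n) h))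
  ∸-flip-< (suc m) (suc r) zero h = s≤s (0<m∸n⇒n<m m r h)
  ∸-flip-< (suc m) (suc r) (suc k) h = subst (suc r <_) (sym (m∸n≡1+[m∸1+n] m k (<-trans (n<1+n k) (≤-trans h (m∸n≤m m r))))) (s≤s (∸-flip-< m r (suc k) h))

  trail-climb : ∀ r x (t : Trail r x) → 1 ≤ r → S r x ≡ false → S r (suc x) ≡ false →
                LChain S b l r (suc x) (insert r (suc x) S⁻)
  trail-climb r x t 1≤r Srx Srx′ =
    LChain-cong (subst (λ z → LChain S b l z (suc x) (ladder G ρ x m)) ρ∸m≡r (LChain-snoc m (Trail.chain t) move))
      (λ p q → trans (cong (λ z → insert z (suc x) (remove ρ x G) p q) ρ∸m≡r)
                     (insert-cong r (suc x) (remove-insert S⁻ ρ x (Trail.S⁻[ρ,x] t)) p q))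
    where
    ρ = Trail.ρ t
    G = insert ρ x S⁻
    m = ρ ∸ r
    r<ρ : r < ρ
    r<ρ = Trail.r<ρ t
    ρ∸m≡r : ρ ∸ m ≡ r
    ρ∸m≡r = m∸[m∸n]≡n (<⇒≤ r<ρ)
    G-above-ρ : ∀ r₂ c → r₂ < ρ → G r₂ c ≡ S r₂ c
    G-above-ρ r₂ c lt = trans (insert-otherRow ρ x S⁻ r₂ c (λ eq → <-irrefl eq lt))
                              (S⁻-otherRow r₂ c (λ eq → <-irrefl eq (<-≤-trans lt (Trail.ρ≤b t))))
    rung : ∀ k → 1 ≤ k → k < m → G (ρ ∸ k) x ≡ true × G (ρ ∸ k) (suc x) ≡ true
    rung (suc k) _ k<m = trans (G-above-ρ r₂ x r₂<ρ) (proj₁ crosses) , trans (G-above-ρ r₂ (suc x) r₂<ρ) (proj₂ crosses)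
      where
      r₂ = ρ ∸ suc k
      r₂<ρ : r₂ < ρ
      r₂<ρ = ∸-monoʳ-< (s≤s z≤n) (<⇒≤ (<-≤-trans k<m (m∸n≤m ρ r)))
      crosses = Trail.rungs t r₂ (∸-flip-< ρ r (suc k) k<m) r₂<ρ
    G-rightOf : ∀ c → x < c → G ρ c ≡ false
    G-rightOf c lt = trans (insert-otherCol ρ x S⁻ ρ c (λ eq → <-irrefl (sym eq) lt)) (Trail.S⁻-rightOf t c lt)
    top-empty : ∀ c → S r c ≡ false → G (ρ ∸ m) c ≡ false
    top-empty c Src = subst (λ z → G z c ≡ false) (sym ρ∸m≡r) (trans (G-above-ρ r c r<ρ) Src)
    move : IsLMove G ρ x m
    move = (insert-here ρ x S⁻ , m<n⇒0<n∸m r<ρ , ∸-monoʳ-< 1≤r (<⇒≤ r<ρ) , G-rightOf (suc x) (n<1+n x) ,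
            rung , top-empty x Srx , top-empty (suc x) Srx′) , G-rightOf

  trail-shift : ∀ r x → i ≤ r → MeetBelow r (suc x) → rowLength (suc r) < x → Trail (suc r) x → Trail r (suc x)
  trail-shift r x ir q Lx t = record
    { 1≤l = Trail.1≤l t ; below-b+l = Trail.below-b+l t ; r<b = <-trans (n<1+n r) (Trail.r<b t) ; b+l≤n = Trail.b+l≤n t
    ; below-S⁻ = T2' ; ρ = R1 ; r<ρ = n<1+n r ; ρ≤b = <⇒≤ (Trail.r<b t)
    ; rungs = λ r2 a1 a2 → ⊥-elim (<-irrefl refl (<-≤-trans a1 (≤-pred a2)))
    ; S⁻[ρ,x] = trans (S⁻-otherRow R1 (suc x) ne) (justified-empty R1 (suc x) (s≤s ir) (<-trans Lx (n<1+n x)))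
    ; S⁻-rightOf = λ c lt → trans (S⁻-otherRow R1 c ne) (justified-empty R1 c (s≤s ir) (<-trans (<-trans Lx (n<1+n x)) lt))
    ; chain = ch }
    where
    R1 = suc r
    L = rowLength R1
    rn = meet⇒1+r<n r (suc x) (s≤s z≤n) q
    cyc = rotation-below r ir rn
    f = below S n R1
    g = below S n r
    ne : R1 ≢ b
    ne eq = <-irrefl eq (Trail.r<b t)
    h' : Labelling
    h' = throughRow S R1 (n ∸ R1) (swapF (R1 + x) f)
    cyc2 : IsRotation R1 L (swapF (R1 + x) f) h'
    cyc2 = leftJustified-rotation S R1 (n ∸ R1) L _ (justifiedBelow R1 (s≤s ir)) (rowLength≤ R1 (s≤s ir))
    T2' : below S⁻ n r ≗ swapF (r + suc x) g
    T2' p = trans (below-S⁻-step r ir rn ne p) (trans (throughRow-cong S R1 (n ∸ R1) (Trail.below-S⁻ t) p)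
              (trans (rotation-shift R1 L f g h' (R1 + x) cyc cyc2 (+-monoʳ-< R1 Lx) p) (cong (λ z → swapF z g p) (sym (+-suc r x)))))
    ch : LChain S b l R1 (suc x) (insert R1 (suc x) S⁻)
    ch = trail-climb R1 x t (s≤s z≤n) (justified-empty R1 x (s≤s ir) Lx) (justified-empty R1 (suc x) (s≤s ir) (<-trans Lx (n<1+n x)))

  trail : ∀ k r x → n ∸ r ≤ k → i ≤ r → 1 ≤ x → MeetBelow r x → Trail r x
  trail zero r x le ir x1 q@(qn , _ , _) = ⊥-elim (<-irrefl refl (<-≤-trans (≤-<-trans (m≤m+n r x) (n<1+n _)) (≤-trans qn (m∸n≡0⇒m≤n (n≤0⇒n≡0 le)))))
  trail (suc k) r x le ir x1 q with <-cmp x (rowLength (suc r))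
  ... | tri< lt _ _ = trail-under r x ir x1 q lt (trail k (suc r) x le' (≤-trans ir (n≤1+n r)) x1 (meet-under r x ir x1 q lt))
    where le' : n ∸ suc r ≤ k
          le' = ≤-trans (≤-reflexive (sym (pred[m∸n]≡m∸[1+n] n r))) (pred-mono-≤ le)
  ... | tri≈ _ eq _ = trail-hit r x ir x1 q eq
  ... | tri> _ _ gt = shiftOrContra x x1 q gt
    where
    le' : n ∸ suc r ≤ k
    le' = ≤-trans (≤-reflexive (sym (pred[m∸n]≡m∸[1+n] n r))) (pred-mono-≤ le)
    shiftOrContra : ∀ x → 1 ≤ x → MeetBelow r x → rowLength (suc r) < x → Trail r x
    shiftOrContra (suc x) x1 q gt with m≤n⇒m<n∨m≡n (≤-pred gt)
    ... | inj₂ eq = ⊥-elim (meet-pastEnd r (suc x) ir x1 q (cong suc (sym eq)))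
    ... | inj₁ Lx = trail-shift r x ir q Lx (trail k (suc r) x le' (≤-trans ir (n≤1+n r)) (≤-trans (s≤s z≤n) Lx) (meet-shift r x ir q Lx))

  theTrail : Trail i j
  theTrail = trail (n ∸ i) i j ≤-refl ≤-refl 1≤j (1+e≤n , below-a , below-b)

  S′ : Grid
  S′ = remove b l (insert i (suc j) S)

  S[i,j]≡false : S i j ≡ false
  S[i,j]≡false with S i j in eq
  ... | false = refl
  ... | true = ⊥-elim (<-irrefl refl (<-≤-trans rowLength<j (proj₁ (justifiedHere j 1≤j (n≤1+n j)) eq)))

  lChain : LChain S b l i (suc j) S′
  lChain = LChain-cong (trail-climb i j theTrail 1≤i S[i,j]≡false Si)
             (insert-remove-comm i (suc j) b l S (λ eq → <-irrefl eq (Trail.r<b theTrail)))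

  module LD = LineDiagram S n bounded

  l≡1+pred : l ≡ suc (pred l)
  l≡1+pred = sym (suc-pred l {{>-nonZero (Trail.1≤l theTrail)}})

  labels-at-crossing : ∀ l' → l ≡ suc l' → label S n b (suc l') fromBottom ≡ a × label S n b (suc l') fromLeft ≡ b
  labels-at-crossing l' e1 =
    trans (throughRow-fixʳ S b l' (below S n b) (suc (b + l')) ≤-refl) (trans (cong (below S n b) (trans (sym (+-suc b l')) (cong (b +_) (sym e1)))) (Trail.below-b+l theTrail)) ,
    trans (proj₁ (proj₂ cyc)) (below-fixˡ S n b b ≤-refl)
    where
    cyc : IsRotation b l' (below S n b) (throughRow S b l' (below S n b))
    cyc = throughFullRow-rotation S b l' (below S n b) (λ c c1 cl → justified-cross b c i<b c1 (subst (c ≤_) (sym e1) (≤-trans cl (n≤1+n l'))))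

  swapData' : ∀ l' → l ≡ suc l' → SwapData n S i (suc j) b (suc l')
  swapData' l' e1 = a , b ,
    (Si , LD.enters-lab i (suc j) fromLeft (1≤i , s≤s z≤n , ≤-trans i+j≤n (n≤1+n n)) , LD.enters-lab i (suc j) fromBottom (1≤i , s≤s z≤n , i+j≤n)) ,
    (subst (λ z → S b z ≡ true) e1 (justified-cross b l i<b (Trail.1≤l theTrail) ≤-refl) ,
     inj₂ (subst (λ t → Enters n S t (b , suc l') fromBottom) (proj₁ (labels-at-crossing l' e1)) (LD.enters-lab b (suc l') fromBottom rg) ,
           subst (λ t → Enters n S t (b , suc l') fromLeft) (proj₂ (labels-at-crossing l' e1)) (LD.enters-lab b (suc l') fromLeft (proj₁ rg , proj₁ (proj₂ rg) , ≤-trans (proj₂ (proj₂ rg)) (n≤1+n n)))))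
    where
    rg : InDiagram n b (suc l') fromBottom
    rg = ≤-trans (s≤s z≤n) i<b , s≤s z≤n , subst (λ z → b + z ≤ n) e1 (Trail.b+l≤n theTrail)

  swapData : SwapData n S i (suc j) b l
  swapData = subst (SwapData n S i (suc j) b) (sym l≡1+pred) (swapData' (pred l) l≡1+pred)

  labelsR⁺ : Labelling
  labelsR⁺ = throughRow R i (suc j) (below R n i)

  labelsR⁺-injective : IsInjective labelsR⁺
  labelsR⁺-injective = throughRow-injective R i (suc j) (below R n i) (below-injective R n i)

  labelsR⁺-a : labelsR⁺ e ≡ a
  labelsR⁺-a = trans (cong (λ h → h e) (throughTile-cross R i j labelsR Ri)) (trans (cong labelsR (transpose-matchˡ e)) labelsR-a)

  labelsR⁺-b : labelsR⁺ (suc e) ≡ b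
  labelsR⁺-b = trans (cong (λ h → h (suc e)) (throughTile-cross R i j labelsR Ri)) (trans (cong labelsR (transpose-matchʳ e)) labelsR-b)

  a-leftOf-b : LeftOf a b labelsR⁺
  a-leftOf-b p q pa qb = subst₂ _<_ (labelsR⁺-injective e p (trans labelsR⁺-a (sym pa))) (labelsR⁺-injective (suc e) q (trans labelsR⁺-b (sym qb))) (n<1+n e)

  EnteredByAB : ℕ → ℕ → Set
  EnteredByAB k c = (label S n k c fromLeft ≡ a × label S n k c fromBottom ≡ b)
                  ⊎ (label S n k c fromLeft ≡ b × label S n k c fromBottom ≡ a)

  no-meeting-cross-processed : ∀ k l3 → Processed i (suc j) k (suc l3) → S k (suc l3) ≡ true → ¬ EnteredByAB k (suc l3)
  no-meeting-cross-processed k l3 inp Skl labs = elim labs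
    where
    bd = bounded k (suc l3) Skl
    k1 : 1 ≤ k
    k1 = proj₁ bd
    kl : k + suc l3 ≤ n
    kl = proj₂ (proj₂ bd)
    kn : k < n
    kn = ≤-trans (s≤s (m≤m+n k l3)) (subst (_≤ n) (+-suc k l3) kl)
    l3n : l3 ≤ n ∸ k
    l3n = ≤-trans (n≤1+n l3) (+≤⇒≤∸ {k} kl)
    cond' : Processed i (suc j) k (suc l3) → (k < i × l3 ≤ n ∸ k) ⊎ (k ≡ i × suc j ≤ l3 × l3 ≤ n ∸ i)
    cond' (inj₁ ki) = inj₁ (ki , l3n)
    cond' (inj₂ (refl , jl)) = inj₂ (refl , ≤-pred jl , l3n)
    cond : (k < i × l3 ≤ n ∸ k) ⊎ (k ≡ i × suc j ≤ l3 × l3 ≤ n ∸ i)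
    cond = cond' inp
    lat = prefixWord-commonExtension S R n i (suc j) k l3 (<-trans i<e 1+e≤n) (+≤⇒≤∸ {i} i+j≤n) agrees cond
    M = proj₁ lat
    stk : throughRow S k l3 (below S n k) ≗ throughRow R k l3 (below R n k)
    stk p = trans (throughRow-below-word S n k l3 p) (trans (cong (λ z → applyWordF id z p) (proj₁ (proj₂ lat)))
              (trans (cong (λ h → h p) (applyWordF-++ id (prefixWord S n i (suc j)) M))
              (trans (applyWordF-cong M (λ q → trans (sym (throughRow-below-word S n i (suc j) q)) (trans (labelsAgree q) (throughRow-below-word R n i (suc j) q))) p)
              (trans (cong (λ h → h p) (sym (applyWordF-++ id (prefixWord R n i (suc j)) M)))
              (trans (cong (λ z → applyWordF id z p) (sym (proj₂ (proj₂ lat)))) (sym (throughRow-below-word R n k l3 p)))))))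
    Rkl : R k (suc l3) ≡ true
    Rkl = trans (sym (agrees k (suc l3) inp)) Skl
    dt = cross-descent k l3 k1 kl Rkl
    elim : EnteredByAB k (suc l3) → ⊥
    elim (inj₁ (la , lb)) = <-asym w[a]<w[b] (subst₂ (λ u v → at w u < at w v) (trans (sym (stk _)) lb) (trans (sym (stk _)) la) dt)
    elim (inj₂ (lb , la)) = <-irrefl refl (<-trans (al _ _ (trans (sym (stk _)) la) (trans (sym (stk _)) lb)) (n<1+n (k + l3)))
      where
      al0 : LeftOf a b (applyWordF id (prefixWord R n i (suc j)))
      al0 = leftOf-cong a b labelsR⁺ _ (throughRow-below-word R n i (suc j)) a-leftOf-b
      al1 : LeftOf a b (applyWordF id (prefixWord R n k l3))
      al1 = subst (LeftOf a b) (trans (sym (applyWordF-++ id (prefixWord R n i (suc j)) M)) (cong (applyWordF id) (sym (proj₂ (proj₂ lat)))))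
              (leftOf-descending a b _ M w[a]<w[b] al0 (descending-middle i (suc j) k l3 M k1 kn l3n (proj₂ (proj₂ lat))))
      al : LeftOf a b (throughRow R k l3 (below R n k))
      al = leftOf-cong a b _ _ (λ p → sym (throughRow-below-word R n k l3 p)) al1

  crossData⇒enteredByAB : ∀ k c → SwapData n S i (suc j) k c → EnteredByAB k c
  crossData⇒enteredByAB k c (a′ , b′ , (_ , a′-enters , b′-enters) , (_ , crossing)) = labels crossing
    where
    a≡a′ : a ≡ a′
    a≡a′ = proj₂ (LD.lab-enters a′ i (suc j) fromLeft a′-enters)
    b≡b′ : b ≡ b′
    b≡b′ = proj₂ (LD.lab-enters b′ i (suc j) fromBottom b′-enters)
    labels : _ → EnteredByAB k c
    labels (inj₁ (E1 , E2)) = inj₁ (trans (proj₂ (LD.lab-enters a′ k c fromLeft E1)) (sym a≡a′) ,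
                                    trans (proj₂ (LD.lab-enters b′ k c fromBottom E2)) (sym b≡b′))
    labels (inj₂ (E1 , E2)) = inj₂ (trans (proj₂ (LD.lab-enters b′ k c fromLeft E2)) (sym b≡b′) ,
                                    trans (proj₂ (LD.lab-enters a′ k c fromBottom E1)) (sym a≡a′))

  enteredByAB-unique : ∀ k l3 → S k (suc l3) ≡ true → EnteredByAB k (suc l3) → k ≡ b × suc l3 ≡ l
  enteredByAB-unique k l3 Skl labs = caseK (<-cmp i k)
    where
    LL = label S n k (suc l3) fromLeft
    LB = label S n k (suc l3) fromBottom
    kl : k + suc l3 ≤ n
    kl = proj₂ (proj₂ (bounded k (suc l3) Skl))
    uRow : ∀ L → LeftJustified S k (suc l3) L → suc l3 ≤ L → LL ≡ k × LB ≡ below S n k (suc (k + l3))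
    uRow L h le = trans (proj₁ (proj₂ cyc)) (below-fixˡ S n k k ≤-refl) , throughRow-fixʳ S k l3 (below S n k) (suc (k + l3)) ≤-refl
      where
      cyc : IsRotation k l3 (below S n k) (throughRow S k l3 (below S n k))
      cyc = throughFullRow-rotation S k l3 (below S n k) (λ c c1 cl → proj₂ (h c c1 (≤-trans cl (n≤1+n l3))) (≤-trans cl (≤-trans (n≤1+n l3) le)))
    caseK : Tri (i < k) (i ≡ k) (k < i) → k ≡ b × suc l3 ≡ l
    caseK (tri< ik _ _) = fin labs
      where
      le : suc l3 ≤ rowLength k
      le = proj₁ (justifiedBelow k ik (suc l3) (s≤s z≤n) (+≤⇒≤∸ {k} kl)) Skl
      u = uRow (rowLength k) (λ c c1 cl → justifiedBelow k ik c c1 (≤-trans cl (+≤⇒≤∸ {k} kl))) le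
      big : k < below S n k (suc (k + l3))
      big = proj₁ (below-mapsInto S n k (suc (k + l3)) (s≤s (m≤m+n k l3)) (subst (_≤ n) (+-suc k l3) kl))
      fin : EnteredByAB k (suc l3) → k ≡ b × suc l3 ≡ l
      fin (inj₁ (la , lb)) = ⊥-elim (<-asym b<a (subst₂ _<_ (trans (sym (proj₁ u)) la) (trans (sym (proj₂ u)) lb) big))
      fin (inj₂ (lb , la)) = kb , lfin
        where
        kb : k ≡ b
        kb = trans (sym (proj₁ u)) lb
        lfin : suc l3 ≡ l
        lfin = +-cancelˡ-≡ b _ _ (trans (+-suc b l3) (below-injective S n b _ _
                 (trans (subst (λ z → below S n z (suc (z + l3)) ≡ a) kb (trans (sym (proj₂ u)) la)) (sym (Trail.below-b+l theTrail)))))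
    caseK (tri≈ _ refl _) with suc l3 ≤? suc j
    ... | yes le = ⊥-elim (fin labs)
      where
      le2 : suc l3 ≤ rowLength i
      le2 = proj₁ (justifiedHere (suc l3) (s≤s z≤n) le) Skl
      u = uRow (rowLength i) (λ c c1 cl → justifiedHere c c1 (≤-trans cl le)) le2
      fin : EnteredByAB k (suc l3) → ⊥
      fin (inj₁ (la , _)) = <-irrefl (trans (sym (proj₁ u)) la) i<a
      fin (inj₂ (lb , _)) = <-irrefl (trans (sym (proj₁ u)) lb) i<b
    ... | no nle = ⊥-elim (no-meeting-cross-processed k l3 (inj₂ (refl , ≰⇒> nle)) Skl labs)
    caseK (tri> _ _ ki) = ⊥-elim (no-meeting-cross-processed k l3 (inj₁ ki) Skl labs)

  swapData-unique : ∀ k c → SwapData n S i (suc j) k c → k ≡ b × c ≡ l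
  swapData-unique k zero (_ , _ , _ , (Skc , _)) = ⊥-elim (<-irrefl refl (proj₁ (proj₂ (bounded k zero Skc))))
  swapData-unique k (suc c) sd@(_ , _ , _ , (Skc , _)) = enteredByAB-unique k c Skc (crossData⇒enteredByAB k (suc c) sd)

  bounded′ : Bounded n S′
  bounded′ x y t with (x ≡ᵇ b) ∧ (y ≡ᵇ l)
  ... | true = ⊥-elim (true≢false (sym t))
  ... | false with (x ≡ᵇ i) ∧ (y ≡ᵇ suc j) in e
  ...   | false = bounded x y t
  ...   | true with ≡ᵇ∧≡ᵇ⇒≡ x y i (suc j) e
  ...     | refl , refl = bR i (suc j) Ri

  S′-below : ∀ r c → i < r → S′ r c ≡ S⁻ r c
  S′-below r c ir = cong-rem
    where
    cong-rem : remove b l (insert i (suc j) S) r c ≡ remove b l S r c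
    cong-rem with (r ≡ᵇ b) ∧ (c ≡ᵇ l)
    ... | true = refl
    ... | false = insert-otherRow i (suc j) S r c (λ eq → <-irrefl (sym eq) ir)

  rowLength′ : ℕ → ℕ
  rowLength′ r = if r ≡ᵇ b then pred l else rowLength r

  rowLength′-b : rowLength′ b ≡ pred l
  rowLength′-b rewrite ≡ᵇ-refl b = refl

  rowLength′-other : ∀ r → r ≢ b → rowLength′ r ≡ rowLength r
  rowLength′-other r ne rewrite ≡ᵇ-≢ ne = refl

  S⁻-justified-b : LeftJustified S⁻ b (n ∸ b) (pred l)
  S⁻-justified-b = subst (λ z → LeftJustified (remove b z S) b (n ∸ b) (pred l)) (sym l≡1+pred)
                     (leftJustified-removeLast S b (n ∸ b) (pred l) (subst (LeftJustified S b (n ∸ b)) l≡1+pred (justifiedBelow b i<b)))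

  justifiedBelow′ : ∀ r → i < r → LeftJustified S′ r (n ∸ r) (rowLength′ r)
  justifiedBelow′ r ir c c1 cn rewrite S′-below r c ir with r ≟ b
  ... | no ne rewrite rowLength′-other r ne | S⁻-otherRow r c ne = justifiedBelow r ir c c1 cn
  ... | yes refl rewrite rowLength′-b = S⁻-justified-b c c1 cn

  rowLength≤′ : ∀ r → i < r → rowLength′ r ≤ n ∸ r
  rowLength≤′ r ir with r ≟ b
  ... | no ne rewrite rowLength′-other r ne = rowLength≤ r ir
  ... | yes refl rewrite rowLength′-b = ≤-trans (pred[n]≤n {l}) (rowLength≤ b ir)

  ≤i⇒≢b : ∀ r → r ≤ i → r ≢ b
  ≤i⇒≢b r ri eq = <-irrefl eq (≤-<-trans ri i<b)

  agrees′ : ∀ r c → Processed i j r c → S′ r c ≡ R r c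
  agrees′ r c (inj₁ ri) = trans (remove-otherRow b l (insert i (suc j) S) r c (≤i⇒≢b r (<⇒≤ ri))) (trans (insert-otherRow i (suc j) S r c (λ eq → <-irrefl eq ri)) (agrees r c (inj₁ ri)))
  agrees′ r c (inj₂ (refl , jc)) with m≤n⇒m<n∨m≡n jc
  ... | inj₂ refl = trans (remove-otherRow b l (insert i (suc j) S) r (suc j) (≤i⇒≢b r ≤-refl)) (trans (insert-here i (suc j) S) (sym Ri))
  ... | inj₁ lt = trans (remove-otherRow b l (insert i (suc j) S) r c (≤i⇒≢b r ≤-refl)) (trans (insert-otherCol i (suc j) S r c (λ eq → <-irrefl (sym eq) lt)) (agrees r c (inj₂ (refl , lt))))

  justifiedHere′ : LeftJustified S′ i j (rowLength′ i)
  justifiedHere′ c c1 cj rewrite rowLength′-other i (≤i⇒≢b i ≤-refl)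
    | remove-otherRow b l (insert i (suc j) S) i c (≤i⇒≢b i ≤-refl)
    | insert-otherCol i (suc j) S i c (λ eq → <-irrefl eq (s≤s cj)) = justifiedUpTo-j c c1 cj

  labelsAgree′ : throughRow S′ i j (below S′ n i) ≗ labelsR
  labelsAgree′ p = trans (throughRow-cong-grid S′ S i j _ (λ c c1 cj → trans (remove-otherRow b l (insert i (suc j) S) i c (≤i⇒≢b i ≤-refl)) (insert-otherCol i (suc j) S i c (λ eq → <-irrefl eq (s≤s cj)))) p)
           (trans (throughRow-cong S i j (λ q → trans (below-cong-grid S′ S⁻ n i (λ r2 c2 ir → S′-below r2 c2 ir) q) (Trail.below-S⁻ theTrail q)) p)
           (trans (rotation-shift i (rowLength i) (below S n i) labelsS _ e rotationHere
                     (leftJustified-rotation S i j (rowLength i) _ justifiedUpTo-j (empty⇒rowLength≤j Si)) (+-monoʳ-< i rowLength<j) p)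
           (trans (swapF-cong e labelsS-swap p) (swapF-involutive e labelsR p))))

  invariant-swap′ : Invariant n R S′ i j
  invariant-swap′ = record
    { 1≤i = 1≤i ; i+j≤n = ≤-trans (+-monoʳ-≤ i (n≤1+n j)) i+j≤n ; bounded = bounded′ ; agrees = agrees′
    ; rowLength = rowLength′ ; justifiedBelow = justifiedBelow′ ; rowLength≤ = rowLength≤′ ; justifiedHere = justifiedHere′
    ; rowLength≤j = subst (_≤ j) (sym (rowLength′-other i (≤i⇒≢b i ≤-refl))) (empty⇒rowLength≤j Si) ; labelsAgree = labelsAgree′ }

module Skip (n : ℕ) (w : List ℕ) (pw : w ↭ oneToN n) (R : Grid) (rc : IsRCGraph n w R)
             (S : Grid) (i j : ℕ) (inv : Invariant n R S i (suc j)) where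
  open AtTile n w pw R rc S i j inv

  invariant-skip-empty : R i (suc j) ≡ false → S i (suc j) ≡ false → Invariant n R S i j
  invariant-skip-empty Rf Sf = record
    { 1≤i = 1≤i ; i+j≤n = ≤-trans (+-monoʳ-≤ i (n≤1+n j)) i+j≤n ; bounded = bounded ; agrees = agrees-step (trans Sf (sym Rf))
    ; rowLength = rowLength ; justifiedBelow = justifiedBelow ; rowLength≤ = rowLength≤ ; justifiedHere = justifiedUpTo-j ; rowLength≤j = empty⇒rowLength≤j Sf ; labelsAgree = ct }
    where
    ct : labelsS ≗ labelsR
    ct p = trans (sym (cong (λ h → h p) (throughTile-empty S i j labelsS Sf))) (trans (labelsAgree p) (cong (λ h → h p) (throughTile-empty R i j labelsR Rf)))

  rowLength≡1+j : S i (suc j) ≡ true → rowLength i ≡ suc j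
  rowLength≡1+j St = ≤-antisym rowLength≤j (proj₁ (justifiedHere (suc j) (s≤s z≤n) ≤-refl) St)

  rotation-full : S i (suc j) ≡ true → IsRotation i j (below S n i) labelsS
  rotation-full St = throughFullRow-rotation S i j (below S n i) (λ c c1 cj → proj₂ (justifiedHere c c1 (m≤n⇒m≤1+n cj)) (subst (c ≤_) (sym (rowLength≡1+j St)) (m≤n⇒m≤1+n cj)))

  -- Row i of S is filled up to column j + 1, so line i leaves that tile to the right; without a
  -- cross there, R would send the line from below to the right instead.
  S-cross⇒R-cross : S i (suc j) ≡ true → R i (suc j) ≡ true
  S-cross⇒R-cross St with R i (suc j) in eq
  ... | true = refl
  ... | false = ⊥-elim (<-irrefl (sym i≡) labelsR-bottom)
    where
    i≡ : labelsR (suc e) ≡ i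
    i≡ = trans (sym (cong (λ h → h (suc e)) (throughTile-empty R i j labelsR eq)))
           (trans (sym (labelsAgree (suc e))) (trans (cong (λ h → h (suc e)) (throughTile-cross S i j labelsS St))
             (trans (cong labelsS (transpose-matchʳ e)) (trans (proj₁ (proj₂ (rotation-full St))) (below-fixˡ S n i i ≤-refl)))))

  invariant-skip-cross : S i (suc j) ≡ true → Invariant n R S i j
  invariant-skip-cross St = record
    { 1≤i = 1≤i ; i+j≤n = ≤-trans (+-monoʳ-≤ i (n≤1+n j)) i+j≤n ; bounded = bounded ; agrees = agrees-step (trans St (sym Rt))
    ; rowLength = rowLength′ ; justifiedBelow = ru ; rowLength≤ = lu ; justifiedHere = ri ; rowLength≤j = subst (_≤ j) (sym l2i) ≤-refl ; labelsAgree = ct }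
    where
    Rt = S-cross⇒R-cross St
    rowLength′ : ℕ → ℕ
    rowLength′ r = if r ≡ᵇ i then j else rowLength r
    l2i : rowLength′ i ≡ j
    l2i rewrite ≡ᵇ-refl i = refl
    l2o : ∀ r → i < r → rowLength′ r ≡ rowLength r
    l2o r ir rewrite ≡ᵇ-≢ {r} {i} (λ eq → <-irrefl (sym eq) ir) = refl
    ru : ∀ r → i < r → LeftJustified S r (n ∸ r) (rowLength′ r)
    ru r ir rewrite l2o r ir = justifiedBelow r ir
    lu : ∀ r → i < r → rowLength′ r ≤ n ∸ r
    lu r ir rewrite l2o r ir = rowLength≤ r ir
    ri : LeftJustified S i j (rowLength′ i)
    ri c c1 cj rewrite l2i = (λ _ → cj) , (λ le → proj₂ (justifiedHere c c1 (m≤n⇒m≤1+n cj)) (subst (c ≤_) (sym (rowLength≡1+j St)) (m≤n⇒m≤1+n le)))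
    ct : labelsS ≗ labelsR
    ct p = trans (sym (swapF-involutive e labelsS p)) (trans (swapF-cong e (λ q → trans (sym (cong (λ h → h q) (throughTile-cross S i j labelsS St)))
             (trans (labelsAgree q) (cong (λ h → h q) (throughTile-cross R i j labelsR Rt)))) p) (swapF-involutive e labelsR p))

invariant-nextRow : ∀ n R S i → Bounded n R → Invariant n R S i 0 → suc i < n → Invariant n R S (suc i) (n ∸ suc i)
invariant-nextRow n R S i bR P lt = record
  { 1≤i = s≤s z≤n ; i+j≤n = ≤-reflexive (m+[n∸m]≡n (<⇒≤ lt)) ; bounded = bounded ; agrees = ag
  ; rowLength = rowLength ; justifiedBelow = λ r ir → justifiedBelow r (<-trans (n<1+n i) ir) ; rowLength≤ = λ r ir → rowLength≤ r (<-trans (n<1+n i) ir)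
  ; justifiedHere = justifiedBelow (suc i) (n<1+n i) ; rowLength≤j = rowLength≤ (suc i) (n<1+n i) ; labelsAgree = ct }
  where
  open Invariant P
  fb : ∀ (G : Grid) → Bounded n G → ∀ r c → (c ≡ 0 ⊎ r + c > n) → G r c ≡ false
  fb G bG r c h with G r c in eq
  ... | false = refl
  ... | true with h
  ...   | inj₁ refl = ⊥-elim (<-irrefl refl (proj₁ (proj₂ (bG r c eq))))
  ...   | inj₂ g = ⊥-elim (<-irrefl refl (<-≤-trans g (proj₂ (proj₂ (bG r c eq)))))
  ag : ∀ r c → Processed (suc i) (n ∸ suc i) r c → S r c ≡ R r c
  ag r c (inj₁ rs) with m≤n⇒m<n∨m≡n (≤-pred rs)
  ... | inj₁ ri = agrees r c (inj₁ ri)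
  ... | inj₂ refl with c
  ...   | zero = trans (fb S bounded r 0 (inj₁ refl)) (sym (fb R bR r 0 (inj₁ refl)))
  ...   | suc c2 = agrees r (suc c2) (inj₂ (refl , s≤s z≤n))
  ag r c (inj₂ (refl , gt)) = trans (fb S bounded r c (inj₂ g)) (sym (fb R bR r c (inj₂ g)))
    where g : n < suc i + c
          g = subst (_< suc i + c) (m+[n∸m]≡n (<⇒≤ lt)) (+-monoʳ-< (suc i) gt)
  ct : throughRow S (suc i) (n ∸ suc i) (below S n (suc i)) ≗ throughRow R (suc i) (n ∸ suc i) (below R n (suc i))
  ct p = trans (cong (λ h → h p) (sym (below-step S n i (<-trans (n<1+n i) lt))))
           (trans (labelsAgree p) (cong (λ h → h p) (below-step R n i (<-trans (n<1+n i) lt))))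

module Start (n : ℕ) (w : List ℕ) (pw : w ↭ oneToN n) (R : Grid) (rc : IsRCGraph n w R) where
  open Permutation n w pw

  bR : Bounded n R
  bR = proj₁ rc

  Rbot⇒1≤col : ∀ x y → Rbot w x y ≡ true → 1 ≤ y
  Rbot⇒1≤col x zero t = ⊥-elim (true≢false (sym t))
  Rbot⇒1≤col x (suc y) t = s≤s z≤n

  Rbot⇒1≤row : ∀ x y → 1 ≤ y → y ≤ codeAt w x → 1 ≤ x
  Rbot⇒1≤row zero y y1 yc = ⊥-elim (<-irrefl refl (≤-trans y1 yc))
  Rbot⇒1≤row (suc x) y _ _ = s≤s z≤n

  col≤n∸row⇒sum≤n : ∀ x y → 1 ≤ y → y ≤ n ∸ x → x + y ≤ n
  col≤n∸row⇒sum≤n x y y1 cle with x ≤? n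
  ... | yes xn = ≤-trans (+-monoʳ-≤ x cle) (≤-reflexive (m+[n∸m]≡n xn))
  ... | no nxn = ⊥-elim (<-irrefl refl (≤-trans y1 (≤-trans cle (≤-reflexive (m≤n⇒m∸n≡0 (<⇒≤ (≰⇒> nxn)))))))

  Rbot-bounded : Bounded n (Rbot w)
  Rbot-bounded x y t = Rbot⇒1≤row x y y1 yc , y1 , col≤n∸row⇒sum≤n x y y1 (≤-trans yc (code≤ x))
    where
    y1 = Rbot⇒1≤col x y t
    yc = proj₁ (Rbot-row-iff w x y y1) t

  Rbot-row0 : ∀ c → Rbot w 0 c ≡ false
  Rbot-row0 zero = refl
  Rbot-row0 (suc c) = refl

  bounded-outside : ∀ (G : Grid) → Bounded n G → ∀ r c → n < r + c → G r c ≡ false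
  bounded-outside G bG r c g with G r c in eq
  ... | false = refl
  ... | true = ⊥-elim (<-irrefl refl (<-≤-trans g (proj₂ (proj₂ (bG r c eq)))))

  R-row0 : ∀ c → R 0 c ≡ false
  R-row0 c with R 0 c in eq
  ... | false = refl
  ... | true = ⊥-elim (<-irrefl refl (proj₁ (bR 0 c eq)))

  top-labels-agree : below (Rbot w) n 0 ≗ below R n 0
  top-labels-agree zero = trans (below-fixˡ (Rbot w) n 0 0 z≤n) (sym (below-fixˡ R n 0 0 z≤n))
  top-labels-agree (suc p) with suc p ≤? n
  ... | no np = trans (below-fixʳ (Rbot w) n 0 (suc p) (≰⇒> np)) (sym (below-fixʳ R n 0 (suc p) (≰⇒> np)))
  ... | yes pn =
    let (a1 , a2) = below-mapsInto₁ (Rbot w) n 0 (suc p) (s≤s z≤n) pn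
        (b1 , b2) = below-mapsInto₁ R n 0 (suc p) (s≤s z≤n) pn
    in at-injective _ _ a1 a2 b1 b2 (trans (BottomGraph.Rbot-top n w pw (suc p) (s≤s z≤n) pn) (sym (ReducedDescents.R-top n w pw R rc (suc p) (s≤s z≤n) pn)))

  invariant-start : 2 ≤ n → Invariant n R (Rbot w) 1 (n ∸ 1)
  invariant-start n2 = record
    { 1≤i = s≤s z≤n ; i+j≤n = ≤-reflexive (m+[n∸m]≡n (≤-trans (s≤s z≤n) n2)) ; bounded = Rbot-bounded ; agrees = ag
    ; rowLength = codeAt w ; justifiedBelow = λ r _ → BottomGraph.Rbot-justified n w pw r ; rowLength≤ = λ r _ → code≤ r
    ; justifiedHere = BottomGraph.Rbot-justified n w pw 1 ; rowLength≤j = code≤ 1 ; labelsAgree = ct }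
    where
    ag : ∀ r c → Processed 1 (n ∸ 1) r c → Rbot w r c ≡ R r c
    ag zero c (inj₁ _) = trans (Rbot-row0 c) (sym (R-row0 c))
    ag (suc r) c (inj₁ (s≤s ()))
    ag r c (inj₂ (refl , gt)) = trans (bounded-outside (Rbot w) Rbot-bounded 1 c g) (sym (bounded-outside R bR 1 c g))
      where g : n < 1 + c
            g = subst (_< 1 + c) (m+[n∸m]≡n (≤-trans (s≤s z≤n) n2)) (s≤s gt)
    ct : throughRow (Rbot w) 1 (n ∸ 1) (below (Rbot w) n 1) ≗ throughRow R 1 (n ∸ 1) (below R n 1)
    ct p = trans (cong (λ h → h p) (sym (below-step (Rbot w) n 0 (≤-trans (s≤s z≤n) n2))))
             (trans (top-labels-agree p) (cong (λ h → h p) (below-step R n 0 (≤-trans (s≤s z≤n) n2))))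

rowsFrom : ℕ → ℕ → List Pos
rowsFrom n r = concatMap (λ i → map (λ j → (i , j)) (desc (n ∸ i))) (applyUpTo (λ x → r + x) (n ∸ r))

positionsAfter : ℕ → ℕ → ℕ → List Pos
positionsAfter n i j = map (λ c → (i , c)) (desc j) ++ rowsFrom n (suc i)

positions-eq : ∀ n → positions n ≡ rowsFrom n 1
positions-eq n = cong (concatMap (λ i → map (λ j → (i , j)) (desc (n ∸ i)))) (oneToN-applyUpTo (n ∸ 1))

rowsFrom-done : ∀ n r → n ≤ r → rowsFrom n r ≡ []
rowsFrom-done n r le rewrite m≤n⇒m∸n≡0 le = refl

rowsFrom-step : ∀ n r → r < n → rowsFrom n r ≡ (r , n ∸ r) ∷ positionsAfter n r (n ∸ suc r)
rowsFrom-step n r lt =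
  trans (cong (λ k → concatMap (λ i → map (λ j → (i , j)) (desc (n ∸ i))) (applyUpTo (λ x → r + x) k)) (m∸n≡1+[m∸1+n] n r lt))
  (trans (cong₂ (λ u v → concatMap (λ i → map (λ j → (i , j)) (desc (n ∸ i))) (u ∷ v)) (+-identityʳ r)
            (applyUpTo-cong _ (λ x → suc r + x) (n ∸ suc r) (λ x → +-suc r x)))
         (hd (n ∸ r) (n ∸ suc r) (m∸n≡1+[m∸1+n] n r lt)))
  where
  hd : ∀ m k → m ≡ suc k → map (λ j → (r , j)) (desc m) ++ rowsFrom n (suc r) ≡ (r , m) ∷ map (λ j → (r , j)) (desc k) ++ rowsFrom n (suc r)
  hd .(suc k) k refl = refl

module Run (n : ℕ) (w : List ℕ) (pw : w ↭ oneToN n) (R : Grid) (rc : IsRCGraph n w R) where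

  bR : Bounded n R
  bR = proj₁ rc

  Reached : Grid → List Pos → Set
  Reached S ps = (ps ≡ []) ⊎ Σ ℕ λ i → Σ ℕ λ j → (ps ≡ (i , suc j) ∷ positionsAfter n i j) × Invariant n R S i (suc j)

  reached-next : ∀ S i j → Invariant n R S i j → Reached S (positionsAfter n i j)
  reached-next S i (suc j) P = inj₂ (i , j , refl , P)
  reached-next S i zero P with suc i <? n
  ... | no nlt = inj₁ (rowsFrom-done n (suc i) (≮⇒≥ nlt))
  ... | yes lt = inj₂ (suc i , m , trans (rowsFrom-step n (suc i) lt) (cong (λ z → (suc i , z) ∷ positionsAfter n (suc i) m) sk) ,
                       subst (Invariant n R S (suc i)) sk (invariant-nextRow n R S i bR P lt))
    where
    m = n ∸ suc (suc i)
    sk : n ∸ suc i ≡ suc m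
    sk = m∸n≡1+[m∸1+n] n (suc i) lt

  reached-start : Reached (Rbot w) (positions n)
  reached-start with 1 <? n
  ... | no nlt = inj₁ (trans (positions-eq n) (rowsFrom-done n 1 (≮⇒≥ nlt)))
  ... | yes lt = inj₂ (1 , m , trans (positions-eq n) (trans (rowsFrom-step n 1 lt) (cong (λ z → (1 , z) ∷ positionsAfter n 1 m) sk)) ,
                       subst (Invariant n R (Rbot w) 1) sk (Start.invariant-start n w pw R rc lt))
    where
    m = n ∸ 2
    sk : n ∸ 1 ≡ suc m
    sk = m∸n≡1+[m∸1+n] n (suc 0) lt

  invariant-skip : ∀ S i j → Invariant n R S i (suc j) → (R i (suc j) ≡ true → S i (suc j) ≡ true) → Invariant n R S i j
  invariant-skip S i j P cond = bool-cases (S i (suc j))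
    (λ St → Skip.invariant-skip-cross n w pw R rc S i j P St)
    (λ Sf → bool-cases (R i (suc j)) (λ Rt → ⊥-elim (true≢false (trans (sym (cond Rt)) Sf))) (λ Rf → Skip.invariant-skip-empty n w pw R rc S i j P Rf Sf))

  invariant-swap : ∀ S i j k l → Invariant n R S i (suc j) → R i (suc j) ≡ true → S i (suc j) ≡ false → SwapData n S i (suc j) k l →
             Invariant n R (remove k l (insert i (suc j) S)) i j
  invariant-swap S i j k l P Rt Sf sd with Swap.swapData-unique n w pw R rc S i j P Rt Sf k l sd
  ... | refl , refl = Swap.invariant-swap′ n w pw R rc S i j P Rt Sf

  proc-reached : ∀ {S ps} → Proc n w R S ps → Reached S ps
  proc-reached start = reached-start
  proc-reached (skip {S} pr cond) with proc-reached pr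
  ... | inj₂ (i , j , refl , P) = reached-next S i j (invariant-skip S i j P cond)
  proc-reached (swap {S} k l pr Rt Sf sd) with proc-reached pr
  ... | inj₂ (i , j , refl , P) = reached-next _ i j (invariant-swap S i j k l P Rt Sf sd)

proposition2p3 : (n : ℕ) (w : List ℕ) → IsPerm n w →
    (R : Grid) → IsRCGraph n w R →
    (S : Grid) (i j : ℕ) (ps : List Pos) → Proc n w R S ((i , j) ∷ ps) →
    R i j ≡ true → S i j ≡ false →
    (Σ ℕ λ k → Σ ℕ λ l → SwapData n S i j k l) ×
    ((k l : ℕ) → SwapData n S i j k l → LChain S k l i j (remove k l (insert i j S)))
proposition2p3 n w pw R rc S i j ps pr Rij Sij with Run.proc-reached n w pw R rc pr
... | inj₂ (i , c , refl , inv) = (b , l , swapData) , chain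
  where
  open Swap n w pw R rc S i c inv Rij Sij
  chain : ∀ k l′ → SwapData n S i (suc c) k l′ → LChain S k l′ i (suc c) (remove k l′ (insert i (suc c) S))
  chain k l′ sd with swapData-unique k l′ sd
  ... | refl , refl = lChain
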